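{- For every $n\geq0$, the number of Dumont permutations of the second kind in $S_n$ avoiding $321$, the number of Dumont permutations (of the first kind) in $S_n$ avoiding $231$, and the number of Dumont permutations (of the first kind) in $S_n$ avoiding $312$ are all equal to the Catalan number $C_{\lfloor n/2\rfloor}$.
   Context: A permutation $\pi=\pi_1\cdots\pi_n\in S_n$ is a Dumont permutation of the first kind if every even entry $\pi_i$ is followed by a smaller entry ($i<n$ and $\pi_{i+1}<\pi_i$) and every odd entry $\pi_i$ is either last ($i=n$) or followed by a larger entry. It is a Dumont permutation of the second kind if $\pi_i<i$ for every even position $i$ and $\pi_i\geq i$ for every odd position $i$. The empty permutation is counted in both classes. $\pi$ avoids a (classical) pattern $\tau\in S_3$ if no subsequence of $\pi$ of length $3$ is order-isomorphic to $\tau$. $C_m=\frac1{m+1}\binom{2m}{m}$. -}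

module Defs where

open import Data.Nat using (ℕ; zero; suc; _+_; _*_; _∸_; _/_; _<?_; _≟_)
open import Data.Nat.Divisibility using (_∣_; _∣?_)
open import Data.Nat.Combinatorics using (_C_)
open import Data.Fin using (Fin; toℕ; _<_)
import Data.Fin as F
open import Data.Fin.Properties using (all?; any?)
open import Data.Vec using (Vec; lookup; []; _∷_)
open import Data.List using (List; []; _∷_; map; concatMap; length; filter)
open import Data.Product using (_×_; ∃; _,_)
open import Data.Sum using (_⊎_)
open import Relation.Nullary using (Dec; ¬_; yes; no)
open import Relation.Nullary.Decidable using (_×-dec_; _⊎-dec_; _→-dec_; ¬?)
open import Relation.Binary.PropositionalEquality using (_≡_)

catalan : ℕ → ℕ
catalan m = ((2 * m) C m) / suc m

-- A permutation π = π₁⋯πₙ ∈ S_n is a word w : Vec (Fin n) n which is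
-- injective; position i (1-based) is  toℕ i + 1, and the entry π_i
-- (1-based value) is  toℕ (lookup w i) + 1.

allVecs : ∀ {A : Set} → List A → (k : ℕ) → List (Vec A k)
allVecs xs zero    = [] ∷ []
allVecs xs (suc k) = concatMap (λ x → map (x ∷_) (allVecs xs k)) xs

allWords : (n : ℕ) → List (Vec (Fin n) n)
allWords n = allVecs (Data.List.allFin n) n

module _ {n : ℕ} (w : Vec (Fin n) n) where

  pos : Fin n → ℕ
  pos i = suc (toℕ i)

  val : Fin n → ℕ
  val i = suc (toℕ (lookup w i))

  IsPerm : Set
  IsPerm = ∀ i j → lookup w i ≡ lookup w j → i ≡ j

  Even Odd : ℕ → Set
  Even k = 2 ∣ k
  Odd  k = ¬ (2 ∣ k)

  Next : Fin n → Fin n → Set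
  Next i j = toℕ j ≡ suc (toℕ i)

  Last : Fin n → Set
  Last i = pos i ≡ n

  Dumont1 : Set
  Dumont1 = ∀ i →
      (Even (val i) → ∃ λ j → Next i j × (val j Data.Nat.< val i))
    × (Odd (val i) → Last i ⊎ (∃ λ j → Next i j × (val i Data.Nat.< val j)))

  Dumont2 : Set
  Dumont2 = ∀ i →
      (Even (pos i) → val i Data.Nat.< pos i)
    × (Odd (pos i) → pos i Data.Nat.≤ val i)

  Contains321 Contains231 Contains312 : Set
  Contains321 = ∃ λ i → ∃ λ j → ∃ λ k → i < j × j < k ×
    (val j Data.Nat.< val i × val k Data.Nat.< val j)
  Contains231 = ∃ λ i → ∃ λ j → ∃ λ k → i < j × j < k ×
    (val k Data.Nat.< val i × val i Data.Nat.< val j)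
  Contains312 = ∃ λ i → ∃ λ j → ∃ λ k → i < j × j < k ×
    (val j Data.Nat.< val k × val k Data.Nat.< val i)

  Avoids321 Avoids231 Avoids312 : Set
  Avoids321 = ¬ Contains321
  Avoids231 = ¬ Contains231
  Avoids312 = ¬ Contains312

module _ {n : ℕ} (w : Vec (Fin n) n) where

  isPerm? : Dec (IsPerm w)
  isPerm? = all? λ i → all? λ j → (lookup w i F.≟ lookup w j) →-dec (i F.≟ j)

  dumont1? : Dec (Dumont1 w)
  dumont1? = all? λ i →
      ((2 ∣? val w i) →-dec any? (λ j → (toℕ j ≟ suc (toℕ i)) ×-dec (val w j <? val w i)))
    ×-dec
      (¬? (2 ∣? val w i) →-dec ((pos w i ≟ n) ⊎-dec
          any? (λ j → (toℕ j ≟ suc (toℕ i)) ×-dec (val w i <? val w j))))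

  dumont2? : Dec (Dumont2 w)
  dumont2? = all? λ i →
      ((2 ∣? pos w i) →-dec (val w i <? pos w i))
    ×-dec (¬? (2 ∣? pos w i) →-dec (Data.Nat._≤?_ (pos w i) (val w i)))

  contains321? : Dec (Contains321 w)
  contains321? = any? λ i → any? λ j → any? λ k →
    (i F.<? j) ×-dec (j F.<? k) ×-dec (val w j <? val w i) ×-dec (val w k <? val w j)

  contains231? : Dec (Contains231 w)
  contains231? = any? λ i → any? λ j → any? λ k →
    (i F.<? j) ×-dec (j F.<? k) ×-dec (val w k <? val w i) ×-dec (val w i <? val w j)

  contains312? : Dec (Contains312 w)
  contains312? = any? λ i → any? λ j → any? λ k →
    (i F.<? j) ×-dec (j F.<? k) ×-dec (val w j <? val w k) ×-dec (val w k <? val w i)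

numD2av321 : ℕ → ℕ
numD2av321 n = length (filter (λ w → isPerm? w ×-dec dumont2? w ×-dec ¬? (contains321? w)) (allWords n))

numD1av231 : ℕ → ℕ
numD1av231 n = length (filter (λ w → isPerm? w ×-dec dumont1? w ×-dec ¬? (contains231? w)) (allWords n))

numD1av312 : ℕ → ℕ
numD1av312 n = length (filter (λ w → isPerm? w ×-dec dumont1? w ×-dec ¬? (contains312? w)) (allWords n))

{-# OPTIONS --safe #-}
-- For odd
-- length 2m + 1 the maximum is forced to be the last entry, which reduces to length 2m. In
-- length 2m all three classes satisfy the Catalan recursion. For 231, everything before the
-- maximum 2m + 2 lies below everything after it, and the Dumont conditions force the shape
-- α (2m+2) γ′ (2m+1). For 312, splitting at the entry 1 gives τ′ 2 1 σ′, where τ belongs to an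
-- auxiliary class (last entry even) obeying the same recursion. For 321, entries two positions
-- apart increase, so the permutation interleaves two increasing sequences; such pairs are
-- counted by ballot numbers, by removing the largest entry. Ballot numbers satisfy the Catalan
-- recursion through the first-return decomposition of Dyck words, and the reflection principle
-- gives ballot m 0 = C(2m, m) / (m + 1).
module Submission where

open import Defs
open import Data.Nat
open import Data.Nat.Properties
open import Data.Nat.Induction using (<-rec)
open import Data.Nat.Combinatorics using (_C_; nC1≡n; nCk≡nC[n∸k]; nCk+nC[k+1]≡[n+1]C[k+1])
open import Data.Nat.DivMod using (m*n/n≡m; m/n≡1+[m∸n]/n)
open import Data.Nat.Divisibility using (_∣_; divides; ∣-refl; ∣1⇒≡1; ∣m∣n⇒∣m+n; ∣m+n∣m⇒∣n)
open import Data.Nat.Tactic.RingSolver using (solve-∀)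
open import Data.Bool using (Bool; true; false)
open import Data.Parity.Base using (Parity; 0ℙ; 1ℙ; _⁻¹)
open import Data.Parity.Properties using (⁻¹-injective)
open import Data.Fin using (Fin; zero; suc; toℕ; fromℕ<)
import Data.Fin as Fin
import Data.Fin.Properties as Finₚ
open import Data.Vec using (Vec; []; _∷_; lookup)
open import Data.Maybe using (just; nothing)
import Data.Maybe as Maybe
open import Data.Maybe.Relation.Unary.All using (just; nothing; drop-just) renaming (All to AllMaybe)
open import Data.Maybe.Relation.Binary.Connected using (Connected; just; just-nothing; nothing-just; nothing)
open import Data.List
  using (List; []; _∷_; _++_; [_]; map; length; replicate; concatMap; filter; allFin; last; head; tabulate; initLast; _∷ʳ′_)
open import Data.List.Properties
  using (∷-injectiveʳ; last-map; length-tabulate; length-++; length-map; map-++; ++-assoc; ++-identityʳ; ++-cancelˡ; ∷-injective; ∷ʳ-injective)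
open import Data.List.Membership.Propositional using (_∈_; _∉_)
open import Data.List.Membership.Propositional.Properties
  using (∈-++⁺ˡ; ∈-++⁺ʳ; ∈-++⁻; ∈-map⁺; ∈-map⁻; ∈-∃++; ∈-filter⁺; ∈-filter⁻; ∈-allFin; ∈-concatMap⁺; ∈-tabulate⁺; ∈-tabulate⁻)
open import Data.List.Membership.Propositional.Properties.WithK using (unique∧set⇒bag)
open import Data.List.Membership.DecPropositional _≟_ using (_∈?_)
open import Data.List.Relation.Binary.BagAndSetEquality using (∼bag⇒↭)
open import Data.List.Relation.Unary.Any using (Any; here; there)
import Data.List.Relation.Unary.Any as Any
open import Data.List.Relation.Unary.All using (All; []; _∷_)
import Data.List.Relation.Unary.All as All
open import Data.List.Relation.Unary.All.Properties using (All¬⇒¬Any) renaming (tabulate⁻ to All-tabulate⁻)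
open import Data.List.Relation.Unary.Unique.Propositional using (Unique; []; _∷_)
import Data.List.Relation.Unary.Unique.Propositional.Properties as Unique
import Data.List.Relation.Unary.Unique.Setoid.Properties as Uniqueₛ
open import Data.List.Relation.Unary.Linked using (Linked; []; [-]; _∷_)
import Data.List.Relation.Unary.Linked as Linked
import Data.List.Relation.Unary.Linked.Properties as Linkedₚ
open import Data.List.Relation.Binary.Sublist.Propositional
  using (_⊆_; []; _∷_; _∷ʳ_; ⊆-refl; ⊆-trans; minimum; from∈) renaming (lookup to ⊆-lookup)
import Data.List.Relation.Binary.Sublist.Propositional.Properties as Sublist
open import Data.List.Relation.Binary.Permutation.Propositional
  using (_↭_; ↭-refl; ↭-sym; ↭-trans; ↭-reflexive; ↭-prep; ↭-swap; ↭⇒↭ₛ; module PermutationReasoning)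
open import Data.List.Relation.Binary.Permutation.Propositional.Properties
  using (↭-length; ↭-empty-inv; ∈-resp-↭; drop-mid; shift; ∷↭∷ʳ; ↭-map-inv; ++⁺ʳ; ++⁺ˡ) renaming (++-comm to ↭-++-comm; map⁺ to ↭-map⁺)
import Data.List.Relation.Binary.Permutation.Setoid.Properties as Permₛ
open import Data.List.Relation.Ternary.Interleaving using ([]; swap)
open import Data.List.Relation.Ternary.Interleaving.Propositional using (Interleaving; consˡ; consʳ; toPermutation)
open import Data.Product using (∃; _×_; _,_; proj₁; proj₂)
open import Data.Product.Properties using (,-injectiveˡ; ,-injectiveʳ)
open import Data.Sum using (_⊎_; inj₁; inj₂)
open import Data.Empty using (⊥; ⊥-elim)
open import Data.Unit using (⊤; tt)
open import Function using (case_of_)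
open import Function.Bundles using (mk⇔)
open import Relation.Nullary using (¬_; Dec; yes; no)
open import Relation.Nullary.Decidable using (_×-dec_; ¬?)
open import Relation.Binary.PropositionalEquality
  using (_≡_; _≢_; refl; sym; trans; cong; cong₂; subst; subst₂; setoid; module ≡-Reasoning)

record Enumeration {A : Set} (P : A → Set) (size : ℕ) : Set where
  constructor enumeration
  field
    elements        : List A
    distinct        : Unique elements
    sound           : ∀ {x} → x ∈ elements → P x
    complete        : ∀ {x} → P x → x ∈ elements
    length-elements : length elements ≡ size
open Enumeration

module _ {A : Set} where

  enum-⇔ : ∀ {P Q : A → Set} {c} → (∀ {x} → P x → Q x) → (∀ {x} → Q x → P x) → Enumeration P c → Enumeration Q c
  enum-⇔ f g e = enumeration (elements e) (distinct e) (λ x∈ → f (sound e x∈)) (λ qx → complete e (g qx)) (length-elements e)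

  enum-cast : ∀ {P : A → Set} {c d} → c ≡ d → Enumeration P c → Enumeration P d
  enum-cast refl e = e

  enum-size-unique : ∀ {P : A → Set} {c d} → Enumeration P c → Enumeration P d → c ≡ d
  enum-size-unique e f = begin
    _                       ≡⟨ sym (length-elements e) ⟩
    length (elements e)     ≡⟨ ↭-length (∼bag⇒↭ same-bag) ⟩
    length (elements f)     ≡⟨ length-elements f ⟩
    _                       ∎
    where
    open ≡-Reasoning
    same-bag = unique∧set⇒bag (distinct e) (distinct f) (mk⇔ (λ x∈ → complete f (sound e x∈)) (λ x∈ → complete e (sound f x∈)))

  enum-∅ : ∀ {P : A → Set} → (∀ {x} → ¬ P x) → Enumeration P 0
  enum-∅ ¬P = enumeration [] [] (λ ()) (λ p → ⊥-elim (¬P p)) refl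

  enum-singleton : ∀ {P : A → Set} (a : A) → P a → (∀ {x} → P x → x ≡ a) → Enumeration P 1
  enum-singleton a pa only-a = enumeration [ a ] ([] ∷ []) (λ { (here refl) → pa }) (λ p → here (only-a p)) refl

  enum-⊎ : ∀ {P Q : A → Set} {c d} → Enumeration P c → Enumeration Q d → (∀ {x} → P x → ¬ Q x) →
           Enumeration (λ x → P x ⊎ Q x) (c + d)
  enum-⊎ {P} {Q} e f disjoint = enumeration (elements e ++ elements f)
    (Unique.++⁺ (distinct e) (distinct f) (λ (x∈e , x∈f) → disjoint (sound e x∈e) (sound f x∈f)))
    sound-++ complete-++ (trans (length-++ (elements e)) (cong₂ _+_ (length-elements e) (length-elements f)))
    where
    sound-++ : ∀ {x} → x ∈ elements e ++ elements f → P x ⊎ Q x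
    sound-++ x∈ with ∈-++⁻ (elements e) x∈
    ... | inj₁ x∈e = inj₁ (sound e x∈e)
    ... | inj₂ x∈f = inj₂ (sound f x∈f)
    complete-++ : ∀ {x} → P x ⊎ Q x → x ∈ elements e ++ elements f
    complete-++ (inj₁ px) = ∈-++⁺ˡ (complete e px)
    complete-++ (inj₂ qx) = ∈-++⁺ʳ (elements e) (complete f qx)

module _ {A B : Set} where

  map-unique : ∀ {P : A → Set} (f : A → B) → (∀ {x y} → P x → P y → f x ≡ f y → x ≡ y) →
               ∀ {xs} → All P xs → Unique xs → Unique (map f xs)
  map-unique f inj [] [] = []
  map-unique {P} f inj {x ∷ xs} (px ∷ pxs) (x∉xs ∷ u) = images-differ pxs x∉xs ∷ map-unique f inj pxs u
    where
    images-differ : ∀ {ys} → All P ys → All (x ≢_) ys → All (f x ≢_) (map f ys)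
    images-differ [] [] = []
    images-differ (py ∷ pys) (x≢y ∷ x≢ys) = (λ fx≡fy → x≢y (inj px py fx≡fy)) ∷ images-differ pys x≢ys

  enum-image : ∀ {P : A → Set} {c} (f : A → B) → (∀ {x y} → P x → P y → f x ≡ f y → x ≡ y) →
               Enumeration P c → Enumeration (λ y → ∃ λ x → P x × y ≡ f x) c
  enum-image f inj e = enumeration (map f (elements e))
    (map-unique f inj (All.tabulate (sound e)) (distinct e))
    (λ y∈ → let (x , x∈ , y≡fx) = ∈-map⁻ f y∈ in x , sound e x∈ , y≡fx)
    (λ { (x , px , refl) → ∈-map⁺ f (complete e px) })
    (trans (length-map f (elements e)) (length-elements e))

module _ {A B : Set} where

  enum-× : ∀ {P : A → Set} {Q : B → Set} {c d} → Enumeration P c → Enumeration Q d →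
           Enumeration (λ (p : A × B) → P (proj₁ p) × Q (proj₂ p)) (c * d)
  enum-× {P} {Q} {c} {d} e f = enum-cast (cong (_* d) (length-elements e))
    (enum-⇔ (λ (x∈ , qy) → sound e x∈ , qy) (λ (px , qy) → complete e px , qy) (pairs (elements e) (distinct e)))
    where
    pairs : (xs : List A) → Unique xs → Enumeration (λ (p : A × B) → proj₁ p ∈ xs × Q (proj₂ p)) (length xs * d)
    pairs [] _ = enum-∅ (λ { (() , _) })
    pairs (x ∷ xs) (x∉xs ∷ u) = enum-⇔ to from (enum-⊎ (enum-image (x ,_) (λ _ _ → cong proj₂) f) (pairs xs u) disjoint)
      where
      disjoint : ∀ {p} → (∃ λ y → Q y × p ≡ (x , y)) → ¬ (proj₁ p ∈ xs × Q (proj₂ p))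
      disjoint (y , _ , refl) (x∈xs , _) = All¬⇒¬Any x∉xs x∈xs
      to : ∀ {p} → (∃ λ y → Q y × p ≡ (x , y)) ⊎ (proj₁ p ∈ xs × Q (proj₂ p)) → proj₁ p ∈ x ∷ xs × Q (proj₂ p)
      to (inj₁ (y , qy , refl)) = here refl , qy
      to (inj₂ (a∈xs , qb)) = there a∈xs , qb
      from : ∀ {p} → proj₁ p ∈ x ∷ xs × Q (proj₂ p) → (∃ λ y → Q y × p ≡ (x , y)) ⊎ (proj₁ p ∈ xs × Q (proj₂ p))
      from {a , b} (here refl , qb) = inj₁ (b , qb , refl)
      from (there a∈xs , qb) = inj₂ (a∈xs , qb)

sumBelow : ℕ → (ℕ → ℕ) → ℕ
sumBelow zero    f = 0
sumBelow (suc k) f = sumBelow k f + f k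

module _ {A : Set} where

  enum-⋃ : (F : ℕ → A → Set) (cnt : ℕ → ℕ) (k : ℕ) → (∀ j → j < k → Enumeration (F j) (cnt j)) →
           (∀ {i j x} → i < k → j < k → F i x → F j x → i ≡ j) →
           Enumeration (λ x → ∃ λ j → j < k × F j x) (sumBelow k cnt)
  enum-⋃ F cnt zero    _  _        = enum-∅ (λ { (_ , () , _) })
  enum-⋃ F cnt (suc k) es disjoint = enum-⇔ to from (enum-⊎ below (es k ≤-refl) apart)
    where
    below : Enumeration (λ x → ∃ λ j → j < k × F j x) (sumBelow k cnt)
    below = enum-⋃ F cnt k (λ j j<k → es j (m<n⇒m<1+n j<k))
                           (λ i<k j<k → disjoint (m<n⇒m<1+n i<k) (m<n⇒m<1+n j<k))
    apart : ∀ {x} → (∃ λ j → j < k × F j x) → ¬ F k x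
    apart (j , j<k , fj) fk = <-irrefl (disjoint (m<n⇒m<1+n j<k) ≤-refl fj fk) j<k
    to : ∀ {x} → (∃ λ j → j < k × F j x) ⊎ F k x → ∃ λ j → j < suc k × F j x
    to (inj₁ (j , j<k , fj)) = j , m<n⇒m<1+n j<k , fj
    to (inj₂ fk) = k , ≤-refl , fk
    from : ∀ {x} → (∃ λ j → j < suc k × F j x) → (∃ λ j → j < k × F j x) ⊎ F k x
    from (j , j<1+k , fj) with m<1+n⇒m<n∨m≡n j<1+k
    ... | inj₁ j<k  = inj₁ (j , j<k , fj)
    ... | inj₂ refl = inj₂ fj

  Glued : (P Q : ℕ → A → Set) (glue : ℕ → A → A → A) → ℕ → A → Set
  Glued P Q glue j x = ∃ λ a → ∃ λ b → P j a × Q j b × x ≡ glue j a b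

  enum-Glued : (P Q : ℕ → A → Set) (cP cQ : ℕ → ℕ) (glue : ℕ → A → A → A) (k : ℕ) →
               (∀ j → j < k → Enumeration (P j) (cP j)) → (∀ j → j < k → Enumeration (Q j) (cQ j)) →
               (∀ {i j a b a′ b′} → i < k → j < k → P i a → Q i b → P j a′ → Q j b′ →
                  glue i a b ≡ glue j a′ b′ → i ≡ j × a ≡ a′ × b ≡ b′) →
               Enumeration (λ x → ∃ λ j → j < k × Glued P Q glue j x) (sumBelow k (λ j → cP j * cQ j))
  enum-Glued P Q cP cQ glue k eP eQ inj = enum-⋃ (Glued P Q glue) (λ j → cP j * cQ j) k layer same-layer
    where
    layer : ∀ j → j < k → Enumeration (Glued P Q glue j) (cP j * cQ j)
    layer j j<k = enum-⇔ to from (enum-image (λ (p : A × A) → glue j (proj₁ p) (proj₂ p)) inj-j (enum-× (eP j j<k) (eQ j j<k)))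
      where
      inj-j : ∀ {x y : A × A} → P j (proj₁ x) × Q j (proj₂ x) → P j (proj₁ y) × Q j (proj₂ y) →
              glue j (proj₁ x) (proj₂ x) ≡ glue j (proj₁ y) (proj₂ y) → x ≡ y
      inj-j (pa , qb) (pa′ , qb′) eq with inj j<k j<k pa qb pa′ qb′ eq
      ... | _ , refl , refl = refl
      to : ∀ {x} → (∃ λ (p : A × A) → (P j (proj₁ p) × Q j (proj₂ p)) × x ≡ glue j (proj₁ p) (proj₂ p)) → Glued P Q glue j x
      to ((a , b) , (pa , qb) , eq) = a , b , pa , qb , eq
      from : ∀ {x} → Glued P Q glue j x → ∃ λ (p : A × A) → (P j (proj₁ p) × Q j (proj₂ p)) × x ≡ glue j (proj₁ p) (proj₂ p)
      from (a , b , pa , qb , eq) = (a , b) , (pa , qb) , eq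
    same-layer : ∀ {i j x} → i < k → j < k → Glued P Q glue i x → Glued P Q glue j x → i ≡ j
    same-layer i<k j<k (_ , _ , pa , qb , refl) (_ , _ , pa′ , qb′ , eq) = proj₁ (inj i<k j<k pa qb pa′ qb′ eq)

C-absorption : ∀ n k → suc k * (suc n C suc k) ≡ suc n * (n C k)
C-absorption zero    zero    = refl
C-absorption zero    (suc k) = *-zeroʳ (suc (suc k))
C-absorption (suc n) zero    = trans (+-identityʳ _) (trans (nC1≡n (suc (suc n))) (sym (*-identityʳ _)))
C-absorption (suc n) (suc k) = begin
  suc (suc k) * (suc (suc n) C suc (suc k))
    ≡⟨ cong (suc (suc k) *_) (sym (pascal (suc n) (suc k))) ⟩
  suc (suc k) * (suc n C suc k + suc n C suc (suc k))
    ≡⟨ *-distribˡ-+ (suc (suc k)) (suc n C suc k) _ ⟩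
  (suc n C suc k + suc k * (suc n C suc k)) + suc (suc k) * (suc n C suc (suc k))
    ≡⟨ cong₂ (λ a b → (suc n C suc k + a) + b) (C-absorption n k) (C-absorption n (suc k)) ⟩
  (suc n C suc k + suc n * (n C k)) + suc n * (n C suc k)
    ≡⟨ +-assoc (suc n C suc k) _ _ ⟩
  suc n C suc k + (suc n * (n C k) + suc n * (n C suc k))
    ≡⟨ cong (suc n C suc k +_) (sym (*-distribˡ-+ (suc n) (n C k) _)) ⟩
  suc n C suc k + suc n * (n C k + n C suc k)
    ≡⟨ cong (λ c → suc n C suc k + suc n * c) (pascal n k) ⟩
  suc (suc n) * (suc n C suc k) ∎
  where
  open ≡-Reasoning
  pascal : ∀ n k → n C k + n C suc k ≡ suc n C suc k
  pascal = nCk+nC[k+1]≡[n+1]C[k+1]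

C-middle-symmetric : ∀ u → suc (2 * u) C suc u ≡ suc (2 * u) C u
C-middle-symmetric u = trans (nCk≡nC[n∸k] (s≤s (m≤m+n u _))) (cong (suc (2 * u) C_) complement)
  where
  complement : suc (2 * u) ∸ suc u ≡ u
  complement = trans (cong (λ z → (u + z) ∸ u) (+-identityʳ u)) (m+n∸m≡n u u)

-- ballot u h counts the ±1 walks with u up-steps and u + h down-steps that go from height h to 0
-- without dropping below 0.
ballot : ℕ → ℕ → ℕ
ballot zero    h       = 1
ballot (suc u) zero    = ballot u 1
ballot (suc u) (suc h) = ballot u (suc (suc h)) + ballot (suc u) h

-- The walks that do drop below 0, counted by reflection in the line −1.
reflected : ℕ → ℕ → ℕ
reflected zero    h = 0
reflected (suc u) h = (2 * suc u + h) C u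

pascal-reflected : ∀ u h → suc (2 * u + h) C u ≡ reflected u h + (2 * u + h) C u
pascal-reflected zero    h = refl
pascal-reflected (suc u) h = sym (nCk+nC[k+1]≡[n+1]C[k+1] (2 * suc u + h) u)

ballot+reflected : ∀ u h → ballot u h + reflected u h ≡ (2 * u + h) C u
ballot+reflected zero    h       = refl
ballot+reflected (suc u) zero    = begin
  ballot u 1 + (2 * suc u + 0) C u         ≡⟨ cong (λ n → ballot u 1 + n C u) (e₁ u) ⟩
  ballot u 1 + suc (2 * u + 1) C u         ≡⟨ cong (ballot u 1 +_) (pascal-reflected u 1) ⟩
  ballot u 1 + (reflected u 1 + (2 * u + 1) C u)
                                           ≡⟨ sym (+-assoc (ballot u 1) _ _) ⟩
  (ballot u 1 + reflected u 1) + (2 * u + 1) C u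
                                           ≡⟨ cong (_+ (2 * u + 1) C u) (ballot+reflected u 1) ⟩
  (2 * u + 1) C u + (2 * u + 1) C u        ≡⟨ cong (λ n → n C u + n C u) (e₂ u) ⟩
  suc (2 * u) C u + suc (2 * u) C u        ≡⟨ cong (suc (2 * u) C u +_) (sym (C-middle-symmetric u)) ⟩
  suc (2 * u) C u + suc (2 * u) C suc u    ≡⟨ nCk+nC[k+1]≡[n+1]C[k+1] (suc (2 * u)) u ⟩
  suc (suc (2 * u)) C suc u                ≡⟨ cong (_C suc u) (e₃ u) ⟩
  (2 * suc u + 0) C suc u                  ∎
  where
  open ≡-Reasoning
  e₁ : ∀ u → 2 * suc u + 0 ≡ suc (2 * u + 1)
  e₁ = solve-∀
  e₂ : ∀ u → 2 * u + 1 ≡ suc (2 * u)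
  e₂ = solve-∀
  e₃ : ∀ u → suc (suc (2 * u)) ≡ 2 * suc u + 0
  e₃ = solve-∀
ballot+reflected (suc u) (suc h) = begin
  (ballot u (2 + h) + ballot (suc u) h) + (2 * suc u + suc h) C u
    ≡⟨ cong (λ n → (ballot u (2 + h) + ballot (suc u) h) + n C u) (e₁ u h) ⟩
  (ballot u (2 + h) + ballot (suc u) h) + suc (2 * u + (2 + h)) C u
    ≡⟨ cong ((ballot u (2 + h) + ballot (suc u) h) +_) (pascal-reflected u (2 + h)) ⟩
  (ballot u (2 + h) + ballot (suc u) h) + (reflected u (2 + h) + (2 * u + (2 + h)) C u)
    ≡⟨ interchange (ballot u (2 + h)) (ballot (suc u) h) (reflected u (2 + h)) _ ⟩
  (ballot u (2 + h) + reflected u (2 + h)) + (ballot (suc u) h + (2 * u + (2 + h)) C u)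
    ≡⟨ cong₂ _+_ (ballot+reflected u (2 + h))
                 (trans (cong (λ n → ballot (suc u) h + n C u) (sym (e₂ u h))) (ballot+reflected (suc u) h)) ⟩
  (2 * u + (2 + h)) C u + (2 * suc u + h) C suc u
    ≡⟨ cong (λ n → (2 * u + (2 + h)) C u + n C suc u) (e₂ u h) ⟩
  (2 * u + (2 + h)) C u + (2 * u + (2 + h)) C suc u
    ≡⟨ nCk+nC[k+1]≡[n+1]C[k+1] _ u ⟩
  suc (2 * u + (2 + h)) C suc u
    ≡⟨ cong (_C suc u) (sym (e₁ u h)) ⟩
  (2 * suc u + suc h) C suc u ∎
  where
  open ≡-Reasoning
  e₁ : ∀ u h → 2 * suc u + suc h ≡ suc (2 * u + (2 + h))
  e₁ = solve-∀
  e₂ : ∀ u h → 2 * suc u + h ≡ 2 * u + (2 + h)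
  e₂ = solve-∀
  interchange : ∀ a b c d → (a + b) + (c + d) ≡ (a + c) + (b + d)
  interchange = solve-∀

reflected-central : ∀ m → reflected m 0 * suc m ≡ m * ((2 * m + 0) C m)
reflected-central zero    = refl
reflected-central (suc u) = begin
  ((2 * suc u + 0) C u) * suc (suc u)               ≡⟨ *-comm ((2 * suc u + 0) C u) (suc (suc u)) ⟩
  suc (suc u) * ((2 * suc u + 0) C u)               ≡⟨ cong (λ n → suc (suc u) * (n C u)) (e u) ⟩
  suc (suc u) * (suc (suc (2 * u)) C u)             ≡⟨ cong (suc (suc u) *_) symmetric ⟩
  suc (suc u) * (suc (suc (2 * u)) C suc (suc u))   ≡⟨ C-absorption (suc (2 * u)) (suc u) ⟩
  suc (suc (2 * u)) * (suc (2 * u) C suc u)         ≡⟨ cong (suc (suc (2 * u)) *_) (C-middle-symmetric u) ⟩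
  suc (suc (2 * u)) * (suc (2 * u) C u)             ≡⟨ sym (C-absorption (suc (2 * u)) u) ⟩
  suc u * (suc (suc (2 * u)) C suc u)               ≡⟨ cong (λ n → suc u * (n C suc u)) (sym (e u)) ⟩
  suc u * ((2 * suc u + 0) C suc u)                 ∎
  where
  open ≡-Reasoning
  e : ∀ u → 2 * suc u + 0 ≡ suc (suc (2 * u))
  e = solve-∀
  e′ : ∀ u → suc (suc (2 * u)) ≡ u + suc (suc u)
  e′ = solve-∀
  symmetric : suc (suc (2 * u)) C u ≡ suc (suc (2 * u)) C suc (suc u)
  symmetric = trans (nCk≡nC[n∸k] (m≤n⇒m≤1+n (m≤n⇒m≤1+n (m≤m+n u _))))
                    (cong (suc (suc (2 * u)) C_) (trans (cong (_∸ u) (e′ u)) (m+n∸m≡n u (suc (suc u)))))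

-- reflected m 0 = C(2m, m − 1) = m · C(2m, m) / (m + 1), so (m + 1) · ballot m 0 = C(2m, m).
catalan≡ballot : ∀ m → catalan m ≡ ballot m 0
catalan≡ballot m = trans (cong (_/ suc m) (sym ballot·[1+m])) (m*n/n≡m (ballot m 0) (suc m))
  where
  open ≡-Reasoning
  central : ℕ
  central = (2 * m + 0) C m
  ballot·[1+m]+m·central : ballot m 0 * suc m + m * central ≡ central + m * central
  ballot·[1+m]+m·central = begin
    ballot m 0 * suc m + m * central           ≡⟨ cong (ballot m 0 * suc m +_) (sym (reflected-central m)) ⟩
    ballot m 0 * suc m + reflected m 0 * suc m ≡⟨ sym (*-distribʳ-+ (suc m) (ballot m 0) _) ⟩
    (ballot m 0 + reflected m 0) * suc m       ≡⟨ cong (_* suc m) (ballot+reflected m 0) ⟩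
    central * suc m                            ≡⟨ *-comm central (suc m) ⟩
    central + m * central                      ∎
  ballot·[1+m] : ballot m 0 * suc m ≡ 2 * m C m
  ballot·[1+m] = trans (+-cancelʳ-≡ (m * central) _ _ ballot·[1+m]+m·central) (cong (_C m) (+-identityʳ (2 * m)))

-- Reading true as a step up and false as a step down, xs walks from height s to height e without going below 0.
Walk : ℕ → ℕ → List Bool → Set
Walk s       e []           = s ≡ e
Walk s       e (true ∷ xs)  = Walk (suc s) e xs
Walk zero    e (false ∷ xs) = ⊥
Walk (suc s) e (false ∷ xs) = Walk s e xs

Walk-lift : ∀ k s e xs → Walk s e xs → Walk (k + s) (k + e) xs
Walk-lift k s e [] refl = refl
Walk-lift k s e (true ∷ xs) w = subst (λ t → Walk t (k + e) xs) (+-suc k s) (Walk-lift k (suc s) e xs w)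
Walk-lift k (suc s) e (false ∷ xs) w = subst (λ t → Walk t (k + e) (false ∷ xs)) (sym (+-suc k s)) (Walk-lift k s e xs w)

Walk-++ : ∀ s m e xs ys → Walk s m xs → Walk m e ys → Walk s e (xs ++ ys)
Walk-++ s m e [] ys refl w = w
Walk-++ s m e (true ∷ xs) ys w₁ w₂ = Walk-++ (suc s) m e xs ys w₁ w₂
Walk-++ (suc s) m e (false ∷ xs) ys w₁ w₂ = Walk-++ s m e xs ys w₁ w₂

Walk-length : ∀ s e xs → Walk s e xs → ∃ λ d → length xs + s ≡ e + 2 * d
Walk-length s e [] refl = 0 , sym (+-identityʳ s)
Walk-length s e (true ∷ xs) w with Walk-length (suc s) e xs w
... | d , eq = d , trans (sym (+-suc (length xs) s)) eq
Walk-length (suc s) e (false ∷ xs) w with Walk-length s e xs w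
... | d , eq = suc d , trans (cong suc (+-suc (length xs) s)) (trans (cong (λ n → suc (suc n)) eq) (shape e d))
  where
  shape : ∀ e d → suc (suc (e + 2 * d)) ≡ e + 2 * suc d
  shape = solve-∀

Walk-start≤ : ∀ s e xs → Walk s e xs → s ≤ length xs + e
Walk-start≤ s e [] refl = ≤-refl
Walk-start≤ s e (true ∷ xs) w = ≤-trans (n≤1+n s) (≤-trans (Walk-start≤ (suc s) e xs w) (n≤1+n _))
Walk-start≤ (suc s) e (false ∷ xs) w = s≤s (Walk-start≤ s e xs w)

BallotWalk : ℕ → ℕ → List Bool → Set
BallotWalk u h xs = length xs ≡ 2 * u + h × Walk h 0 xs

BallotWalk-descent : ∀ h xs → BallotWalk 0 h xs → xs ≡ replicate h false
BallotWalk-descent zero [] _ = refl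
BallotWalk-descent (suc h) (false ∷ xs) (eq , w) = cong (false ∷_) (BallotWalk-descent h xs (suc-injective eq , w))
BallotWalk-descent h (true ∷ xs) (eq , w) = ⊥-elim (<-irrefl (sym eq) (s≤s (≤-trans (n≤1+n h) too-long)))
  where
  too-long : suc h ≤ length xs
  too-long = ≤-trans (Walk-start≤ (suc h) 0 xs w) (≤-reflexive (+-identityʳ _))

descent-BallotWalk : ∀ h → BallotWalk 0 h (replicate h false)
descent-BallotWalk zero = refl , refl
descent-BallotWalk (suc h) = cong suc (proj₁ (descent-BallotWalk h)) , proj₂ (descent-BallotWalk h)

module _ {b : Bool} where

  BallotWalk-∷ : ∀ u h u′ h′ {xs} → suc (2 * u + h) ≡ 2 * u′ + h′ →
                 (∃ λ ys → BallotWalk u h ys × xs ≡ b ∷ ys) → Walk h′ 0 xs → BallotWalk u′ h′ xs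
  BallotWalk-∷ u h u′ h′ shape (ys , (len , _) , refl) w = trans (cong suc len) shape , w

  BallotWalk-∷⁻ : ∀ u h u′ h′ {ys} → 2 * u′ + h′ ≡ suc (2 * u + h) →
                  BallotWalk u′ h′ (b ∷ ys) → Walk h 0 ys → ∃ λ zs → BallotWalk u h zs × b ∷ ys ≡ b ∷ zs
  BallotWalk-∷⁻ u h u′ h′ shape (len , _) w = _ , (suc-injective (trans len shape) , w) , refl

enum-BallotWalk : ∀ u h → Enumeration (BallotWalk u h) (ballot u h)
enum-BallotWalk zero h = enum-singleton (replicate h false) (descent-BallotWalk h) (BallotWalk-descent h _)
enum-BallotWalk (suc u) zero = enum-⇔ to from (enum-image (true ∷_) (λ _ _ → ∷-injectiveʳ) (enum-BallotWalk u 1))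
  where
  shape : ∀ u → suc (2 * u + 1) ≡ 2 * suc u + 0
  shape = solve-∀
  to : ∀ {xs} → (∃ λ ys → BallotWalk u 1 ys × xs ≡ true ∷ ys) → BallotWalk (suc u) 0 xs
  to p@(_ , (_ , w) , refl) = BallotWalk-∷ u 1 (suc u) 0 (shape u) p w
  from : ∀ {xs} → BallotWalk (suc u) 0 xs → ∃ λ ys → BallotWalk u 1 ys × xs ≡ true ∷ ys
  from {true ∷ ys} bw@(_ , w) = BallotWalk-∷⁻ u 1 (suc u) 0 (sym (shape u)) bw w
  from {false ∷ ys} (_ , ())
enum-BallotWalk (suc u) (suc h) =
  enum-⇔ to from (enum-⊎ (enum-image (true ∷_) (λ _ _ → ∷-injectiveʳ) (enum-BallotWalk u (2 + h)))
                         (enum-image (false ∷_) (λ _ _ → ∷-injectiveʳ) (enum-BallotWalk (suc u) h))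
                         (λ { (_ , _ , refl) (_ , _ , ()) }))
  where
  up : ∀ u h → suc (2 * u + (2 + h)) ≡ 2 * suc u + suc h
  up = solve-∀
  down : ∀ u h → suc (2 * suc u + h) ≡ 2 * suc u + suc h
  down = solve-∀
  to : ∀ {xs} → (∃ λ ys → BallotWalk u (2 + h) ys × xs ≡ true ∷ ys) ⊎ (∃ λ ys → BallotWalk (suc u) h ys × xs ≡ false ∷ ys) →
       BallotWalk (suc u) (suc h) xs
  to (inj₁ p@(_ , (_ , w) , refl)) = BallotWalk-∷ u (2 + h) (suc u) (suc h) (up u h) p w
  to (inj₂ p@(_ , (_ , w) , refl)) = BallotWalk-∷ (suc u) h (suc u) (suc h) (down u h) p w
  from : ∀ {xs} → BallotWalk (suc u) (suc h) xs →
         (∃ λ ys → BallotWalk u (2 + h) ys × xs ≡ true ∷ ys) ⊎ (∃ λ ys → BallotWalk (suc u) h ys × xs ≡ false ∷ ys)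
  from {true ∷ ys} bw@(_ , w) = inj₁ (BallotWalk-∷⁻ u (2 + h) (suc u) (suc h) (sym (up u h)) bw w)
  from {false ∷ ys} bw@(_ , w) = inj₂ (BallotWalk-∷⁻ (suc u) h (suc u) (suc h) (sym (down u h)) bw w)

-- The bound n on the length is fuel: the second recursive call is on a suffix that is not structurally smaller.
first-descent : ∀ n h e ys → length ys ≤ n → Walk (suc h) e ys → e ≤ h →
                ∃ λ a → ∃ λ b → ys ≡ a ++ false ∷ b × Walk 0 0 a × Walk h e b
first-descent n h e [] _ refl e≤h = ⊥-elim (<-irrefl refl (s≤s e≤h))
first-descent n h e (false ∷ ys) _ w _ = [] , ys , refl , refl , w
first-descent (suc n) h e (true ∷ ys) (s≤s |ys|≤n) w e≤h
  with first-descent n (suc h) e ys |ys|≤n w (m≤n⇒m≤1+n e≤h)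
... | a₁ , b₁ , refl , w₁ , w₂ with first-descent n h e b₁ |b₁|≤n w₂ e≤h
  where
  |b₁|≤n : length b₁ ≤ n
  |b₁|≤n = ≤-trans (m≤n+m (length b₁) (length a₁))
             (≤-trans (+-monoʳ-≤ (length a₁) (n≤1+n _)) (≤-trans (≤-reflexive (sym (length-++ a₁))) |ys|≤n))
... | a₂ , b₂ , refl , w₃ , w₄ =
  true ∷ a₁ ++ false ∷ a₂ , b₂ , cong (true ∷_) (sym (++-assoc a₁ (false ∷ a₂) (false ∷ b₂))) ,
  Walk-++ 1 1 0 a₁ (false ∷ a₂) (Walk-lift 1 0 0 a₁ w₁) w₃ , w₄

excursion-unique : ∀ s a a′ b b′ → Walk s 0 a → Walk s 0 a′ → a ++ false ∷ b ≡ a′ ++ false ∷ b′ → a ≡ a′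
excursion-unique s [] [] b b′ w w′ eq = refl
excursion-unique s [] (true ∷ a′) b b′ w w′ ()
excursion-unique zero [] (false ∷ a′) b b′ w () eq
excursion-unique (suc s) [] (false ∷ a′) b b′ () w′ eq
excursion-unique s (true ∷ a) [] b b′ w w′ ()
excursion-unique zero (false ∷ a) [] b b′ () w′ eq
excursion-unique (suc s) (false ∷ a) [] b b′ w () eq
excursion-unique s (true ∷ a) (true ∷ a′) b b′ w w′ eq =
  cong (true ∷_) (excursion-unique (suc s) a a′ b b′ w w′ (∷-injectiveʳ eq))
excursion-unique s (true ∷ a) (false ∷ a′) b b′ w w′ ()
excursion-unique s (false ∷ a) (true ∷ a′) b b′ w w′ ()
excursion-unique zero (false ∷ a) (false ∷ a′) b b′ () w′ eq
excursion-unique (suc s) (false ∷ a) (false ∷ a′) b b′ w w′ eq =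
  cong (false ∷_) (excursion-unique s a a′ b b′ w w′ (∷-injectiveʳ eq))

2*-injective : ∀ {a b} → 2 * a ≡ 2 * b → a ≡ b
2*-injective {a} {b} = *-cancelˡ-≡ a b 2

Dyck-length : ∀ xs → Walk 0 0 xs → ∃ λ d → length xs ≡ 2 * d + 0
Dyck-length xs w with Walk-length 0 0 xs w
... | d , eq = d , trans (sym (+-identityʳ (length xs))) (trans eq (sym (+-identityʳ (2 * d))))

-- The first-return decomposition of a Dyck word; the index is unused and only matches the shape Glued expects.
arch : ℕ → List Bool → List Bool → List Bool
arch _ a b = true ∷ a ++ false ∷ b

length-arch : ∀ a b → length (arch 0 a b) ≡ 2 + (length a + length b)
length-arch a b = cong suc (trans (length-++ a) (+-suc (length a) (length b)))

arch-injective : ∀ {i j a b a′ b′} → BallotWalk i 0 a → BallotWalk j 0 a′ → arch i a b ≡ arch j a′ b′ → i ≡ j × a ≡ a′ × b ≡ b′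
arch-injective {i} {j} {a} {b} {a′} {b′} (|a| , wa) (|a′| , wa′) eq with excursion-unique 0 a a′ b b′ wa wa′ (∷-injectiveʳ eq)
... | refl = i≡j , refl , ∷-injectiveʳ (++-cancelˡ a _ _ (∷-injectiveʳ eq))
  where
  i≡j : i ≡ j
  i≡j = 2*-injective (trans (sym (+-identityʳ (2 * i))) (trans (sym |a|) (trans |a′| (+-identityʳ (2 * j)))))

ballot-convolution : ∀ m → sumBelow (suc m) (λ j → ballot j 0 * ballot (m ∸ j) 0) ≡ ballot (suc m) 0
ballot-convolution m = enum-size-unique (enum-⇔ to from arches) (enum-BallotWalk (suc m) 0)
  where
  arches : Enumeration (λ xs → ∃ λ j → j < suc m × Glued (λ j → BallotWalk j 0) (λ j → BallotWalk (m ∸ j) 0) arch j xs)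
                       (sumBelow (suc m) (λ j → ballot j 0 * ballot (m ∸ j) 0))
  arches = enum-Glued (λ j → BallotWalk j 0) (λ j → BallotWalk (m ∸ j) 0) (λ j → ballot j 0) (λ j → ballot (m ∸ j) 0) arch (suc m)
             (λ j _ → enum-BallotWalk j 0) (λ j _ → enum-BallotWalk (m ∸ j) 0) (λ _ _ a-walk _ a′-walk _ → arch-injective a-walk a′-walk)
  shape : ∀ x y → 2 + ((2 * x + 0) + (2 * y + 0)) ≡ 2 * suc (x + y) + 0
  shape = solve-∀
  to : ∀ {xs} → (∃ λ j → j < suc m × Glued (λ j → BallotWalk j 0) (λ j → BallotWalk (m ∸ j) 0) arch j xs) →
       BallotWalk (suc m) 0 xs
  to (j , s≤s j≤m , a , b , (|a| , wa) , (|b| , wb) , refl) =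
    length≡ , Walk-++ 1 1 0 a (false ∷ b) (Walk-lift 1 0 0 a wa) wb
    where
    open ≡-Reasoning
    length≡ : length (arch j a b) ≡ 2 * suc m + 0
    length≡ = begin
      length (arch j a b)                       ≡⟨ length-arch a b ⟩
      2 + (length a + length b)                 ≡⟨ cong₂ (λ x y → 2 + (x + y)) |a| |b| ⟩
      2 + ((2 * j + 0) + (2 * (m ∸ j) + 0))     ≡⟨ shape j (m ∸ j) ⟩
      2 * suc (j + (m ∸ j)) + 0                 ≡⟨ cong (λ z → 2 * suc z + 0) (m+[n∸m]≡n j≤m) ⟩
      2 * suc m + 0                             ∎
  from : ∀ {xs} → BallotWalk (suc m) 0 xs →
         ∃ λ j → j < suc m × Glued (λ j → BallotWalk j 0) (λ j → BallotWalk (m ∸ j) 0) arch j xs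
  from {[]} (() , _)
  from {false ∷ ys} (_ , ())
  from {true ∷ ys} (|xs| , w) with first-descent (length ys) 0 0 ys ≤-refl w z≤n
  ... | a , b , refl , wa , wb with Dyck-length a wa | Dyck-length b wb
  ... | da , |a| | db , |b| = da , s≤s da≤m , a , b , (|a| , wa) , (trans |b| (cong (λ d → 2 * d + 0) db≡m∸da) , wb) , refl
    where
    da+db≡m : da + db ≡ m
    da+db≡m = suc-injective (2*-injective (+-cancelʳ-≡ 0 _ _ (begin
      2 * suc (da + db) + 0                     ≡⟨ sym (shape da db) ⟩
      2 + ((2 * da + 0) + (2 * db + 0))         ≡⟨ cong₂ (λ x y → 2 + (x + y)) (sym |a|) (sym |b|) ⟩
      2 + (length a + length b)                 ≡⟨ sym (length-arch a b) ⟩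
      length (arch 0 a b)                       ≡⟨ |xs| ⟩
      2 * suc m + 0                             ∎)))
      where open ≡-Reasoning
    da≤m : da ≤ m
    da≤m = ≤-trans (m≤m+n da db) (≤-reflexive da+db≡m)
    db≡m∸da : db ≡ m ∸ da
    db≡m∸da = sym (trans (cong (_∸ da) (sym da+db≡m)) (m+n∸m≡n da db))

ballot-induction : ∀ (P : ℕ → Set) → P 0 → (∀ m → (∀ j → j ≤ m → P j) → P (suc m)) → ∀ m → P m
ballot-induction P base step = <-rec P go
  where
  go : ∀ n → (∀ {j} → j < n → P j) → P n
  go zero _ = base
  go (suc m) ih = step m (λ j j≤m → ih (s≤s j≤m))

enum-by-gluing : ∀ {A : Set} (D : A → Set) (L Rt : ℕ → A → Set) (glue : ℕ → A → A → A) m →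
  (∀ j → j ≤ m → Enumeration (L j) (ballot j 0)) → (∀ j → j ≤ m → Enumeration (Rt j) (ballot j 0)) →
  (∀ {i j a b a′ b′} → i < suc m → j < suc m → L i a → Rt (m ∸ i) b → L j a′ → Rt (m ∸ j) b′ →
     glue i a b ≡ glue j a′ b′ → i ≡ j × a ≡ a′ × b ≡ b′) →
  (∀ j a b → j ≤ m → L j a → Rt (m ∸ j) b → D (glue j a b)) →
  (∀ x → D x → ∃ λ j → j < suc m × Glued L (λ j → Rt (m ∸ j)) glue j x) →
  Enumeration D (ballot (suc m) 0)
enum-by-gluing D L Rt glue m enumL enumR injective sound complete =
  enum-cast (ballot-convolution m) (enum-⇔ to (λ {x} → complete x)
    (enum-Glued L (λ j → Rt (m ∸ j)) (λ j → ballot j 0) (λ j → ballot (m ∸ j) 0) glue (suc m)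
                (λ j j<1+m → enumL j (≤-pred j<1+m)) (λ j _ → enumR (m ∸ j) (m∸n≤m m j)) injective))
  where
  to : ∀ {x} → (∃ λ j → j < suc m × Glued L (λ j → Rt (m ∸ j)) glue j x) → D x
  to (j , s≤s j≤m , a , b , la , rb , refl) = sound j a b j≤m la rb

-- range n = 1 ∷ 2 ∷ … ∷ n, so that a permutation in S_n is a list xs with xs ↭ range n.
range : ℕ → List ℕ
range zero    = []
range (suc n) = range n ++ [ suc n ]

raise : ℕ → List ℕ → List ℕ
raise k = map (k +_)

raise-raise : ∀ a b xs → raise a (raise b xs) ≡ raise (a + b) xs
raise-raise a b [] = refl
raise-raise a b (x ∷ xs) = cong₂ _∷_ (sym (+-assoc a b x)) (raise-raise a b xs)

raise-injective : ∀ k {xs ys} → raise k xs ≡ raise k ys → xs ≡ ys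
raise-injective k {[]} {[]} _ = refl
raise-injective k {x ∷ xs} {y ∷ ys} eq with ∷-injective eq
... | kx≡ky , eq′ = cong₂ _∷_ (+-cancelˡ-≡ k x y kx≡ky) (raise-injective k eq′)

range-+ : ∀ a b → range (a + b) ≡ range a ++ raise a (range b)
range-+ a zero = trans (cong range (+-identityʳ a)) (sym (++-identityʳ (range a)))
range-+ a (suc b) = begin
  range (a + suc b)                                   ≡⟨ cong range (+-suc a b) ⟩
  range (a + b) ++ [ suc (a + b) ]                    ≡⟨ cong (_++ [ suc (a + b) ]) (range-+ a b) ⟩
  (range a ++ raise a (range b)) ++ [ suc (a + b) ]   ≡⟨ ++-assoc (range a) _ _ ⟩
  range a ++ (raise a (range b) ++ [ suc (a + b) ])   ≡⟨ cong (λ z → range a ++ (raise a (range b) ++ [ z ])) (sym (+-suc a b)) ⟩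
  range a ++ (raise a (range b) ++ raise a [ suc b ]) ≡⟨ cong (range a ++_) (sym (map-++ (a +_) (range b) _)) ⟩
  range a ++ raise a (range (suc b))                  ∎
  where open ≡-Reasoning

raise-range-suc : ∀ a b → raise a (range (suc b)) ≡ raise a (range b) ++ [ a + suc b ]
raise-range-suc a b = map-++ (a +_) (range b) _

length-range : ∀ n → length (range n) ≡ n
length-range zero = refl
length-range (suc n) = trans (length-++ (range n)) (trans (cong (_+ 1) (length-range n)) (+-comm n 1))

∈-range⁻ : ∀ {x} n → x ∈ range n → 1 ≤ x × x ≤ n
∈-range⁻ (suc n) x∈ with ∈-++⁻ (range n) x∈
... | inj₁ x∈′ = let (1≤x , x≤n) = ∈-range⁻ n x∈′ in 1≤x , m≤n⇒m≤1+n x≤n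
... | inj₂ (here refl) = s≤s z≤n , ≤-refl

∈-range⁺ : ∀ {x} n → 1 ≤ x → x ≤ n → x ∈ range n
∈-range⁺ zero (s≤s _) ()
∈-range⁺ {x} (suc n) 1≤x x≤1+n with m≤n⇒m<n∨m≡n x≤1+n
... | inj₁ x<1+n = ∈-++⁺ˡ (∈-range⁺ n 1≤x (≤-pred x<1+n))
... | inj₂ refl  = ∈-++⁺ʳ (range n) (here refl)

∈-raise-range⁻ : ∀ k l {x} → x ∈ raise k (range l) → suc k ≤ x × x ≤ k + l
∈-raise-range⁻ k l x∈ with ∈-map⁻ (k +_) x∈
... | y , y∈ , refl = let (1≤y , y≤l) = ∈-range⁻ l y∈ in
  subst (_≤ k + y) (+-comm k 1) (+-monoʳ-≤ k 1≤y) , +-monoʳ-≤ k y≤l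

∈-raise-range⁺ : ∀ k l {y} → 1 ≤ y → y ≤ l → k + y ∈ raise k (range l)
∈-raise-range⁺ k l 1≤y y≤l = ∈-map⁺ (k +_) (∈-range⁺ l 1≤y y≤l)

Unique-resp-↭ : ∀ {xs ys : List ℕ} → xs ↭ ys → Unique xs → Unique ys
Unique-resp-↭ p = Permₛ.Unique-resp-↭ (setoid ℕ) (↭⇒↭ₛ p)

range-unique : ∀ n → Unique (range n)
range-unique zero = []
range-unique (suc n) = Unique-resp-↭ (↭-sym (↭-++-comm (range n) [ suc n ]))
  (All.tabulate (λ x∈ x≡ → <-irrefl (sym x≡) (s≤s (proj₂ (∈-range⁻ n x∈)))) ∷ range-unique n)

raise-range-unique : ∀ k l → Unique (raise k (range l))
raise-range-unique k l = Unique.map⁺ (λ {a} {b} → +-cancelˡ-≡ k a b) (range-unique l)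

module _ {n : ℕ} {xs : List ℕ} (p : xs ↭ range n) where

  ↭range-unique : Unique xs
  ↭range-unique = Unique-resp-↭ (↭-sym p) (range-unique n)

  ↭range-bounds : ∀ {x} → x ∈ xs → 1 ≤ x × x ≤ n
  ↭range-bounds x∈ = ∈-range⁻ n (∈-resp-↭ p x∈)

  ↭range-∈ : ∀ {x} → 1 ≤ x → x ≤ n → x ∈ xs
  ↭range-∈ 1≤x x≤n = ∈-resp-↭ (↭-sym p) (∈-range⁺ n 1≤x x≤n)

  ↭range-length : length xs ≡ n
  ↭range-length = trans (↭-length p) (length-range n)

↭raise-range-bounds : ∀ {xs} k l → xs ↭ raise k (range l) → ∀ {x} → x ∈ xs → suc k ≤ x × x ≤ k + l
↭raise-range-bounds k l p x∈ = ∈-raise-range⁻ k l (∈-resp-↭ p x∈)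

Unique-++-≢ : ∀ {xs ys : List ℕ} {a b} → Unique (xs ++ ys) → a ∈ xs → b ∈ ys → a ≢ b
Unique-++-≢ {x ∷ xs} (x∉ ∷ u) (here refl) b∈ refl = All¬⇒¬Any x∉ (∈-++⁺ʳ xs b∈)
Unique-++-≢ {x ∷ xs} (_ ∷ u) (there a∈) b∈ = Unique-++-≢ u a∈ b∈

Unique-++⁻ʳ : ∀ {xs ys : List ℕ} → Unique (xs ++ ys) → Unique ys
Unique-++⁻ʳ {[]} u = u
Unique-++⁻ʳ {x ∷ xs} (_ ∷ u) = Unique-++⁻ʳ u

length-++-∷ : ∀ (xs : List ℕ) {x} ys → length (xs ++ x ∷ ys) ≡ suc (length (xs ++ ys))
length-++-∷ xs ys = trans (length-++ xs) (trans (+-suc (length xs) (length ys)) (cong suc (sym (length-++ xs))))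

Unique-length-≤ : ∀ {xs ys : List ℕ} → Unique xs → (∀ {x} → x ∈ xs → x ∈ ys) → length xs ≤ length ys
Unique-length-≤ {[]} _ _ = z≤n
Unique-length-≤ {x ∷ xs} (x∉xs ∷ u) ⊆ys with ∈-∃++ (⊆ys (here refl))
... | ys₁ , ys₂ , refl = ≤-trans (s≤s (Unique-length-≤ u ⊆ys₁ys₂)) (≤-reflexive (sym (length-++-∷ ys₁ ys₂)))
  where
  ⊆ys₁ys₂ : ∀ {y} → y ∈ xs → y ∈ ys₁ ++ ys₂
  ⊆ys₁ys₂ y∈ with ∈-++⁻ ys₁ (⊆ys (there y∈))
  ... | inj₁ y∈₁ = ∈-++⁺ˡ y∈₁
  ... | inj₂ (here refl) = ⊥-elim (All¬⇒¬Any x∉xs y∈)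
  ... | inj₂ (there y∈₂) = ∈-++⁺ʳ ys₁ y∈₂

unique⇒↭range : ∀ {xs} n → Unique xs → (∀ {x} → x ∈ xs → 1 ≤ x × x ≤ n) → length xs ≡ n → xs ↭ range n
unique⇒↭range {xs} n u bounds |xs| =
  ∼bag⇒↭ (unique∧set⇒bag u (range-unique n) (mk⇔ (λ x∈ → let (a , b) = bounds x∈ in ∈-range⁺ n a b) covered))
  where
  covered : ∀ {x} → x ∈ range n → x ∈ xs
  covered {x} x∈ with x ∈? xs
  ... | yes x∈xs = x∈xs
  ... | no x∉xs with ∈-∃++ x∈
  ...   | r₁ , r₂ , eq = ⊥-elim (<-irrefl refl (≤-trans (s≤s (≤-trans (≤-reflexive (sym |xs|)) (Unique-length-≤ u ⊆r₁r₂)))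
                                                         (≤-reflexive |r₁xr₂|)))
    where
    ⊆r₁r₂ : ∀ {y} → y ∈ xs → y ∈ r₁ ++ r₂
    ⊆r₁r₂ {y} y∈ with bounds y∈
    ... | a , b with ∈-++⁻ r₁ (subst (y ∈_) eq (∈-range⁺ n a b))
    ...   | inj₁ y∈₁ = ∈-++⁺ˡ y∈₁
    ...   | inj₂ (here refl) = ⊥-elim (x∉xs y∈)
    ...   | inj₂ (there y∈₂) = ∈-++⁺ʳ r₁ y∈₂
    |r₁xr₂| : suc (length (r₁ ++ r₂)) ≡ n
    |r₁xr₂| = trans (sym (length-++-∷ r₁ r₂)) (trans (cong length (sym eq)) (length-range n))

↭range-drop-max : ∀ n α β → α ++ suc n ∷ β ↭ range (suc n) → α ++ β ↭ range n
↭range-drop-max n α β p = ↭-trans (drop-mid α (range n) p) (↭-reflexive (++-identityʳ (range n)))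

↭range-snoc-max⁻ : ∀ n α → α ++ [ suc n ] ↭ range (suc n) → α ↭ range n
↭range-snoc-max⁻ n α p = ↭-trans (↭-reflexive (sym (++-identityʳ α))) (↭range-drop-max n α [] p)

↭range-insert-max : ∀ {α β} n → α ++ β ↭ range n → α ++ suc n ∷ β ↭ range (suc n)
↭range-insert-max {α} {β} n p = ↭-trans (shift (suc n) α β) (↭-trans (∷↭∷ʳ (suc n) (α ++ β)) (++⁺ʳ [ suc n ] p))

↭range-++ : ∀ {α γ} k l → α ↭ range k → γ ↭ raise k (range l) → α ++ γ ↭ range (k + l)
↭range-++ {α} {γ} k l p q = ↭-trans (++⁺ʳ γ p) (↭-trans (++⁺ˡ (range k) q) (↭-reflexive (sym (range-+ k l))))

raise-↭ : ∀ {γ} k l → γ ↭ range l → raise k γ ↭ raise k (range l)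
raise-↭ k l = ↭-map⁺ (k +_)

↭raise-range⁻ : ∀ {γ′} k l → γ′ ↭ raise k (range l) → ∃ λ γ → γ′ ≡ raise k γ × γ ↭ range l
↭raise-range⁻ k l p with ↭-map-inv (k +_) (↭-sym p)
... | γ , eq , q = γ , eq , ↭-sym q

↭range-split : ∀ n α β → α ++ β ↭ range n → (∀ {a b} → a ∈ α → b ∈ β → a < b) →
               α ↭ range (length α) × β ↭ raise (length α) (range (length β))
↭range-split n α [] p _ = subst (λ l → α ↭ range l) (sym (↭range-length {n} α↭)) α↭ , ↭-refl
  where
  α↭ : α ↭ range n
  α↭ = ↭-trans (↭-reflexive (sym (++-identityʳ α))) p
↭range-split zero α (b ∷ β) p _ =
  ⊥-elim (1+n≢0 (trans (sym (trans (length-++ α) (+-suc (length α) (length β)))) (↭range-length p)))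
↭range-split (suc n) α (b ∷ β) p α<β with ∈-++⁻ α (↭range-∈ p (s≤s z≤n) (≤-refl {suc n}))
... | inj₁ max∈α = ⊥-elim (<⇒≱ (α<β max∈α (here refl)) (proj₂ (↭range-bounds p (∈-++⁺ʳ α (here {xs = β} refl)))))
... | inj₂ max∈β with ∈-∃++ max∈β
... | β₁ , β₂ , bβ≡ = proj₁ split , bβ↭
  where
  open PermutationReasoning
  p′ : α ++ (β₁ ++ β₂) ↭ range n
  p′ = ↭-trans (↭-reflexive (sym (++-assoc α β₁ β₂)))
         (↭range-drop-max n (α ++ β₁) β₂ (↭-trans (↭-reflexive (trans (++-assoc α β₁ _) (cong (α ++_) (sym bβ≡)))) p))
  α<β₁β₂ : ∀ {a c} → a ∈ α → c ∈ β₁ ++ β₂ → a < c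
  α<β₁β₂ a∈ c∈ with ∈-++⁻ β₁ c∈
  ... | inj₁ c∈₁ = α<β a∈ (subst (_ ∈_) (sym bβ≡) (∈-++⁺ˡ c∈₁))
  ... | inj₂ c∈₂ = α<β a∈ (subst (_ ∈_) (sym bβ≡) (∈-++⁺ʳ β₁ (there c∈₂)))
  split : α ↭ range (length α) × β₁ ++ β₂ ↭ raise (length α) (range (length (β₁ ++ β₂)))
  split = ↭range-split n α (β₁ ++ β₂) p′ α<β₁β₂
  k l : ℕ
  k = length α
  l = length (β₁ ++ β₂)
  |bβ| : length (b ∷ β) ≡ suc l
  |bβ| = trans (cong length bβ≡) (length-++-∷ β₁ β₂)
  n≡k+l : n ≡ k + l
  n≡k+l = trans (sym (↭range-length p′)) (length-++ α)
  bβ↭ : b ∷ β ↭ raise k (range (length (b ∷ β)))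
  bβ↭ = begin
    b ∷ β                            ≡⟨ bβ≡ ⟩
    β₁ ++ [ suc n ] ++ β₂            ↭⟨ shift (suc n) β₁ β₂ ⟩
    suc n ∷ (β₁ ++ β₂)               ↭⟨ ∷↭∷ʳ (suc n) (β₁ ++ β₂) ⟩
    (β₁ ++ β₂) ++ [ suc n ]          ↭⟨ ++⁺ʳ [ suc n ] (proj₂ split) ⟩
    raise k (range l) ++ [ suc n ]   ≡⟨ cong (λ z → raise k (range l) ++ [ z ]) (trans (cong suc n≡k+l) (sym (+-suc k l))) ⟩
    raise k (range l) ++ [ k + suc l ] ≡⟨ sym (raise-range-suc k l) ⟩
    raise k (range (suc l))          ≡⟨ cong (λ z → raise k (range z)) (sym |bβ|) ⟩
    raise k (range (length (b ∷ β))) ∎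

split-at-first : ∀ {x} (ys ys′ : List ℕ) {zs zs′} → x ∉ ys → x ∉ ys′ → ys ++ x ∷ zs ≡ ys′ ++ x ∷ zs′ → ys ≡ ys′ × zs ≡ zs′
split-at-first [] [] _ _ eq = refl , proj₂ (∷-injective eq)
split-at-first [] (y ∷ ys′) _ x∉ eq = ⊥-elim (x∉ (here (proj₁ (∷-injective eq))))
split-at-first (y ∷ ys) [] x∉ _ eq = ⊥-elim (x∉ (here (sym (proj₁ (∷-injective eq)))))
split-at-first (y ∷ ys) (y′ ∷ ys′) x∉ x∉′ eq with ∷-injective eq
... | refl , eq′ = let (ys≡ , zs≡) = split-at-first ys ys′ (λ x∈ → x∉ (there x∈)) (λ x∈ → x∉′ (there x∈)) eq′
                   in cong (y ∷_) ys≡ , zs≡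

snoc-injective : ∀ {x} (xs ys : List ℕ) → xs ++ [ x ] ≡ ys ++ [ x ] → xs ≡ ys
snoc-injective xs ys eq = proj₁ (∷ʳ-injective xs ys eq)

⊆-++-split : ∀ {zs : List ℕ} xs ys → zs ⊆ xs ++ ys → ∃ λ us → ∃ λ vs → zs ≡ us ++ vs × us ⊆ xs × vs ⊆ ys
⊆-++-split [] ys s = [] , _ , refl , [] , s
⊆-++-split (x ∷ xs) ys (_ ∷ʳ s) with ⊆-++-split xs ys s
... | us , vs , refl , s₁ , s₂ = us , vs , refl , x ∷ʳ s₁ , s₂
⊆-++-split (x ∷ xs) ys (refl ∷ s) with ⊆-++-split xs ys s
... | us , vs , refl , s₁ , s₂ = x ∷ us , vs , refl , refl ∷ s₁ , s₂

⊆-map⁻ : ∀ {zs} (f : ℕ → ℕ) (ys : List ℕ) → zs ⊆ map f ys → ∃ λ xs → zs ≡ map f xs × xs ⊆ ys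
⊆-map⁻ f [] [] = [] , refl , []
⊆-map⁻ f (y ∷ ys) (_ ∷ʳ s) with ⊆-map⁻ f ys s
... | xs , refl , s′ = xs , refl , y ∷ʳ s′
⊆-map⁻ f (y ∷ ys) (refl ∷ s) with ⊆-map⁻ f ys s
... | xs , refl , s′ = y ∷ xs , refl , refl ∷ s′

Pattern : Set₁
Pattern = ℕ → ℕ → ℕ → Set

Is321 Is231 Is312 : Pattern
Is321 a b c = b < a × c < b
Is231 a b c = c < a × a < b
Is312 a b c = b < c × c < a

-- An occurrence of such a pattern cannot straddle a direct sum α ++ β with α entirely below β.
EndsBelow : Pattern → Set
EndsBelow R = ∀ {a b c} → R a b c → c < a

321-endsBelow : EndsBelow Is321
321-endsBelow (b<a , c<b) = <-trans c<b b<a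

231-endsBelow : EndsBelow Is231
231-endsBelow = proj₁

312-endsBelow : EndsBelow Is312
312-endsBelow = proj₂

-- All three patterns are conjunctions of two strict comparisons, hence invariant under translation.
<×<-cancelˡ : ∀ k {a b c d} → k + a < k + b × k + c < k + d → a < b × c < d
<×<-cancelˡ k (p , q) = +-cancelˡ-< k _ _ p , +-cancelˡ-< k _ _ q

<×<-monoˡ : ∀ k {a b c d} → a < b × c < d → k + a < k + b × k + c < k + d
<×<-monoˡ k (p , q) = +-monoʳ-< k p , +-monoʳ-< k q

Contains : Pattern → List ℕ → Set
Contains R xs = ∃ λ a → ∃ λ b → ∃ λ c → a ∷ b ∷ c ∷ [] ⊆ xs × R a b c

Contains-⊆ : ∀ {R xs ys} → xs ⊆ ys → Contains R xs → Contains R ys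
Contains-⊆ s (a , b , c , t , r) = a , b , c , ⊆-trans t s , r

Contains-raise⁻ : ∀ {R} k xs → (∀ {a b c} → R (k + a) (k + b) (k + c) → R a b c) → Contains R (raise k xs) → Contains R xs
Contains-raise⁻ k xs cancel (_ , _ , _ , t , r) with ⊆-map⁻ (k +_) xs t
... | a ∷ b ∷ c ∷ [] , refl , t′ = a , b , c , t′ , cancel r

Contains-raise⁺ : ∀ {R} k xs → (∀ {a b c} → R a b c → R (k + a) (k + b) (k + c)) → Contains R xs → Contains R (raise k xs)
Contains-raise⁺ k xs mono (a , b , c , t , r) = k + a , k + b , k + c , Sublist.map⁺ (k +_) t , mono r

Contains-∷ : ∀ {R x ys} → Contains R (x ∷ ys) → Contains R ys ⊎ (∃ λ b → ∃ λ c → b ∷ c ∷ [] ⊆ ys × R x b c)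
Contains-∷ (a , b , c , _ ∷ʳ t , r) = inj₁ (a , b , c , t , r)
Contains-∷ (a , b , c , refl ∷ t , r) = inj₂ (b , c , t , r)

Straddles : Pattern → List ℕ → List ℕ → Set
Straddles R xs ys = ∃ λ a → ∃ λ b → ∃ λ c → R a b c × (a ∷ b ∷ [] ⊆ xs × c ∈ ys ⊎ a ∈ xs × b ∷ c ∷ [] ⊆ ys)

Contains-++ : ∀ {R} xs ys → Contains R (xs ++ ys) → Contains R xs ⊎ Contains R ys ⊎ Straddles R xs ys
Contains-++ xs ys (a , b , c , t , r) with ⊆-++-split xs ys t
... | [] , _ , refl , _ , s₂ = inj₂ (inj₁ (a , b , c , s₂ , r))
... | _ ∷ [] , _ , refl , s₁ , s₂ = inj₂ (inj₂ (a , b , c , r , inj₂ (⊆-lookup s₁ (here refl) , s₂)))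
... | _ ∷ _ ∷ [] , _ , refl , s₁ , s₂ = inj₂ (inj₂ (a , b , c , r , inj₁ (s₁ , ⊆-lookup s₂ (here refl))))
... | _ ∷ _ ∷ _ ∷ [] , [] , refl , s₁ , _ = inj₁ (a , b , c , s₁ , r)

Contains-⊕ : ∀ {R} xs ys → EndsBelow R → (∀ {a b} → a ∈ xs → b ∈ ys → a < b) →
             Contains R (xs ++ ys) → Contains R xs ⊎ Contains R ys
Contains-⊕ xs ys endsBelow xs<ys occ with Contains-++ xs ys occ
... | inj₁ occ₁ = inj₁ occ₁
... | inj₂ (inj₁ occ₂) = inj₂ occ₂
... | inj₂ (inj₂ (a , b , c , r , inj₁ (s , c∈))) = ⊥-elim (<-asym (endsBelow r) (xs<ys (⊆-lookup s (here refl)) c∈))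
... | inj₂ (inj₂ (a , b , c , r , inj₂ (a∈ , s))) = ⊥-elim (<-asym (endsBelow r) (xs<ys a∈ (⊆-lookup s (there (here refl)))))

Avoids-++⁻ˡ : ∀ {R} ys zs → ¬ Contains R (ys ++ zs) → ¬ Contains R ys
Avoids-++⁻ˡ ys zs av occ = av (Contains-⊆ (Sublist.++⁺ʳ zs ⊆-refl) occ)

Avoids-snoc-max : ∀ {R} ys M → EndsBelow R → (∀ {y} → y ∈ ys → y < M) → ¬ Contains R ys → ¬ Contains R (ys ++ [ M ])
Avoids-snoc-max ys M endsBelow ys<M av occ with Contains-++ ys [ M ] occ
... | inj₁ occ₁ = av occ₁
... | inj₂ (inj₁ (_ , _ , _ , _ ∷ʳ () , _))
... | inj₂ (inj₁ (_ , _ , _ , _ ∷ () , _))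
... | inj₂ (inj₂ (_ , _ , _ , r , inj₁ (s , here refl))) = <-asym (endsBelow r) (ys<M (⊆-lookup s (here refl)))
... | inj₂ (inj₂ (_ , _ , _ , _ , inj₂ (_ , _ ∷ʳ ())))
... | inj₂ (inj₂ (_ , _ , _ , _ , inj₂ (_ , _ ∷ ())))

parity-2*+ : ∀ j x → parity (2 * j + x) ≡ parity x
parity-2*+ zero x = refl
parity-2*+ (suc j) x rewrite +-suc j (j + 0) = parity-2*+ j x

parity-suc : ∀ x → parity (suc x) ≡ parity x ⁻¹
parity-suc zero = refl
parity-suc (suc zero) = refl
parity-suc (suc (suc x)) = parity-suc x

parity-2* : ∀ m → parity (2 * m) ≡ 0ℙ
parity-2* m = trans (cong parity (sym (+-identityʳ (2 * m)))) (parity-2*+ m 0)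

parity-1+2* : ∀ m → parity (suc (2 * m)) ≡ 1ℙ
parity-1+2* m = trans (parity-suc (2 * m)) (cong _⁻¹ (parity-2* m))

parity≡0ℙ⇒2* : ∀ k → parity k ≡ 0ℙ → ∃ λ j → k ≡ 2 * j
parity≡0ℙ⇒2* zero _ = 0 , refl
parity≡0ℙ⇒2* (suc (suc k)) e with parity≡0ℙ⇒2* k e
... | j , refl = suc j , sym (cong suc (+-suc j (j + 0)))

Step : Parity → ℕ → ℕ → Set
Step 0ℙ x y = y < x
Step 1ℙ x y = x < y

DumontStep : ℕ → ℕ → Set
DumontStep x y = Step (parity x) x y

HasParity : Parity → ℕ → Set
HasParity b x = parity x ≡ b

LastParity : Parity → List ℕ → Set
LastParity b xs = AllMaybe (HasParity b) (last xs)

-- The last entry of a Dumont permutation of the first kind is followed by nothing, so it is odd.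
Dumont₁ : List ℕ → Set
Dumont₁ xs = Linked DumontStep xs × LastParity 1ℙ xs

last-++ : ∀ (xs : List ℕ) y ys → last (xs ++ y ∷ ys) ≡ last (y ∷ ys)
last-++ [] y ys = refl
last-++ (x ∷ []) y ys = refl
last-++ (x ∷ x′ ∷ xs) y ys = last-++ (x′ ∷ xs) y ys

last-snoc : ∀ (xs : List ℕ) x → last (xs ++ [ x ]) ≡ just x
last-snoc xs x = last-++ xs x []

last-∈ : ∀ {x : ℕ} xs → last xs ≡ just x → x ∈ xs
last-∈ (x ∷ []) refl = here refl
last-∈ (x ∷ y ∷ r) eq = there (last-∈ (y ∷ r) eq)

LastParity-suffix : ∀ b xs ys → LastParity b (xs ++ ys) → LastParity b ys
LastParity-suffix b xs [] _ = nothing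
LastParity-suffix b xs (y ∷ ys) lp = subst (AllMaybe (HasParity b)) (last-++ xs y ys) lp

LastParity-snoc : ∀ {b} xs x → parity x ≡ b → LastParity b (xs ++ [ x ])
LastParity-snoc {b} xs x e = subst (AllMaybe (HasParity b)) (sym (last-snoc xs x)) (just e)

LastParity-snoc⁻ : ∀ {b} xs x → LastParity b (xs ++ [ x ]) → parity x ≡ b
LastParity-snoc⁻ {b} xs x lp = drop-just (subst (AllMaybe (HasParity b)) (last-snoc xs x) lp)

Linked-++⁻ : ∀ {R : ℕ → ℕ → Set} xs {ys} → Linked R (xs ++ ys) →
             Linked R xs × Connected R (last xs) (head ys) × Linked R ys
Linked-++⁻ [] {[]} l = [] , nothing , l
Linked-++⁻ [] {y ∷ ys} l = [] , nothing-just , l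
Linked-++⁻ (x ∷ []) {[]} l = [-] , just-nothing , []
Linked-++⁻ (x ∷ []) {y ∷ ys} (r ∷ l) = [-] , just r , l
Linked-++⁻ (x ∷ x′ ∷ xs) (r ∷ l) with Linked-++⁻ (x′ ∷ xs) l
... | l₁ , c , l₂ = r ∷ l₁ , c , l₂

Linked-middle : ∀ {R : ℕ → ℕ → Set} xs {x y ys} → Linked R (xs ++ x ∷ y ∷ ys) → R x y
Linked-middle xs l = Linked.head (proj₂ (proj₂ (Linked-++⁻ xs l)))

DumontStep-raise⁻ : ∀ j {x y} → DumontStep (2 * j + x) (2 * j + y) → DumontStep x y
DumontStep-raise⁻ j {x} s rewrite parity-2*+ j x with parity x
... | 0ℙ = +-cancelˡ-< (2 * j) _ _ s
... | 1ℙ = +-cancelˡ-< (2 * j) _ _ s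

DumontStep-raise⁺ : ∀ j {x y} → DumontStep x y → DumontStep (2 * j + x) (2 * j + y)
DumontStep-raise⁺ j {x} s rewrite parity-2*+ j x with parity x
... | 0ℙ = +-monoʳ-< (2 * j) s
... | 1ℙ = +-monoʳ-< (2 * j) s

Linked-raise⁻ : ∀ j {xs} → Linked DumontStep (raise (2 * j) xs) → Linked DumontStep xs
Linked-raise⁻ j l = Linked.map (DumontStep-raise⁻ j) (Linkedₚ.map⁻ l)

Linked-raise⁺ : ∀ j {xs} → Linked DumontStep xs → Linked DumontStep (raise (2 * j) xs)
Linked-raise⁺ j l = Linkedₚ.map⁺ (Linked.map (DumontStep-raise⁺ j) l)

LastParity-raise⁻ : ∀ b j xs → LastParity b (raise (2 * j) xs) → LastParity b xs
LastParity-raise⁻ b j xs lp with last xs | last-map (2 * j +_) xs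
... | nothing | _ = nothing
... | just x | eq with subst (AllMaybe (HasParity b)) eq lp
...   | just e = just (trans (sym (parity-2*+ j x)) e)

LastParity-raise⁺ : ∀ b j xs → LastParity b xs → LastParity b (raise (2 * j) xs)
LastParity-raise⁺ b j xs lp = subst (AllMaybe (HasParity b)) (sym (last-map (2 * j +_) xs)) (helper lp)
  where
  helper : ∀ {m} → AllMaybe (HasParity b) m → AllMaybe (HasParity b) (Maybe.map (2 * j +_) m)
  helper (just e) = just (trans (parity-2*+ j _) e)
  helper nothing = nothing

Step-parity : ∀ b b′ {x y} → Step b′ x y → Step b x y → b′ ≡ b
Step-parity 0ℙ 0ℙ _ _ = refl
Step-parity 1ℙ 1ℙ _ _ = refl
Step-parity 0ℙ 1ℙ y<x x<y = ⊥-elim (<-asym y<x x<y)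
Step-parity 1ℙ 0ℙ x<y y<x = ⊥-elim (<-asym y<x x<y)

last-connects : ∀ {b} xs {y} → LastParity b xs → (∀ {x} → x ∈ xs → Step b x y) → Connected DumontStep (last xs) (just y)
last-connects xs lp step with last xs in eq
... | nothing = nothing-just
... | just x with lp
...   | just refl = just (step (last-∈ xs eq))

connects⇒LastParity : ∀ b xs {y} → Connected DumontStep (last xs) (just y) → (∀ {x} → x ∈ xs → Step b x y) → LastParity b xs
connects⇒LastParity b xs c step with last xs in eq
... | nothing = nothing
... | just x with c
...   | just s = just (Step-parity b (parity x) s (step (last-∈ xs eq)))

Linked-∷ : ∀ b {x} ys → parity x ≡ b → (∀ {y} → y ∈ ys → Step b x y) → Linked DumontStep ys → Linked DumontStep (x ∷ ys)
Linked-∷ b [] _ _ _ = [-]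
Linked-∷ b (y ∷ ys) refl step l = step (here refl) ∷ l

Dumont₁-snoc-max⁺ : ∀ ys M → Dumont₁ ys → (∀ {y} → y ∈ ys → y < M) → parity M ≡ 1ℙ → Dumont₁ (ys ++ [ M ])
Dumont₁-snoc-max⁺ ys M (l , lp) ys<M M-odd =
  Linkedₚ.++⁺ l (last-connects ys lp ys<M) [-] , LastParity-snoc ys M M-odd

Dumont₁-snoc-max⁻ : ∀ ys M → Dumont₁ (ys ++ [ M ]) → (∀ {y} → y ∈ ys → y < M) → Dumont₁ ys
Dumont₁-snoc-max⁻ ys M (l , _) ys<M with Linked-++⁻ ys l
... | l₁ , c , _ = l₁ , connects⇒LastParity 1ℙ ys c ys<M

-- Dumont₂From p xs: every entry of xs satisfies the second-kind condition for its position,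
-- positions being counted from p + 1.
Step₂ : Parity → ℕ → ℕ → Set
Step₂ 0ℙ q x = x < q
Step₂ 1ℙ q x = q ≤ x

Dumont₂Entry : ℕ → ℕ → Set
Dumont₂Entry q x = Step₂ (parity q) q x

Dumont₂From : ℕ → List ℕ → Set
Dumont₂From p []       = ⊤
Dumont₂From p (x ∷ xs) = Dumont₂Entry (suc p) x × Dumont₂From (suc p) xs

Dumont₂ : List ℕ → Set
Dumont₂ = Dumont₂From 0

Dumont₂From-at : ∀ p pre x rest → Dumont₂From p (pre ++ x ∷ rest) → Dumont₂Entry (suc (p + length pre)) x
Dumont₂From-at p [] x rest (d , _) = subst (λ q → Dumont₂Entry (suc q) x) (sym (+-identityʳ p)) d
Dumont₂From-at p (_ ∷ pre) x rest (_ , d) =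
  subst (λ q → Dumont₂Entry (suc q) x) (sym (+-suc p (length pre))) (Dumont₂From-at (suc p) pre x rest d)

Dumont₂From-snoc⁺ : ∀ p ys x → Dumont₂From p ys → Dumont₂Entry (suc (p + length ys)) x → Dumont₂From p (ys ++ [ x ])
Dumont₂From-snoc⁺ p [] x _ d = subst (λ q → Dumont₂Entry (suc q) x) (+-identityʳ p) d , tt
Dumont₂From-snoc⁺ p (y ∷ ys) x (d₀ , ds) d =
  d₀ , Dumont₂From-snoc⁺ (suc p) ys x ds (subst (λ q → Dumont₂Entry (suc q) x) (+-suc p (length ys)) d)

Dumont₂From-snoc⁻ : ∀ p ys x → Dumont₂From p (ys ++ [ x ]) → Dumont₂From p ys
Dumont₂From-snoc⁻ p [] x _ = tt
Dumont₂From-snoc⁻ p (y ∷ ys) x (d₀ , ds) = d₀ , Dumont₂From-snoc⁻ (suc p) ys x ds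

module _ {A : Set} where

  prepend-each : ∀ {k} → List (Vec A k) → List A → List (Vec A (suc k))
  prepend-each vs xs = concatMap (λ x → map (x ∷_) vs) xs

  prepend-each-head : ∀ {k} (vs : List (Vec A k)) xs {a v} → (a ∷ v) ∈ prepend-each vs xs → a ∈ xs
  prepend-each-head vs (x ∷ xs) a∷v∈ with ∈-++⁻ (map (x ∷_) vs) a∷v∈
  ... | inj₁ a∷v∈₁ with ∈-map⁻ (x ∷_) a∷v∈₁
  ...   | _ , _ , refl = here refl
  prepend-each-head vs (x ∷ xs) a∷v∈ | inj₂ a∷v∈₂ = there (prepend-each-head vs xs a∷v∈₂)

  prepend-each-unique : ∀ {k} (vs : List (Vec A k)) xs → Unique vs → Unique xs → Unique (prepend-each vs xs)
  prepend-each-unique vs [] _ _ = []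
  prepend-each-unique vs (x ∷ xs) u-vs (x∉xs ∷ u-xs) =
    Unique.++⁺ (Unique.map⁺ ∷-injectiveʳ′ u-vs) (prepend-each-unique vs xs u-vs u-xs) disjoint
    where
    ∷-injectiveʳ′ : ∀ {v w : Vec A _} → x ∷ v ≡ x ∷ w → v ≡ w
    ∷-injectiveʳ′ refl = refl
    disjoint : ∀ {v} → ¬ (v ∈ map (x ∷_) vs × v ∈ prepend-each vs xs)
    disjoint (v∈₁ , v∈₂) with ∈-map⁻ (x ∷_) v∈₁
    ... | _ , _ , refl = All¬⇒¬Any x∉xs (prepend-each-head vs xs v∈₂)

  allVecs-unique : ∀ (xs : List A) k → Unique xs → Unique (allVecs xs k)
  allVecs-unique xs zero _ = [] ∷ []
  allVecs-unique xs (suc k) u = prepend-each-unique (allVecs xs k) xs (allVecs-unique xs k u) u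

  allVecs-complete : ∀ (xs : List A) k → (∀ a → a ∈ xs) → (v : Vec A k) → v ∈ allVecs xs k
  allVecs-complete xs zero _ [] = here refl
  allVecs-complete xs (suc k) all (a ∷ v) =
    ∈-concatMap⁺ (λ x → map (x ∷_) (allVecs xs k)) (Any.map (λ { refl → ∈-map⁺ (a ∷_) (allVecs-complete xs k all v) }) (all a))

enum-filter-allWords : ∀ n {P : Vec (Fin n) n → Set} (P? : ∀ w → Dec (P w)) →
                       Enumeration P (length (filter P? (allWords n)))
enum-filter-allWords n P? = enumeration (filter P? (allWords n))
  (Unique.filter⁺ P? (allVecs-unique (allFin n) n (Unique.allFin⁺ n)))
  (λ w∈ → proj₂ (∈-filter⁻ P? {xs = allWords n} w∈))
  (λ {w} pw → ∈-filter⁺ P? (allVecs-complete (allFin n) n ∈-allFin w) pw)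
  refl

parity-∣ : ∀ x → (parity x ≡ 0ℙ × 2 ∣ x) ⊎ (parity x ≡ 1ℙ × ¬ 2 ∣ x)
parity-∣ zero = inj₁ (refl , divides 0 refl)
parity-∣ (suc zero) = inj₂ (refl , λ 2∣1 → case ∣1⇒≡1 2∣1 of λ ())
parity-∣ (suc (suc x)) with parity-∣ x
... | inj₁ (e , 2∣x) = inj₁ (e , ∣m∣n⇒∣m+n ∣-refl 2∣x)
... | inj₂ (e , 2∤x) = inj₂ (e , λ 2∣2+x → 2∤x (∣m+n∣m⇒∣n 2∣2+x ∣-refl))

odd⇒∤ : ∀ x → parity x ≡ 1ℙ → ¬ 2 ∣ x
odd⇒∤ x odd with parity-∣ x
... | inj₂ (_ , 2∤) = 2∤
... | inj₁ (even , _) with trans (sym odd) even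
...   | ()

ParityLocal : (ℕ → ℕ → Set) → (ℕ → ℕ → Set) → ℕ → ℕ → Set
ParityLocal E O x y = (2 ∣ x → E x y) × (¬ 2 ∣ x → O x y)

StepBy⇒ParityLocal : ∀ {S : Parity → ℕ → ℕ → Set} x y → S (parity x) x y → ParityLocal (S 0ℙ) (S 1ℙ) x y
StepBy⇒ParityLocal {S} x y s with parity-∣ x
... | inj₁ (e , 2∣x) = (λ _ → subst (λ b → S b x y) e s) , (λ 2∤x → ⊥-elim (2∤x 2∣x))
... | inj₂ (e , 2∤x) = (λ 2∣x → ⊥-elim (2∤x 2∣x)) , (λ _ → subst (λ b → S b x y) e s)

ParityLocal⇒StepBy : ∀ {S : Parity → ℕ → ℕ → Set} x y → ParityLocal (S 0ℙ) (S 1ℙ) x y → S (parity x) x y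
ParityLocal⇒StepBy {S} x y (even , odd) with parity-∣ x
... | inj₁ (e , 2∣x) = subst (λ b → S b x y) (sym e) (even 2∣x)
... | inj₂ (e , 2∤x) = subst (λ b → S b x y) (sym e) (odd 2∤x)

values : ∀ {n k} → Vec (Fin n) k → List ℕ
values w = tabulate (λ i → suc (toℕ (lookup w i)))

-- The predicates of Defs with the vector of values abstracted to an arbitrary function, so that
-- the translation to lists can be proved by induction on the length.
Dumont1ᶠ : (k : ℕ) → (Fin k → ℕ) → Set
Dumont1ᶠ k f = ∀ i → ((2 ∣ f i) → ∃ λ j → toℕ j ≡ suc (toℕ i) × f j < f i)
                   × (¬ (2 ∣ f i) → suc (toℕ i) ≡ k ⊎ ∃ λ j → toℕ j ≡ suc (toℕ i) × f i < f j)

Dumont2Local : ℕ → ℕ → Set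
Dumont2Local = ParityLocal (λ q x → x < q) (λ q x → q ≤ x)

Dumont2ᶠ : ℕ → (k : ℕ) → (Fin k → ℕ) → Set
Dumont2ᶠ p k f = ∀ i → Dumont2Local (p + suc (toℕ i)) (f i)

Containsᶠ : Pattern → (k : ℕ) → (Fin k → ℕ) → Set
Containsᶠ R k f = ∃ λ i → ∃ λ j → ∃ λ l → i Fin.< j × j Fin.< l × R (f i) (f j) (f l)

private
  toℕ≡1 : ∀ {k} (j : Fin (suc (suc k))) → toℕ j ≡ 1 → j ≡ suc zero
  toℕ≡1 (suc zero) refl = refl

  toℕ≡suc : ∀ {k} (j : Fin (suc k)) {i} → toℕ j ≡ suc i → ∃ λ j′ → j ≡ suc j′ × toℕ j′ ≡ i
  toℕ≡suc (suc j′) eq = j′ , refl , suc-injective eq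

Dumont1ᶠ-head : ∀ k f → Dumont1ᶠ (suc (suc k)) f → DumontStep (f zero) (f (suc zero))
Dumont1ᶠ-head k f d = ParityLocal⇒StepBy {Step} (f zero) (f (suc zero)) (even , odd)
  where
  even : 2 ∣ f zero → f (suc zero) < f zero
  even 2∣ with proj₁ (d zero) 2∣
  ... | j , eq , lt = subst (λ j → f j < f zero) (toℕ≡1 j eq) lt
  odd : ¬ 2 ∣ f zero → f zero < f (suc zero)
  odd 2∤ with proj₂ (d zero) 2∤
  ... | inj₂ (j , eq , lt) = subst (λ j → f zero < f j) (toℕ≡1 j eq) lt

Dumont1ᶠ-tail : ∀ k f → Dumont1ᶠ (suc (suc k)) f → Dumont1ᶠ (suc k) (λ i → f (suc i))
Dumont1ᶠ-tail k f d i = even , odd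
  where
  even : 2 ∣ f (suc i) → ∃ λ j → toℕ j ≡ suc (toℕ i) × f (suc j) < f (suc i)
  even 2∣ with proj₁ (d (suc i)) 2∣
  ... | j , eq , lt with toℕ≡suc j eq
  ...   | j′ , refl , eq′ = j′ , eq′ , lt
  odd : ¬ 2 ∣ f (suc i) → suc (toℕ i) ≡ suc k ⊎ ∃ λ j → toℕ j ≡ suc (toℕ i) × f (suc i) < f (suc j)
  odd 2∤ with proj₂ (d (suc i)) 2∤
  ... | inj₁ eq = inj₁ (suc-injective eq)
  ... | inj₂ (j , eq , lt) with toℕ≡suc j eq
  ...   | j′ , refl , eq′ = inj₂ (j′ , eq′ , lt)

Dumont1ᶠ⇒Dumont₁ : ∀ k f → Dumont1ᶠ k f → Dumont₁ (tabulate f)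
Dumont1ᶠ⇒Dumont₁ zero f d = [] , nothing
Dumont1ᶠ⇒Dumont₁ (suc zero) f d with parity-∣ (f zero)
... | inj₂ (odd , _) = [-] , just odd
... | inj₁ (_ , 2∣) with proj₁ (d zero) 2∣
...   | zero , () , _
Dumont1ᶠ⇒Dumont₁ (suc (suc k)) f d with Dumont1ᶠ⇒Dumont₁ (suc k) (λ i → f (suc i)) (Dumont1ᶠ-tail k f d)
... | l , lp = Dumont1ᶠ-head k f d ∷ l , lp

Dumont₁⇒Dumont1ᶠ : ∀ k f → Dumont₁ (tabulate f) → Dumont1ᶠ k f
Dumont₁⇒Dumont1ᶠ (suc zero) f (_ , just odd) zero = (λ 2∣ → ⊥-elim (odd⇒∤ (f zero) odd 2∣)) , (λ _ → inj₁ refl)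
Dumont₁⇒Dumont1ᶠ (suc (suc k)) f (s ∷ l , lp) zero with StepBy⇒ParityLocal {Step} (f zero) (f (suc zero)) s
... | even , odd = (λ 2∣ → suc zero , refl , even 2∣) , (λ 2∤ → inj₂ (suc zero , refl , odd 2∤))
Dumont₁⇒Dumont1ᶠ (suc (suc k)) f (s ∷ l , lp) (suc i) with Dumont₁⇒Dumont1ᶠ (suc k) (λ i → f (suc i)) (l , lp) i
... | even , odd = (λ 2∣ → let (j , eq , lt) = even 2∣ in suc j , cong suc eq , lt) , odd′
  where
  odd′ : ¬ 2 ∣ f (suc i) → suc (suc (toℕ i)) ≡ suc (suc k) ⊎ ∃ λ j → toℕ j ≡ suc (suc (toℕ i)) × f (suc i) < f j
  odd′ 2∤ with odd 2∤
  ... | inj₁ eq = inj₁ (cong suc eq)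
  ... | inj₂ (j , eq , lt) = inj₂ (suc j , cong suc eq , lt)

Dumont2ᶠ⇒Dumont₂From : ∀ p k f → Dumont2ᶠ p k f → Dumont₂From p (tabulate f)
Dumont2ᶠ⇒Dumont₂From p zero f d = tt
Dumont2ᶠ⇒Dumont₂From p (suc k) f d =
  subst (λ q → Dumont₂Entry q (f zero)) (+-comm p 1) (ParityLocal⇒StepBy {Step₂} _ _ (d zero)) ,
  Dumont2ᶠ⇒Dumont₂From (suc p) k (λ i → f (suc i))
    (λ i → subst (λ q → Dumont2Local q (f (suc i))) (+-suc p (suc (toℕ i))) (d (suc i)))

Dumont₂From⇒Dumont2ᶠ : ∀ p k f → Dumont₂From p (tabulate f) → Dumont2ᶠ p k f
Dumont₂From⇒Dumont2ᶠ p (suc k) f (d , _) zero =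
  subst (λ q → Dumont2Local q (f zero)) (+-comm 1 p) (StepBy⇒ParityLocal {Step₂} _ _ d)
Dumont₂From⇒Dumont2ᶠ p (suc k) f (_ , ds) (suc i) =
  subst (λ q → Dumont2Local q (f (suc i))) (sym (+-suc p (suc (toℕ i))))
    (Dumont₂From⇒Dumont2ᶠ (suc p) k (λ i → f (suc i)) ds i)

⊆-tabulate² : ∀ k (f : Fin k → ℕ) (i j : Fin k) → i Fin.< j → f i ∷ f j ∷ [] ⊆ tabulate f
⊆-tabulate² (suc k) f zero (suc j) _ = refl ∷ from∈ (∈-tabulate⁺ j)
⊆-tabulate² (suc k) f (suc i) (suc j) (s≤s i<j) = f zero ∷ʳ ⊆-tabulate² k (λ i → f (suc i)) i j i<j

⊆-tabulate³ : ∀ k (f : Fin k → ℕ) (i j l : Fin k) → i Fin.< j → j Fin.< l → f i ∷ f j ∷ f l ∷ [] ⊆ tabulate f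
⊆-tabulate³ (suc k) f zero (suc j) (suc l) _ (s≤s j<l) = refl ∷ ⊆-tabulate² k (λ i → f (suc i)) j l j<l
⊆-tabulate³ (suc k) f (suc i) (suc j) (suc l) (s≤s i<j) (s≤s j<l) =
  f zero ∷ʳ ⊆-tabulate³ k (λ i → f (suc i)) i j l i<j j<l

⊆-tabulate²⁻ : ∀ k (f : Fin k → ℕ) {a b zs} → a ∷ b ∷ zs ⊆ tabulate f → ∃ λ i → ∃ λ j → i Fin.< j × f i ≡ a × f j ≡ b
⊆-tabulate²⁻ (suc k) f (_ ∷ʳ s) with ⊆-tabulate²⁻ k (λ i → f (suc i)) s
... | i , j , i<j , refl , refl = suc i , suc j , s≤s i<j , refl , refl
⊆-tabulate²⁻ (suc k) f (refl ∷ s) with ∈-tabulate⁻ (⊆-lookup s (here refl))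
... | j , refl = zero , suc j , s≤s z≤n , refl , refl

⊆-tabulate³⁻ : ∀ k (f : Fin k → ℕ) {a b c} → a ∷ b ∷ c ∷ [] ⊆ tabulate f →
               ∃ λ i → ∃ λ j → ∃ λ l → i Fin.< j × j Fin.< l × f i ≡ a × f j ≡ b × f l ≡ c
⊆-tabulate³⁻ (suc k) f (_ ∷ʳ s) with ⊆-tabulate³⁻ k (λ i → f (suc i)) s
... | i , j , l , i<j , j<l , refl , refl , refl = suc i , suc j , suc l , s≤s i<j , s≤s j<l , refl , refl , refl
⊆-tabulate³⁻ (suc k) f (refl ∷ s) with ⊆-tabulate²⁻ k (λ i → f (suc i)) s
... | j , l , j<l , refl , refl = zero , suc j , suc l , s≤s z≤n , s≤s j<l , refl , refl , refl

Containsᶠ⇒Contains : ∀ R k f → Containsᶠ R k f → Contains R (tabulate f)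
Containsᶠ⇒Contains R k f (i , j , l , i<j , j<l , r) = f i , f j , f l , ⊆-tabulate³ k f i j l i<j j<l , r

Contains⇒Containsᶠ : ∀ R k f → Contains R (tabulate f) → Containsᶠ R k f
Contains⇒Containsᶠ R k f (_ , _ , _ , s , r) with ⊆-tabulate³⁻ k f s
... | i , j , l , i<j , j<l , refl , refl , refl = i , j , l , i<j , j<l , r

injective⇒tabulate-unique : ∀ k (f : Fin k → ℕ) → (∀ i j → f i ≡ f j → i ≡ j) → Unique (tabulate f)
injective⇒tabulate-unique k f inj = Uniqueₛ.tabulate⁺ (setoid ℕ) (inj _ _)

tabulate-unique⇒injective : ∀ k (f : Fin k → ℕ) → Unique (tabulate f) → ∀ i j → f i ≡ f j → i ≡ j
tabulate-unique⇒injective (suc k) f _ zero zero _ = refl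
tabulate-unique⇒injective (suc k) f (f₀∉ ∷ _) zero (suc j) eq = ⊥-elim (All-tabulate⁻ f₀∉ j eq)
tabulate-unique⇒injective (suc k) f (f₀∉ ∷ _) (suc i) zero eq = ⊥-elim (All-tabulate⁻ f₀∉ i (sym eq))
tabulate-unique⇒injective (suc k) f (_ ∷ u) (suc i) (suc j) eq =
  cong suc (tabulate-unique⇒injective k (λ i → f (suc i)) u i j eq)

values-bounds : ∀ {n k} (w : Vec (Fin n) k) {x} → x ∈ values w → 1 ≤ x × x ≤ n
values-bounds (y ∷ w) (here refl) = s≤s z≤n , Finₚ.toℕ<n y
values-bounds (y ∷ w) (there x∈) = values-bounds w x∈

values-injective : ∀ {n k} (w w′ : Vec (Fin n) k) → values w ≡ values w′ → w ≡ w′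
values-injective [] [] _ = refl
values-injective (x ∷ w) (y ∷ w′) eq with ∷-injective eq
... | x≡y , eq′ = cong₂ _∷_ (Finₚ.toℕ-injective (suc-injective x≡y)) (values-injective w w′ eq′)

fromValues : ∀ {n} (xs : List ℕ) → All (λ x → 1 ≤ x × x ≤ n) xs → Vec (Fin n) (length xs)
fromValues [] _ = []
fromValues (suc x ∷ xs) ((_ , x<n) ∷ bounds) = fromℕ< x<n ∷ fromValues xs bounds

values-fromValues : ∀ {n} (xs : List ℕ) (bounds : All (λ x → 1 ≤ x × x ≤ n) xs) → values (fromValues xs bounds) ≡ xs
values-fromValues [] _ = refl
values-fromValues (suc x ∷ xs) ((_ , x<n) ∷ bounds) = cong₂ _∷_ (cong suc (Finₚ.toℕ-fromℕ< x<n)) (values-fromValues xs bounds)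

values-subst : ∀ {n a b} (eq : a ≡ b) (w : Vec (Fin n) a) → values (subst (Vec (Fin n)) eq w) ≡ values w
values-subst refl w = refl

module _ {n : ℕ} where

  IsPerm⇒unique : (w : Vec (Fin n) n) → IsPerm w → Unique (values w)
  IsPerm⇒unique w perm = injective⇒tabulate-unique n (val w) (λ i j eq → perm i j (Finₚ.toℕ-injective (suc-injective eq)))

  unique⇒IsPerm : (w : Vec (Fin n) n) → Unique (values w) → IsPerm w
  unique⇒IsPerm w u i j eq = tabulate-unique⇒injective n (val w) u i j (cong (λ z → suc (toℕ z)) eq)

  transfer : ∀ {P : Vec (Fin n) n → Set} {Q : List ℕ → Set} →
             (∀ w → P w → Q (values w)) → (∀ w → Q (values w) → P w) →
             ∀ {c} → Enumeration (λ w → IsPerm w × P w) c → Enumeration (λ xs → xs ↭ range n × Q xs) c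
  transfer {P} {Q} P⇒Q Q⇒P e = enum-⇔ to from (enum-image values (λ _ _ → values-injective _ _) e)
    where
    to : ∀ {xs} → (∃ λ w → (IsPerm w × P w) × xs ≡ values w) → xs ↭ range n × Q xs
    to (w , (perm , pw) , refl) =
      unique⇒↭range n (IsPerm⇒unique w perm) (values-bounds w) (length-tabulate _) , P⇒Q w pw
    from : ∀ {xs} → xs ↭ range n × Q xs → ∃ λ w → (IsPerm w × P w) × xs ≡ values w
    from {xs} (p , qxs) = w , (unique⇒IsPerm w (subst Unique (sym values-w) (↭range-unique {n} p)) ,
                               Q⇒P w (subst Q (sym values-w) qxs)) , sym values-w
      where
      bounds : All (λ x → 1 ≤ x × x ≤ n) xs
      bounds = All.tabulate (↭range-bounds {n} p)
      w : Vec (Fin n) n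
      w = subst (Vec (Fin n)) (↭range-length {n} p) (fromValues xs bounds)
      values-w : values w ≡ xs
      values-w = trans (values-subst (↭range-length {n} p) (fromValues xs bounds)) (values-fromValues xs bounds)

Dumont₁Avoiding Dumont₂Avoiding : Pattern → ℕ → List ℕ → Set
Dumont₁Avoiding R n xs = xs ↭ range n × Dumont₁ xs × ¬ Contains R xs
Dumont₂Avoiding R n xs = xs ↭ range n × Dumont₂ xs × ¬ Contains R xs

module _ {n : ℕ} {R : Pattern} {Contains-w : Vec (Fin n) n → Set}
         (⇒Contains : ∀ w → Contains-w w → Contains R (values w))
         (Contains⇒ : ∀ w → Contains R (values w) → Contains-w w) where

  transfer₁ : ∀ {c} → Enumeration (λ w → IsPerm w × Dumont1 w × ¬ Contains-w w) c → Enumeration (Dumont₁Avoiding R n) c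
  transfer₁ = transfer (λ w (d , av) → Dumont1ᶠ⇒Dumont₁ n (val w) d , λ occ → av (Contains⇒ w occ))
                       (λ w (d , av) → Dumont₁⇒Dumont1ᶠ n (val w) d , λ occ → av (⇒Contains w occ))

  transfer₂ : ∀ {c} → Enumeration (λ w → IsPerm w × Dumont2 w × ¬ Contains-w w) c → Enumeration (Dumont₂Avoiding R n) c
  transfer₂ = transfer (λ w (d , av) → Dumont2ᶠ⇒Dumont₂From 0 n (val w) d , λ occ → av (Contains⇒ w occ))
                       (λ w (d , av) → Dumont₂From⇒Dumont2ᶠ 0 n (val w) d , λ occ → av (⇒Contains w occ))

enum-numD2av321 : ∀ n → Enumeration (Dumont₂Avoiding Is321 n) (numD2av321 n)
enum-numD2av321 n = transfer₂ (λ w → Containsᶠ⇒Contains Is321 n (val w)) (λ w → Contains⇒Containsᶠ Is321 n (val w))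
  (enum-filter-allWords n (λ w → isPerm? w ×-dec dumont2? w ×-dec ¬? (contains321? w)))

enum-numD1av231 : ∀ n → Enumeration (Dumont₁Avoiding Is231 n) (numD1av231 n)
enum-numD1av231 n = transfer₁ (λ w → Containsᶠ⇒Contains Is231 n (val w)) (λ w → Contains⇒Containsᶠ Is231 n (val w))
  (enum-filter-allWords n (λ w → isPerm? w ×-dec dumont1? w ×-dec ¬? (contains231? w)))

enum-numD1av312 : ∀ n → Enumeration (Dumont₁Avoiding Is312 n) (numD1av312 n)
enum-numD1av312 n = transfer₁ (λ w → Containsᶠ⇒Contains Is312 n (val w)) (λ w → Contains⇒Containsᶠ Is312 n (val w))
  (enum-filter-allWords n (λ w → isPerm? w ×-dec dumont1? w ×-dec ¬? (contains312? w)))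

module _ {D : List ℕ → Set} {R : Pattern} (endsBelow : EndsBelow R) (n : ℕ)
         (snoc⁺ : ∀ ys → ys ↭ range n → D ys → D (ys ++ [ suc n ]))
         (snoc⁻ : ∀ xs → xs ↭ range (suc n) → D xs → ∃ λ ys → xs ≡ ys ++ [ suc n ] × D ys) where

  enum-snoc-max : ∀ {c} → Enumeration (λ xs → xs ↭ range n × D xs × ¬ Contains R xs) c →
                  Enumeration (λ xs → xs ↭ range (suc n) × D xs × ¬ Contains R xs) c
  enum-snoc-max e = enum-⇔ to from (enum-image (_++ [ suc n ]) (λ _ _ → snoc-injective _ _) e)
    where
    to : ∀ {xs} → (∃ λ ys → (ys ↭ range n × D ys × ¬ Contains R ys) × xs ≡ ys ++ [ suc n ]) →
         xs ↭ range (suc n) × D xs × ¬ Contains R xs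
    to (ys , (p , d , av) , refl) = ++⁺ʳ [ suc n ] p , snoc⁺ ys p d ,
      Avoids-snoc-max ys (suc n) endsBelow (λ y∈ → s≤s (proj₂ (↭range-bounds p y∈))) av
    from : ∀ {xs} → xs ↭ range (suc n) × D xs × ¬ Contains R xs →
           ∃ λ ys → (ys ↭ range n × D ys × ¬ Contains R ys) × xs ≡ ys ++ [ suc n ]
    from {xs} (p , d , av) with snoc⁻ xs p d
    ... | ys , refl , dys = ys , (↭range-snoc-max⁻ n ys p , dys , Avoids-++⁻ˡ ys _ av) , refl

↭range-snoc-max-below : ∀ {n} ys → ys ++ [ suc n ] ↭ range (suc n) → ∀ {y} → y ∈ ys → y < suc n
↭range-snoc-max-below {n} ys p y∈ with m≤n⇒m<n∨m≡n (proj₂ (↭range-bounds p (∈-++⁺ˡ y∈)))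
... | inj₁ y<1+n = y<1+n
... | inj₂ refl = ⊥-elim (Unique-++-≢ (↭range-unique {suc n} p) y∈ (here refl) refl)

-- An odd maximum n + 1 cannot be followed by a larger entry, so it comes last.
enum-Dumont₁-odd : ∀ {R} → EndsBelow R → ∀ n → parity (suc n) ≡ 1ℙ → ∀ {c} →
                   Enumeration (Dumont₁Avoiding R n) c → Enumeration (Dumont₁Avoiding R (suc n)) c
enum-Dumont₁-odd endsBelow n odd = enum-snoc-max endsBelow n snoc⁺ snoc⁻
  where
  snoc⁺ : ∀ ys → ys ↭ range n → Dumont₁ ys → Dumont₁ (ys ++ [ suc n ])
  snoc⁺ ys p d = Dumont₁-snoc-max⁺ ys (suc n) d (λ y∈ → s≤s (proj₂ (↭range-bounds p y∈))) odd
  snoc⁻ : ∀ xs → xs ↭ range (suc n) → Dumont₁ xs → ∃ λ ys → xs ≡ ys ++ [ suc n ] × Dumont₁ ys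
  snoc⁻ xs p d with ∈-∃++ (↭range-∈ p (s≤s z≤n) (≤-refl {suc n}))
  ... | ys , [] , refl = ys , refl , Dumont₁-snoc-max⁻ ys (suc n) d (↭range-snoc-max-below ys p)
  ... | ys , z ∷ zs , refl = ⊥-elim (<-irrefl refl (≤-trans n+1<z z≤n+1))
    where
    n+1<z : suc n < z
    n+1<z = subst (λ b → Step b (suc n) z) odd (Linked-middle ys (proj₁ d))
    z≤n+1 : z ≤ suc n
    z≤n+1 = proj₂ (↭range-bounds p (∈-++⁺ʳ ys (there (here refl))))

-- Position n + 1 is odd, so it carries an entry ≥ n + 1, i.e. the maximum.
enum-Dumont₂-odd : ∀ {R} → EndsBelow R → ∀ n → parity (suc n) ≡ 1ℙ → ∀ {c} →
                   Enumeration (Dumont₂Avoiding R n) c → Enumeration (Dumont₂Avoiding R (suc n)) c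
enum-Dumont₂-odd endsBelow n odd = enum-snoc-max endsBelow n snoc⁺ snoc⁻
  where
  snoc⁺ : ∀ ys → ys ↭ range n → Dumont₂ ys → Dumont₂ (ys ++ [ suc n ])
  snoc⁺ ys p d = Dumont₂From-snoc⁺ 0 ys (suc n) d
    (subst (λ l → Dumont₂Entry (suc l) (suc n)) (sym (↭range-length {n} p)) (subst (λ b → Step₂ b (suc n) (suc n)) (sym odd) ≤-refl))
  snoc⁻ : ∀ xs → xs ↭ range (suc n) → Dumont₂ xs → ∃ λ ys → xs ≡ ys ++ [ suc n ] × Dumont₂ ys
  snoc⁻ xs p d with initLast xs
  ... | [] = ⊥-elim (1+n≢0 (sym (↭range-length p)))
  ... | ys ∷ʳ′ x = ys , cong (λ z → ys ++ [ z ]) x≡n+1 , Dumont₂From-snoc⁻ 0 ys x d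
    where
    |ys|≡n : length ys ≡ n
    |ys|≡n = suc-injective (trans (sym (trans (length-++ ys) (+-comm (length ys) 1))) (↭range-length p))
    n+1≤x : suc n ≤ x
    n+1≤x = subst (λ b → Step₂ b (suc n) x) odd
              (subst (λ l → Dumont₂Entry (suc l) x) |ys|≡n (Dumont₂From-at 0 ys x [] d))
    x≡n+1 : x ≡ suc n
    x≡n+1 = ≤-antisym (proj₂ (↭range-bounds p (∈-++⁺ʳ ys (here refl)))) n+1≤x

2*j+2*[m∸j] : ∀ m j → j ≤ m → 2 * j + 2 * (m ∸ j) ≡ 2 * m
2*j+2*[m∸j] m j j≤m = trans (sym (*-distribˡ-+ 2 j (m ∸ j))) (cong (2 *_) (m+[n∸m]≡n j≤m))

-- A 231-avoiding Dumont permutation of 2m + 2 is α (2m+2) γ′ (2m+1), with α on the values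
-- 1 … 2j and γ′ a copy of a permutation γ of size 2(m − j) raised by 2j.
glue231 : ℕ → ℕ → List ℕ → List ℕ → List ℕ
glue231 m j α γ = α ++ suc (suc (2 * m)) ∷ (raise (2 * j) γ ++ [ suc (2 * m) ])

module Glue231 (m j : ℕ) (j≤m : j ≤ m) (α γ : List ℕ) (pα : α ↭ range (2 * j)) (pγ : γ ↭ range (2 * (m ∸ j))) where

  N : ℕ
  N = suc (suc (2 * m))
  γ′ rest : List ℕ
  γ′ = raise (2 * j) γ
  rest = γ′ ++ [ suc (2 * m) ]

  α≤2m : ∀ {x} → x ∈ α → x ≤ 2 * m
  α≤2m x∈ = ≤-trans (proj₂ (↭range-bounds {2 * j} pα x∈)) (*-monoʳ-≤ 2 j≤m)

  γ′-bounds : ∀ {x} → x ∈ γ′ → suc (2 * j) ≤ x × x ≤ 2 * m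
  γ′-bounds x∈ with ∈-map⁻ (2 * j +_) x∈
  ... | y , y∈ , refl = let (1≤y , y≤) = ↭range-bounds {2 * (m ∸ j)} pγ y∈ in
    subst (_≤ 2 * j + y) (+-comm (2 * j) 1) (+-monoʳ-≤ (2 * j) 1≤y) ,
    ≤-trans (+-monoʳ-≤ (2 * j) y≤) (≤-reflexive (2*j+2*[m∸j] m j j≤m))

  rest<N : ∀ {x} → x ∈ rest → x < N
  rest<N x∈ with ∈-++⁻ γ′ x∈
  ... | inj₁ x∈γ′ = s≤s (m≤n⇒m≤1+n (proj₂ (γ′-bounds x∈γ′)))
  ... | inj₂ (here refl) = ≤-refl

  α<N∷rest : ∀ {a b} → a ∈ α → b ∈ N ∷ rest → a < b
  α<N∷rest a∈ (here refl) = s≤s (m≤n⇒m≤1+n (α≤2m a∈))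
  α<N∷rest a∈ (there b∈) with ∈-++⁻ γ′ b∈
  ... | inj₁ b∈γ′ = <-≤-trans (s≤s (proj₂ (↭range-bounds {2 * j} pα a∈))) (proj₁ (γ′-bounds b∈γ′))
  ... | inj₂ (here refl) = s≤s (α≤2m a∈)

  ↭range : glue231 m j α γ ↭ range N
  ↭range = ↭range-insert-max (suc (2 * m))
    (↭-trans (↭-reflexive (sym (++-assoc α γ′ [ suc (2 * m) ])))
      (++⁺ʳ [ suc (2 * m) ] (subst (λ n → α ++ γ′ ↭ range n) (2*j+2*[m∸j] m j j≤m)
                                   (↭range-++ (2 * j) (2 * (m ∸ j)) pα (raise-↭ (2 * j) (2 * (m ∸ j)) pγ)))))

  dumont₁ : Dumont₁ α → Dumont₁ γ → Dumont₁ (glue231 m j α γ)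
  dumont₁ (lα , lpα) (lγ , lpγ) =
    Linkedₚ.++⁺ lα (last-connects α lpα (λ a∈ → α<N∷rest a∈ (here refl)))
      (Linked-∷ 0ℙ rest (parity-2* m) rest<N
        (Linkedₚ.++⁺ (Linked-raise⁺ j lγ) (last-connects γ′ (LastParity-raise⁺ 1ℙ j γ lpγ) (λ x∈ → s≤s (proj₂ (γ′-bounds x∈)))) [-])) ,
    subst (AllMaybe (HasParity 1ℙ)) (sym (trans (last-++ α N rest) (last-snoc (N ∷ γ′) (suc (2 * m))))) (just (parity-1+2* m))

  avoids : ¬ Contains Is231 α → ¬ Contains Is231 γ → ¬ Contains Is231 (glue231 m j α γ)
  avoids avα avγ occ with Contains-⊕ α (N ∷ rest) 231-endsBelow α<N∷rest occ
  ... | inj₁ occα = avα occα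
  ... | inj₂ occ′ with Contains-∷ occ′
  ...   | inj₂ (b , _ , s , _ , N<b) = <-asym N<b (rest<N (⊆-lookup s (here refl)))
  ...   | inj₁ occ-rest = Avoids-snoc-max γ′ (suc (2 * m)) 231-endsBelow (λ x∈ → s≤s (proj₂ (γ′-bounds x∈)))
                            (λ occγ′ → avγ (Contains-raise⁻ (2 * j) γ (<×<-cancelˡ (2 * j)) occγ′)) occ-rest

glue231-sound : ∀ m j α γ → j ≤ m → Dumont₁Avoiding Is231 (2 * j) α → Dumont₁Avoiding Is231 (2 * (m ∸ j)) γ →
                Dumont₁Avoiding Is231 (suc (suc (2 * m))) (glue231 m j α γ)
glue231-sound m j α γ j≤m (pα , dα , avα) (pγ , dγ , avγ) = ↭range , dumont₁ dα dγ , avoids avα avγ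
  where open Glue231 m j j≤m α γ pα pγ

-- The smallest entry of a final segment is followed, if at all, by a larger entry, so it is odd.
final-segment-min-odd : ∀ pre β k l → β ↭ raise k (range l) → 1 ≤ l → Dumont₁ (pre ++ β) → parity (suc k) ≡ 1ℙ
final-segment-min-odd pre β k l p 1≤l (linked , lp) with parity (suc k) in par
... | 1ℙ = refl
... | 0ℙ with ∈-∃++ (∈-resp-↭ (↭-sym p) (∈-raise-range⁺ k l (≤-refl {1}) 1≤l))
...   | β₁ , [] , refl with LastParity-snoc⁻ (pre ++ β₁) (k + 1) (subst (LastParity 1ℙ) (sym (++-assoc pre β₁ _)) lp)
...     | odd = case trans (sym odd) (trans (cong parity (+-comm k 1)) par) of λ ()
final-segment-min-odd pre β k l p 1≤l (linked , lp) | 0ℙ | β₁ , z ∷ β₂ , refl =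
  ⊥-elim (<-irrefl refl (≤-trans z<k+1 (proj₁ (↭raise-range-bounds k l p (∈-++⁺ʳ β₁ (there (here refl)))))))
  where
  z<k+1 : suc z ≤ suc k
  z<k+1 = subst (suc z ≤_) (+-comm k 1)
            (subst (λ b → Step b (k + 1) z) (trans (cong parity (+-comm k 1)) par)
              (Linked-middle (pre ++ β₁) (subst (Linked DumontStep) (sym (++-assoc pre β₁ _)) linked)))

-- An odd largest entry cannot be followed by a larger one, so it is last.
final-segment-odd-max-last : ∀ pre β k l → β ↭ raise k (range l) → 1 ≤ l → Linked DumontStep (pre ++ β) →
                             parity (k + l) ≡ 1ℙ → ∃ λ γ′ → β ≡ γ′ ++ [ k + l ]
final-segment-odd-max-last pre β k l p 1≤l linked odd with ∈-∃++ (∈-resp-↭ (↭-sym p) (∈-raise-range⁺ k l 1≤l (≤-refl {l})))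
... | γ′ , [] , refl = γ′ , refl
... | γ′ , z ∷ zs , refl = ⊥-elim (<-irrefl refl (≤-trans (s≤s z≤k+l) k+l<z))
  where
  k+l<z : k + l < z
  k+l<z = subst (λ b → Step b (k + l) z) odd
            (Linked-middle (pre ++ γ′) (subst (Linked DumontStep) (sym (++-assoc pre γ′ _)) linked))
  z≤k+l : z ≤ k + l
  z≤k+l = proj₂ (↭raise-range-bounds k l p (∈-++⁺ʳ γ′ (there (here refl))))

Dumont₁-before-larger : ∀ α {y rest} → Linked DumontStep (α ++ y ∷ rest) → (∀ {a} → a ∈ α → a < y) → Dumont₁ α
Dumont₁-before-larger α linked α<y with Linked-++⁻ α linked
... | lα , c , _ = lα , connects⇒LastParity 1ℙ α c α<y

raised-Dumont₁-before-larger : ∀ j γ {y} → Linked DumontStep (raise (2 * j) γ ++ [ y ]) →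
                               (∀ {x} → x ∈ raise (2 * j) γ → x < y) → Dumont₁ γ
raised-Dumont₁-before-larger j γ linked below with Dumont₁-before-larger (raise (2 * j) γ) linked below
... | lγ′ , lpγ′ = Linked-raise⁻ j lγ′ , LastParity-raise⁻ 1ℙ j γ lpγ′

↭raise-range-snoc⁻ : ∀ γ′ k l → γ′ ++ [ k + suc l ] ↭ raise k (range (suc l)) → γ′ ↭ raise k (range l)
↭raise-range-snoc⁻ γ′ k l p = ↭-trans (↭-reflexive (sym (++-identityʳ γ′)))
  (↭-trans (drop-mid γ′ (raise k (range l)) (subst (γ′ ++ [ k + suc l ] ↭_) (raise-range-suc k l) p))
           (↭-reflexive (++-identityʳ _)))

avoid231-max-separates : ∀ N α β → α ++ N ∷ β ↭ range N → ¬ Contains Is231 (α ++ N ∷ β) →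
                         ∀ {a b} → a ∈ α → b ∈ β → a < b
avoid231-max-separates N α β p av {a} {b} a∈ b∈ =
  ≤∧≢⇒< (≮⇒≥ λ b<a → av (a , N , b , Sublist.++⁺ (from∈ a∈) (refl ∷ from∈ b∈) , b<a , a<N)) (Unique-++-≢ u a∈ (there b∈))
  where
  u : Unique (α ++ N ∷ β)
  u = ↭range-unique {N} p
  a<N : a < N
  a<N = ≤∧≢⇒< (proj₂ (↭range-bounds p (∈-++⁺ˡ a∈))) (Unique-++-≢ u a∈ (here refl))

2*j+l≡2*m : ∀ m j l → 2 * j + l ≡ 2 * m → j ≤ m × l ≡ 2 * (m ∸ j)
2*j+l≡2*m m j l eq =
  *-cancelˡ-≤ 2 (≤-trans (m≤m+n (2 * j) l) (≤-reflexive eq)) ,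
  trans (sym (m+n∸m≡n (2 * j) l)) (trans (cong (_∸ 2 * j) eq) (sym (*-distribˡ-∸ 2 m j)))

even-not-last : ∀ α β {N} → parity N ≡ 0ℙ → Dumont₁ (α ++ N ∷ β) → 1 ≤ length β
even-not-last α (_ ∷ _) _ _ = s≤s z≤n
even-not-last α [] {N} even (_ , lp) with trans (sym even) (LastParity-snoc⁻ α N lp)
... | ()

module Split231 (m : ℕ) (α β : List ℕ) (p : α ++ suc (suc (2 * m)) ∷ β ↭ range (suc (suc (2 * m))))
                (d : Dumont₁ (α ++ suc (suc (2 * m)) ∷ β)) (av : ¬ Contains Is231 (α ++ suc (suc (2 * m)) ∷ β)) where

  N : ℕ
  N = suc (suc (2 * m))

  α<β : ∀ {a b} → a ∈ α → b ∈ β → a < b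
  α<β = avoid231-max-separates N α β p av
  split : α ↭ range (length α) × β ↭ raise (length α) (range (length β))
  split = ↭range-split (suc (2 * m)) α β (↭range-drop-max _ α β p) α<β
  k l : ℕ
  k = length α
  l = length β

  k+l≡ : k + l ≡ suc (2 * m)
  k+l≡ = trans (sym (length-++ α)) (↭range-length (↭range-drop-max _ α β p))

  α<N : ∀ {a} → a ∈ α → a < N
  α<N a∈ = ≤∧≢⇒< (proj₂ (↭range-bounds p (∈-++⁺ˡ a∈))) (Unique-++-≢ (↭range-unique {N} p) a∈ (here refl))

  dα : Dumont₁ α
  dα = Dumont₁-before-larger α (proj₁ d) α<N

  d′ : Dumont₁ ((α ++ [ N ]) ++ β)
  d′ = subst Dumont₁ (sym (++-assoc α [ N ] β)) d

  1≤l : 1 ≤ l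
  1≤l = even-not-last α β (parity-2* m) d

  k-even : parity k ≡ 0ℙ
  k-even = ⁻¹-injective (trans (sym (parity-suc k)) (final-segment-min-odd (α ++ [ N ]) β k l (proj₂ split) 1≤l d′))

  j : ℕ
  j = proj₁ (parity≡0ℙ⇒2* k k-even)
  k≡2j : k ≡ 2 * j
  k≡2j = proj₂ (parity≡0ℙ⇒2* k k-even)

  l′ : ℕ
  l′ = pred l
  l≡1+l′ : l ≡ suc l′
  l≡1+l′ = sym (suc-pred l {{>-nonZero 1≤l}})

  max-last : ∃ λ γ′ → β ≡ γ′ ++ [ length α + length β ]
  max-last = final-segment-odd-max-last (α ++ [ N ]) β k l (proj₂ split) 1≤l (proj₁ d′)
               (trans (cong parity k+l≡) (parity-1+2* m))
  γ′ : List ℕ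
  γ′ = proj₁ max-last
  β≡ : β ≡ γ′ ++ [ k + l ]
  β≡ = proj₂ max-last

  γ′↭ : γ′ ↭ raise k (range l′)
  γ′↭ = ↭raise-range-snoc⁻ γ′ k l′
    (subst₂ (λ l″ l‴ → γ′ ++ [ k + l″ ] ↭ raise k (range l‴)) l≡1+l′ l≡1+l′ (subst (_↭ raise k (range l)) β≡ (proj₂ split)))

  γ : List ℕ
  γ = proj₁ (↭raise-range⁻ k l′ γ′↭)
  γ′≡ : γ′ ≡ raise (2 * j) γ
  γ′≡ = trans (proj₁ (proj₂ (↭raise-range⁻ k l′ γ′↭))) (cong (λ k → raise k γ) k≡2j)

  j≤m×l′≡ : j ≤ m × l′ ≡ 2 * (m ∸ j)
  j≤m×l′≡ = 2*j+l≡2*m m j l′ (suc-injective (begin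
    suc (2 * j + l′)  ≡⟨ sym (+-suc (2 * j) l′) ⟩
    2 * j + suc l′    ≡⟨ cong₂ _+_ (sym k≡2j) (sym l≡1+l′) ⟩
    k + l             ≡⟨ k+l≡ ⟩
    suc (2 * m)       ∎))
    where open ≡-Reasoning

  γ↭ : γ ↭ range (2 * (m ∸ j))
  γ↭ = subst (λ n → γ ↭ range n) (proj₂ j≤m×l′≡) (proj₂ (proj₂ (↭raise-range⁻ k l′ γ′↭)))

  xs≡ : α ++ N ∷ β ≡ glue231 m j α γ
  xs≡ = cong (λ t → α ++ N ∷ t) (trans β≡ (cong₂ (λ u v → u ++ [ v ]) γ′≡ k+l≡))

  β≡raised : β ≡ raise (2 * j) γ ++ [ k + l ]
  β≡raised = trans β≡ (cong (_++ [ k + l ]) γ′≡)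

  raised<k+l : ∀ {x} → x ∈ raise (2 * j) γ → x < k + l
  raised<k+l x∈ = ≤-trans (s≤s (proj₂ (↭raise-range-bounds k l′ γ′↭ (subst (_ ∈_) (sym γ′≡) x∈))))
                          (≤-reflexive (trans (sym (+-suc k l′)) (cong (k +_) (sym l≡1+l′))))

  dγ : Dumont₁ γ
  dγ = raised-Dumont₁-before-larger j γ
         (subst (Linked DumontStep) β≡raised (Linked.tail (proj₂ (proj₂ (Linked-++⁻ α (proj₁ d)))))) raised<k+l

  avγ : ¬ Contains Is231 γ
  avγ occ = av (subst (Contains Is231) (sym xs≡)
    (Contains-⊆ (Sublist.++⁺ˡ α (N ∷ʳ Sublist.++⁺ʳ _ ⊆-refl)) (Contains-raise⁺ (2 * j) γ (<×<-monoˡ (2 * j)) occ)))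

glue231-complete : ∀ m xs → Dumont₁Avoiding Is231 (suc (suc (2 * m))) xs →
  ∃ λ j → j < suc m × Glued (λ j → Dumont₁Avoiding Is231 (2 * j)) (λ j → Dumont₁Avoiding Is231 (2 * (m ∸ j))) (glue231 m) j xs
glue231-complete m xs (p , d , av) with ∈-∃++ (↭range-∈ p (s≤s z≤n) (≤-refl {suc (suc (2 * m))}))
... | α , β , refl = j , s≤s (proj₁ j≤m×l′≡) , α , γ ,
  (subst (λ n → α ↭ range n) k≡2j (proj₁ split) , dα , Avoids-++⁻ˡ α _ av) , (γ↭ , dγ , avγ) , xs≡
  where open Split231 m α β p d av

glue231-injective : ∀ m {i j α γ α′ γ′} → i < suc m → j < suc m →
                    Dumont₁Avoiding Is231 (2 * i) α → Dumont₁Avoiding Is231 (2 * (m ∸ i)) γ →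
                    Dumont₁Avoiding Is231 (2 * j) α′ → Dumont₁Avoiding Is231 (2 * (m ∸ j)) γ′ →
                    glue231 m i α γ ≡ glue231 m j α′ γ′ → i ≡ j × α ≡ α′ × γ ≡ γ′
glue231-injective m {i} {j} {α} {γ} {α′} {γ′} (s≤s i≤m) (s≤s j≤m) (pα , _) _ (pα′ , _) _ eq
  with split-at-first α α′ (N∉ pα i≤m) (N∉ pα′ j≤m) eq
  where
  N∉ : ∀ {a t} → a ↭ range (2 * t) → t ≤ m → suc (suc (2 * m)) ∉ a
  N∉ {t = t} p t≤m N∈ = <-irrefl refl (≤-trans (s≤s (proj₂ (↭range-bounds {2 * t} p N∈))) (s≤s (m≤n⇒m≤1+n (*-monoʳ-≤ 2 t≤m))))
... | refl , tails≡ = i≡j , refl , raise-injective (2 * j) (subst (λ t → raise (2 * t) γ ≡ raise (2 * j) γ′) i≡j (snoc-injective _ _ tails≡))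
  where
  i≡j : i ≡ j
  i≡j = 2*-injective (trans (sym (↭range-length {2 * i} pα)) (↭range-length {2 * j} pα′))

enum-Dumont-empty : ∀ {D : List ℕ → Set} {R} → D [] → Enumeration (λ xs → xs ↭ range 0 × D xs × ¬ Contains R xs) 1
enum-Dumont-empty d = enum-singleton [] (↭-refl , d , λ { (_ , _ , _ , () , _) }) (λ (p , _) → ↭-empty-inv p)

enum-231-even : ∀ m → Enumeration (Dumont₁Avoiding Is231 (2 * m)) (ballot m 0)
enum-231-even = ballot-induction (λ m → Enumeration (Dumont₁Avoiding Is231 (2 * m)) (ballot m 0)) (enum-Dumont-empty ([] , nothing)) step
  where
  step : ∀ m → (∀ j → j ≤ m → Enumeration (Dumont₁Avoiding Is231 (2 * j)) (ballot j 0)) →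
         Enumeration (Dumont₁Avoiding Is231 (2 * suc m)) (ballot (suc m) 0)
  step m ih = enum-by-gluing (Dumont₁Avoiding Is231 (2 * suc m)) (λ j → Dumont₁Avoiding Is231 (2 * j)) (λ j → Dumont₁Avoiding Is231 (2 * j)) (glue231 m) m
    ih ih (glue231-injective m)
    (λ j α γ j≤m dα dγ → subst (λ n → Dumont₁Avoiding Is231 n (glue231 m j α γ)) (sym (*-suc 2 m)) (glue231-sound m j α γ j≤m dα dγ))
    (λ xs d → glue231-complete m xs (subst (λ n → Dumont₁Avoiding Is231 n xs) (*-suc 2 m) d))

-- The auxiliary class of the 312 case: τ in glue312 is followed by 2, so its last entry is even.
EvenEnded312 : ℕ → List ℕ → Set
EvenEnded312 k xs = xs ↭ range (2 * k) × Linked DumontStep xs × LastParity 0ℙ xs × ¬ Contains Is312 xs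

glue312 : ℕ → List ℕ → List ℕ → List ℕ
glue312 j τ σ = raise 2 τ ++ 2 ∷ 1 ∷ raise (2 * suc j) σ

-- When nothing follows 2 1, an even ending forces the shape 1 (τ raised by 2) 2 instead.
glue312′ : ℕ → List ℕ → List ℕ → List ℕ
glue312′ j τ [] = 1 ∷ (raise 2 τ ++ [ 2 ])
glue312′ j τ σ@(_ ∷ _) = glue312 j τ σ

raised-by-2-bounds : ∀ j τ → τ ↭ range (2 * j) → ∀ {x} → x ∈ raise 2 τ → 3 ≤ x × x ≤ 2 * suc j
raised-by-2-bounds j τ p x∈ with ↭raise-range-bounds 2 (2 * j) (raise-↭ 2 (2 * j) p) x∈
... | 3≤x , x≤ = 3≤x , ≤-trans x≤ (≤-reflexive (sym (*-suc 2 j)))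

prefix312-↭ : ∀ j τ → τ ↭ range (2 * j) → raise 2 τ ++ 2 ∷ 1 ∷ [] ↭ range (2 * suc j)
prefix312-↭ j τ p = ↭-trans (↭-++-comm (raise 2 τ) (2 ∷ 1 ∷ []))
  (↭-trans (↭-swap 2 1 (raise-↭ 2 (2 * j) p)) (↭-reflexive (trans (sym (range-+ 2 (2 * j))) (cong range (sym (*-suc 2 j))))))

prefix312-avoids : ∀ j τ → τ ↭ range (2 * j) → ¬ Contains Is312 τ → ¬ Contains Is312 (raise 2 τ ++ 2 ∷ 1 ∷ [])
prefix312-avoids j τ p avτ occ with Contains-++ (raise 2 τ) (2 ∷ 1 ∷ []) occ
... | inj₁ occτ = avτ (Contains-raise⁻ 2 τ (<×<-cancelˡ 2) occτ)
... | inj₂ (inj₁ (_ , _ , _ , _ ∷ʳ (_ ∷ʳ ()) , _))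
... | inj₂ (inj₁ (_ , _ , _ , _ ∷ʳ (_ ∷ ()) , _))
... | inj₂ (inj₁ (_ , _ , _ , _ ∷ (_ ∷ʳ ()) , _))
... | inj₂ (inj₁ (_ , _ , _ , _ ∷ (_ ∷ ()) , _))
... | inj₂ (inj₂ (_ , _ , _ , (b<c , _) , inj₁ (s , c∈))) =
  <-irrefl refl (≤-trans (s≤s (≤-trans (proj₁ (raised-by-2-bounds j τ p (⊆-lookup s (there (here refl))))) (<⇒≤ b<c))) (≤2 c∈))
  where
  ≤2 : ∀ {c} → c ∈ 2 ∷ 1 ∷ [] → suc c ≤ 3
  ≤2 (here refl) = ≤-refl
  ≤2 (there (here refl)) = s≤s (s≤s z≤n)
... | inj₂ (inj₂ (_ , _ , _ , (b<c , _) , inj₂ (_ , refl ∷ (refl ∷ [])))) = <-asym b<c (s≤s (s≤s z≤n))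
... | inj₂ (inj₂ (_ , _ , _ , _ , inj₂ (_ , refl ∷ (_ ∷ʳ ()))))
... | inj₂ (inj₂ (_ , _ , _ , _ , inj₂ (_ , _ ∷ʳ (refl ∷ ()))))
... | inj₂ (inj₂ (_ , _ , _ , _ , inj₂ (_ , _ ∷ʳ (_ ∷ʳ ()))))

module Glue312 (j : ℕ) (τ σ : List ℕ) (L : ℕ) (pτ : τ ↭ range (2 * j)) (pσ : σ ↭ range L) where

  K : ℕ
  K = 2 * suc j
  prefix : List ℕ
  prefix = raise 2 τ ++ 2 ∷ 1 ∷ []

  above-prefix : ∀ {x} → x ∈ raise K σ → suc K ≤ x
  above-prefix x∈ = proj₁ (↭raise-range-bounds K L (raise-↭ K L pσ) x∈)

  prefix<σ : ∀ {a b} → a ∈ prefix → b ∈ raise K σ → a < b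
  prefix<σ a∈ b∈ = <-≤-trans (s≤s (proj₂ (↭range-bounds (prefix312-↭ j τ pτ) a∈))) (above-prefix b∈)

  reassociate : prefix ++ raise K σ ≡ glue312 j τ σ
  reassociate = ++-assoc (raise 2 τ) (2 ∷ 1 ∷ []) (raise K σ)

  ↭range : glue312 j τ σ ↭ range (K + L)
  ↭range = subst (_↭ range (K + L)) reassociate (↭range-++ K L (prefix312-↭ j τ pτ) (raise-↭ K L pσ))

  linked : Linked DumontStep τ → LastParity 0ℙ τ → Linked DumontStep σ → Linked DumontStep (glue312 j τ σ)
  linked lτ lpτ lσ = Linkedₚ.++⁺ (Linked-raise⁺ 1 lτ)
    (last-connects (raise 2 τ) (LastParity-raise⁺ 0ℙ 1 τ lpτ) (λ x∈ → proj₁ (raised-by-2-bounds j τ pτ x∈)))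
    (s≤s (s≤s z≤n) ∷ Linked-∷ 1ℙ (raise K σ) refl (λ x∈ → <-≤-trans (s≤s (s≤s z≤n)) (above-prefix x∈)) (Linked-raise⁺ (suc j) lσ))

  avoids : ¬ Contains Is312 τ → ¬ Contains Is312 σ → ¬ Contains Is312 (glue312 j τ σ)
  avoids avτ avσ occ with Contains-⊕ prefix (raise K σ) 312-endsBelow prefix<σ (subst (Contains Is312) (sym reassociate) occ)
  ... | inj₁ occ₁ = prefix312-avoids j τ pτ avτ occ₁
  ... | inj₂ occ₂ = avσ (Contains-raise⁻ K σ (<×<-cancelˡ K) occ₂)

  last-glue : last (glue312 j τ σ) ≡ last (1 ∷ raise K σ)
  last-glue = last-++ (raise 2 τ) 2 (1 ∷ raise K σ)

2*[1+j]+2*[m∸j] : ∀ m j → j ≤ m → 2 * suc j + 2 * (m ∸ j) ≡ 2 * suc m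
2*[1+j]+2*[m∸j] m j j≤m = 2*j+2*[m∸j] (suc m) (suc j) (s≤s j≤m)

glue312-sound : ∀ m j τ σ → j ≤ m → EvenEnded312 j τ → Dumont₁Avoiding Is312 (2 * (m ∸ j)) σ →
                Dumont₁Avoiding Is312 (2 * suc m) (glue312 j τ σ)
glue312-sound m j τ σ j≤m (pτ , lτ , lpτ , avτ) (pσ , (lσ , lpσ) , avσ) =
  subst (λ n → glue312 j τ σ ↭ range n) (2*[1+j]+2*[m∸j] m j j≤m) ↭range ,
  (linked lτ lpτ lσ , subst (AllMaybe (HasParity 1ℙ)) (sym last-glue) (last-odd σ lpσ)) , avoids avτ avσ
  where
  open Glue312 j τ σ (2 * (m ∸ j)) pτ pσ
  last-odd : ∀ σ → LastParity 1ℙ σ → LastParity 1ℙ (1 ∷ raise K σ)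
  last-odd [] _ = just refl
  last-odd (s ∷ σ) lp = LastParity-raise⁺ 1ℙ (suc j) (s ∷ σ) lp

1∷τ∷2-sound : ∀ k τ → EvenEnded312 k τ → EvenEnded312 (suc k) (1 ∷ (raise 2 τ ++ [ 2 ]))
1∷τ∷2-sound k τ (pτ , lτ , lpτ , avτ) = ↭range , linked , LastParity-snoc (1 ∷ raise 2 τ) 2 refl , avoids
  where
  τ-bounds : ∀ {x} → x ∈ raise 2 τ → 3 ≤ x × x ≤ 2 * suc k
  τ-bounds = raised-by-2-bounds k τ pτ
  above-1 : ∀ {y} → y ∈ raise 2 τ ++ [ 2 ] → 1 < y
  above-1 y∈ with ∈-++⁻ (raise 2 τ) y∈
  ... | inj₁ y∈τ = ≤-trans (s≤s (s≤s z≤n)) (proj₁ (τ-bounds y∈τ))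
  ... | inj₂ (here refl) = s≤s (s≤s z≤n)
  ↭range : 1 ∷ (raise 2 τ ++ [ 2 ]) ↭ range (2 * suc k)
  ↭range = ↭-trans (↭-prep 1 (↭-trans (↭-++-comm (raise 2 τ) [ 2 ]) (↭-prep 2 (raise-↭ 2 (2 * k) pτ))))
                   (↭-reflexive (trans (sym (range-+ 2 (2 * k))) (cong range (sym (*-suc 2 k)))))
  linked : Linked DumontStep (1 ∷ (raise 2 τ ++ [ 2 ]))
  linked = Linked-∷ 1ℙ _ refl above-1
    (Linkedₚ.++⁺ (Linked-raise⁺ 1 lτ) (last-connects (raise 2 τ) (LastParity-raise⁺ 0ℙ 1 τ lpτ) (λ x∈ → proj₁ (τ-bounds x∈))) [-])
  avoids : ¬ Contains Is312 (1 ∷ (raise 2 τ ++ [ 2 ]))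
  avoids occ with Contains-∷ occ
  ... | inj₂ (_ , _ , _ , b<c , c<1) = n≮0 (≤-trans b<c (≤-pred c<1))
  ... | inj₁ occ′ with Contains-++ (raise 2 τ) [ 2 ] occ′
  ...   | inj₁ occτ = avτ (Contains-raise⁻ 2 τ (<×<-cancelˡ 2) occτ)
  ...   | inj₂ (inj₁ (_ , _ , _ , _ ∷ʳ () , _))
  ...   | inj₂ (inj₁ (_ , _ , _ , _ ∷ () , _))
  ...   | inj₂ (inj₂ (_ , _ , _ , (b<c , _) , inj₁ (s , here refl))) =
    <-irrefl refl (≤-trans (s≤s (≤-trans (proj₁ (τ-bounds (⊆-lookup s (there (here refl))))) (<⇒≤ b<c))) (s≤s (s≤s (s≤s z≤n))))
  ...   | inj₂ (inj₂ (_ , _ , _ , _ , inj₂ (_ , _ ∷ʳ ())))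
  ...   | inj₂ (inj₂ (_ , _ , _ , _ , inj₂ (_ , _ ∷ ())))

glue312′-sound : ∀ k j τ σ → j ≤ k → EvenEnded312 j τ → EvenEnded312 (k ∸ j) σ → EvenEnded312 (suc k) (glue312′ j τ σ)
glue312′-sound k j τ [] j≤k eτ (pσ , _) = subst (λ i → EvenEnded312 (suc i) (glue312′ j τ [])) j≡k (1∷τ∷2-sound j τ eτ)
  where
  j≡k : j ≡ k
  j≡k = ≤-antisym j≤k (m∸n≡0⇒m≤n (2*-injective (sym (↭range-length {2 * (k ∸ j)} pσ))))
glue312′-sound k j τ σ@(_ ∷ _) j≤k (pτ , lτ , lpτ , avτ) (pσ , lσ , lpσ , avσ) =
  subst (λ n → glue312 j τ σ ↭ range n) (2*[1+j]+2*[m∸j] k j j≤k) ↭range , linked lτ lpτ lσ ,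
  subst (AllMaybe (HasParity 0ℙ)) (sym last-glue) (LastParity-raise⁺ 0ℙ (suc j) σ lpσ) , avoids avτ avσ
  where open Glue312 j τ σ (2 * (k ∸ j)) pτ pσ

split-at-one : ∀ N α β → α ++ 1 ∷ β ↭ range N → ¬ Contains Is312 (α ++ 1 ∷ β) →
               α ↭ raise 1 (range (length α)) × β ↭ raise (suc (length α)) (range (length β)) × suc (length α) + length β ≡ N
split-at-one N α β p av = α↭ , subst (λ k → β ↭ raise k (range (length β))) |α1| (proj₂ split) , length≡
  where
  u : Unique (α ++ 1 ∷ β)
  u = ↭range-unique {N} p
  1<β : ∀ {b} → b ∈ β → 1 < b
  1<β b∈ = ≤∧≢⇒< (proj₁ (↭range-bounds {N} p (∈-++⁺ʳ α (there b∈)))) (1≢β b∈)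
    where
    1≢β : ∀ {b} → b ∈ β → 1 ≢ b
    1≢β b∈ with Unique-++⁻ʳ {α} u
    ... | 1∉β ∷ _ = λ 1≡b → All¬⇒¬Any 1∉β (subst (_∈ β) (sym 1≡b) b∈)
  α1<β : ∀ {a b} → a ∈ α ++ [ 1 ] → b ∈ β → a < b
  α1<β a∈ b∈ with ∈-++⁻ α a∈
  ... | inj₂ (here refl) = 1<β b∈
  ... | inj₁ a∈α = ≤∧≢⇒< (≮⇒≥ λ b<a → av (_ , 1 , _ , Sublist.++⁺ (from∈ a∈α) (refl ∷ from∈ b∈) , 1<β b∈ , b<a))
                         (Unique-++-≢ u a∈α (there b∈))
  p′ : (α ++ [ 1 ]) ++ β ↭ range N
  p′ = subst (_↭ range N) (sym (++-assoc α [ 1 ] β)) p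
  split : α ++ [ 1 ] ↭ range (length (α ++ [ 1 ])) × β ↭ raise (length (α ++ [ 1 ])) (range (length β))
  split = ↭range-split N (α ++ [ 1 ]) β p′ α1<β
  |α1| : length (α ++ [ 1 ]) ≡ suc (length α)
  |α1| = trans (length-++ α) (+-comm (length α) 1)
  α↭ : α ↭ raise 1 (range (length α))
  α↭ = subst₂ _↭_ (++-identityʳ α) refl
         (drop-mid α [] (subst (α ++ [ 1 ] ↭_) (trans (cong range |α1|) (range-+ 1 (length α))) (proj₁ split)))
  length≡ : suc (length α) + length β ≡ N
  length≡ = trans (cong (_+ length β) (sym |α1|)) (trans (sym (length-++ (α ++ [ 1 ]))) (↭range-length p′))

-- The largest entry of a block that is followed by a smaller entry must be even: being largest,
-- it is followed by something smaller in any case.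
block-max-even : ∀ S y rest k l → S ↭ raise k (range l) → 1 ≤ l → Linked DumontStep (S ++ y ∷ rest) → y < k + l →
                 parity (k + l) ≡ 0ℙ
block-max-even S y rest k l p 1≤l linked y<max with parity (k + l) in par
... | 0ℙ = refl
... | 1ℙ with ∈-∃++ (∈-resp-↭ (↭-sym p) (∈-raise-range⁺ k l 1≤l (≤-refl {l})))
...   | s₁ , s₂ , refl = ⊥-elim (<-irrefl refl (≤-trans (s≤s (next≤max s₂ p)) (max<next s₂ linked′)))
  where
  next : List ℕ → ℕ
  next [] = y
  next (z ∷ _) = z
  next≤max : ∀ s₂ → s₁ ++ k + l ∷ s₂ ↭ raise k (range l) → next s₂ ≤ k + l
  next≤max [] _ = <⇒≤ y<max
  next≤max (z ∷ _) p = proj₂ (↭raise-range-bounds k l p (∈-++⁺ʳ s₁ (there (here refl))))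
  linked′ : Linked DumontStep (s₁ ++ k + l ∷ s₂ ++ y ∷ rest)
  linked′ = subst (Linked DumontStep) (++-assoc s₁ (k + l ∷ s₂) (y ∷ rest)) linked
  max<next : ∀ s₂ → Linked DumontStep (s₁ ++ k + l ∷ s₂ ++ y ∷ rest) → k + l < next s₂
  max<next [] l′ = subst (λ b → Step b (k + l) y) par (Linked-middle s₁ l′)
  max<next (z ∷ _) l′ = subst (λ b → Step b (k + l) z) par (Linked-middle s₁ l′)

two-right-before-one : ∀ α β a → α ↭ raise 1 (range (suc a)) → Linked DumontStep (α ++ 1 ∷ β) → ∃ λ α₁ → α ≡ α₁ ++ [ 2 ]
two-right-before-one α β a p linked with ∈-∃++ (∈-resp-↭ (↭-sym p) (∈-raise-range⁺ 1 (suc a) (≤-refl {1}) (s≤s z≤n)))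
... | α₁ , [] , refl = α₁ , refl
... | α₁ , z ∷ α₂ , refl = ⊥-elim (<-irrefl refl (≤-trans (s≤s 2≤z) z<2))
  where
  z<2 : z < 2
  z<2 = Linked-middle α₁ (subst (Linked DumontStep) (++-assoc α₁ (2 ∷ z ∷ α₂) (1 ∷ β)) linked)
  2≤z : 2 ≤ z
  2≤z = proj₁ (↭raise-range-bounds 1 (suc a) p (∈-++⁺ʳ α₁ (there (here refl))))

AroundOne : ℕ → List ℕ → Set
AroundOne N xs = (∃ λ β → xs ≡ 1 ∷ β × β ↭ raise 1 (range (pred N)))
               ⊎ (∃ λ j → ∃ λ τ → ∃ λ σ → ∃ λ L → xs ≡ glue312 j τ σ × EvenEnded312 j τ × σ ↭ range L ×
                    Linked DumontStep σ × ¬ Contains Is312 σ × 2 * suc j + L ≡ N)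

raise-1-range-suc : ∀ a → raise 1 (range (suc a)) ≡ 2 ∷ raise 2 (range a)
raise-1-range-suc a = trans (cong (raise 1) (range-+ 1 a)) (cong (2 ∷_) (raise-raise 1 1 (range a)))

module AroundOne₂ (N : ℕ) (α₁ β : List ℕ) (a : ℕ)
                  (pα : α₁ ++ [ 2 ] ↭ raise 1 (range (suc a))) (pβ : β ↭ raise (suc (suc a)) (range (length β)))
                  (length≡ : suc (suc a) + length β ≡ N)
                  (linked : Linked DumontStep (α₁ ++ 2 ∷ 1 ∷ β)) (av : ¬ Contains Is312 (α₁ ++ 2 ∷ 1 ∷ β)) where

  α₁↭ : α₁ ↭ raise 2 (range a)
  α₁↭ = subst₂ _↭_ (++-identityʳ α₁) refl (drop-mid α₁ [] (subst (α₁ ++ [ 2 ] ↭_) (raise-1-range-suc a) pα))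

  a-even : parity a ≡ 0ℙ
  a-even = block-even a α₁↭
    where
    block-even : ∀ t → α₁ ↭ raise 2 (range t) → parity t ≡ 0ℙ
    block-even zero _ = refl
    block-even (suc t) p = block-max-even α₁ 2 (1 ∷ β) 2 (suc t) p (s≤s z≤n) linked (s≤s (s≤s (s≤s z≤n)))

  j : ℕ
  j = proj₁ (parity≡0ℙ⇒2* a a-even)
  a≡2j : a ≡ 2 * j
  a≡2j = proj₂ (parity≡0ℙ⇒2* a a-even)

  τ : List ℕ
  τ = proj₁ (↭raise-range⁻ 2 a α₁↭)
  α₁≡ : α₁ ≡ raise 2 τ
  α₁≡ = proj₁ (proj₂ (↭raise-range⁻ 2 a α₁↭))

  2+a≡ : suc (suc a) ≡ 2 * suc j
  2+a≡ = trans (cong (λ a → suc (suc a)) a≡2j) (sym (*-suc 2 j))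

  σ : List ℕ
  σ = proj₁ (↭raise-range⁻ (2 * suc j) (length β) (subst (λ k → β ↭ raise k (range (length β))) 2+a≡ pβ))
  β≡ : β ≡ raise (2 * suc j) σ
  β≡ = proj₁ (proj₂ (↭raise-range⁻ (2 * suc j) (length β) (subst (λ k → β ↭ raise k (range (length β))) 2+a≡ pβ)))
  σ↭ : σ ↭ range (length β)
  σ↭ = proj₂ (proj₂ (↭raise-range⁻ (2 * suc j) (length β) (subst (λ k → β ↭ raise k (range (length β))) 2+a≡ pβ)))

  xs≡ : α₁ ++ 2 ∷ 1 ∷ β ≡ glue312 j τ σ
  xs≡ = cong₂ (λ u v → u ++ 2 ∷ 1 ∷ v) α₁≡ β≡

  parts = Linked-++⁻ α₁ linked

  eτ : EvenEnded312 j τ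
  eτ = subst (λ t → τ ↭ range t) a≡2j (proj₂ (proj₂ (↭raise-range⁻ 2 a α₁↭))) ,
       Linked-raise⁻ 1 (subst (Linked DumontStep) α₁≡ (proj₁ parts)) ,
       LastParity-raise⁻ 0ℙ 1 τ (subst (LastParity 0ℙ) α₁≡
         (connects⇒LastParity 0ℙ α₁ (proj₁ (proj₂ parts)) (λ x∈ → proj₁ (↭raise-range-bounds 2 a α₁↭ x∈)))) ,
       λ occ → av (Contains-⊆ (Sublist.++⁺ʳ (2 ∷ 1 ∷ β) ⊆-refl)
                    (subst (Contains Is312) (sym α₁≡) (Contains-raise⁺ 2 τ (<×<-monoˡ 2) occ)))

  lσ : Linked DumontStep σ
  lσ = Linked-raise⁻ (suc j) (subst (Linked DumontStep) β≡ (Linked.tail (Linked.tail (proj₂ (proj₂ parts)))))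

  avσ : ¬ Contains Is312 σ
  avσ occ = av (Contains-⊆ (Sublist.++⁺ˡ α₁ (2 ∷ʳ 1 ∷ʳ ⊆-refl))
                 (subst (Contains Is312) (sym β≡) (Contains-raise⁺ (2 * suc j) σ (<×<-monoˡ (2 * suc j)) occ)))

  result : AroundOne N (α₁ ++ 2 ∷ 1 ∷ β)
  result = inj₂ (j , τ , σ , length β , xs≡ , eτ , σ↭ , lσ , avσ , trans (cong (_+ length β) (sym 2+a≡)) length≡)

around-one : ∀ N xs → xs ↭ range (suc N) → Linked DumontStep xs → ¬ Contains Is312 xs → AroundOne (suc N) xs
around-one N xs p linked av with ∈-∃++ (↭range-∈ p (≤-refl {1}) (s≤s z≤n))
... | α , β , refl with split-at-one (suc N) α β p av
... | pα , pβ , length≡ = by-prefix α pα pβ length≡ linked av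
  where
  by-prefix : ∀ α → α ↭ raise 1 (range (length α)) → β ↭ raise (suc (length α)) (range (length β)) →
              suc (length α) + length β ≡ suc N → Linked DumontStep (α ++ 1 ∷ β) → ¬ Contains Is312 (α ++ 1 ∷ β) →
              AroundOne (suc N) (α ++ 1 ∷ β)
  by-prefix [] _ pβ length≡ _ _ = inj₁ (β , refl , subst (λ l → β ↭ raise 1 (range l)) (suc-injective length≡) pβ)
  by-prefix α@(_ ∷ α′) pα pβ length≡ linked av with two-right-before-one α β (length α′) pα linked
  ... | α₁ , α≡ = subst (AroundOne (suc N)) (sym xs≡)
    (AroundOne₂.result (suc N) α₁ β (length α′) (subst (_↭ raise 1 (range (length α))) α≡ pα) pβ length≡
                       (subst (Linked DumontStep) xs≡ linked) (subst (λ xs → ¬ Contains Is312 xs) xs≡ av))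
    where
    xs≡ : α ++ 1 ∷ β ≡ α₁ ++ 2 ∷ 1 ∷ β
    xs≡ = trans (cong (_++ 1 ∷ β) α≡) (++-assoc α₁ [ 2 ] (1 ∷ β))

glue312-complete : ∀ m xs → Dumont₁Avoiding Is312 (2 * suc m) xs →
                   ∃ λ j → j < suc m × Glued EvenEnded312 (λ j → Dumont₁Avoiding Is312 (2 * (m ∸ j))) glue312 j xs
glue312-complete m xs (p , d@(linked , lp) , av) with around-one (suc (2 * m)) xs (subst (λ n → xs ↭ range n) (*-suc 2 m) p) linked av
... | inj₁ (β , refl , pβ) with final-segment-min-odd [ 1 ] β 1 (suc (2 * m)) pβ (s≤s z≤n) d
...   | ()
glue312-complete m xs (p , (linked , lp) , av) | inj₂ (j , τ , σ , L , refl , eτ , pσ , lσ , avσ , length≡)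
  with 2*j+l≡2*m (suc m) (suc j) L (trans length≡ (sym (*-suc 2 m)))
... | s≤s j≤m , L≡ = j , s≤s j≤m , τ , σ , eτ ,
  (subst (λ n → σ ↭ range n) L≡ pσ , (lσ , σ-parity) , avσ) , refl
  where
  σ-parity : LastParity 1ℙ σ
  σ-parity = LastParity-raise⁻ 1ℙ (suc j) σ
    (LastParity-suffix 1ℙ (raise 2 τ ++ 2 ∷ 1 ∷ []) (raise (2 * suc j) σ)
      (subst (LastParity 1ℙ) (sym (++-assoc (raise 2 τ) (2 ∷ 1 ∷ []) _)) lp))

-- 2, the smallest entry after 1, is even and so cannot be followed by anything: it comes last.
one-first-even-ended : ∀ k β → β ↭ raise 1 (range (suc (2 * k))) → Linked DumontStep (1 ∷ β) → ¬ Contains Is312 (1 ∷ β) →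
                       ∃ λ τ → β ≡ raise 2 τ ++ [ 2 ] × EvenEnded312 k τ
one-first-even-ended k β p linked av with ∈-∃++ (∈-resp-↭ (↭-sym p) (∈-raise-range⁺ 1 (suc (2 * k)) (≤-refl {1}) (s≤s z≤n)))
... | β₁ , z ∷ β₂ , refl = ⊥-elim (<-irrefl refl (≤-trans (s≤s 2≤z) (Linked-middle (1 ∷ β₁) linked)))
  where
  2≤z : 2 ≤ z
  2≤z = proj₁ (↭raise-range-bounds 1 (suc (2 * k)) p (∈-++⁺ʳ β₁ (there (here refl))))
... | β₁ , [] , refl = τ , cong (_++ [ 2 ]) β₁≡ , (τ↭ , lτ , lpτ , avτ)
  where
  β₁↭ : β₁ ↭ raise 2 (range (2 * k))
  β₁↭ = subst₂ _↭_ (++-identityʳ β₁) refl (drop-mid β₁ [] (subst (β₁ ++ [ 2 ] ↭_) (raise-1-range-suc (2 * k)) p))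
  τ : List ℕ
  τ = proj₁ (↭raise-range⁻ 2 (2 * k) β₁↭)
  β₁≡ : β₁ ≡ raise 2 τ
  β₁≡ = proj₁ (proj₂ (↭raise-range⁻ 2 (2 * k) β₁↭))
  τ↭ : τ ↭ range (2 * k)
  τ↭ = proj₂ (proj₂ (↭raise-range⁻ 2 (2 * k) β₁↭))
  parts = Linked-++⁻ β₁ (Linked.tail linked)
  lτ : Linked DumontStep τ
  lτ = Linked-raise⁻ 1 (subst (Linked DumontStep) β₁≡ (proj₁ parts))
  lpτ : LastParity 0ℙ τ
  lpτ = LastParity-raise⁻ 0ℙ 1 τ (subst (LastParity 0ℙ) β₁≡
          (connects⇒LastParity 0ℙ β₁ (proj₁ (proj₂ parts)) (λ x∈ → proj₁ (↭raise-range-bounds 2 (2 * k) β₁↭ x∈))))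
  avτ : ¬ Contains Is312 τ
  avτ occ = av (Contains-⊆ (1 ∷ʳ Sublist.++⁺ʳ [ 2 ] ⊆-refl)
                 (subst (Contains Is312) (sym β₁≡) (Contains-raise⁺ 2 τ (<×<-monoˡ 2) occ)))

glue312′-complete : ∀ k xs → EvenEnded312 (suc k) xs →
                    ∃ λ j → j < suc k × Glued EvenEnded312 (λ j → EvenEnded312 (k ∸ j)) glue312′ j xs
glue312′-complete k xs (p , linked , lp , av) with around-one (suc (2 * k)) xs (subst (λ n → xs ↭ range n) (*-suc 2 k) p) linked av
... | inj₁ (β , refl , pβ) with one-first-even-ended k β pβ linked av
...   | τ , refl , eτ = k , ≤-refl , τ , [] , eτ , subst (λ i → EvenEnded312 i []) (sym (n∸n≡0 k)) empty , refl
  where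
  empty : EvenEnded312 0 []
  empty = ↭-refl , [] , nothing , λ { (_ , _ , _ , () , _) }
glue312′-complete k xs (p , linked , lp , av) | inj₂ (j , τ , [] , L , refl , _ , _ , _ , _ , _)
  with subst (AllMaybe (HasParity 0ℙ)) (last-++ (raise 2 τ) 2 [ 1 ]) lp
... | just ()
glue312′-complete k xs (p , linked , lp , av) | inj₂ (j , τ , σ@(_ ∷ _) , L , refl , eτ , pσ , lσ , avσ , length≡)
  with 2*j+l≡2*m (suc k) (suc j) L (trans length≡ (sym (*-suc 2 k)))
... | s≤s j≤k , L≡ = j , s≤s j≤k , τ , σ , eτ , (subst (λ n → σ ↭ range n) L≡ pσ , lσ , σ-parity , avσ) , refl
  where
  σ-parity : LastParity 0ℙ σ
  σ-parity = LastParity-raise⁻ 0ℙ (suc j) σ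
    (LastParity-suffix 0ℙ (raise 2 τ ++ 2 ∷ 1 ∷ []) (raise (2 * suc j) σ)
      (subst (LastParity 0ℙ) (sym (++-assoc (raise 2 τ) (2 ∷ 1 ∷ []) _)) lp))

1∉raise-2-then-2 : ∀ τ → 1 ∉ raise 2 τ ++ [ 2 ]
1∉raise-2-then-2 τ 1∈ with ∈-++⁻ (raise 2 τ) 1∈
... | inj₁ 1∈τ with ∈-map⁻ (2 +_) 1∈τ
...   | _ , _ , ()
1∉raise-2-then-2 τ 1∈ | inj₂ (here ())
1∉raise-2-then-2 τ 1∈ | inj₂ (there ())

glue312-injective : ∀ {i j τ σ τ′ σ′} → τ ↭ range (2 * i) → τ′ ↭ range (2 * j) →
                    glue312 i τ σ ≡ glue312 j τ′ σ′ → i ≡ j × τ ≡ τ′ × σ ≡ σ′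
glue312-injective {i} {j} {τ} {σ} {τ′} {σ′} pτ pτ′ eq
  with split-at-first (raise 2 τ ++ [ 2 ]) (raise 2 τ′ ++ [ 2 ]) (1∉raise-2-then-2 τ) (1∉raise-2-then-2 τ′)
         (trans (++-assoc (raise 2 τ) [ 2 ] _) (trans eq (sym (++-assoc (raise 2 τ′) [ 2 ] _))))
... | prefix≡ , suffix≡ with raise-injective 2 (snoc-injective _ _ prefix≡)
... | refl = i≡j , refl , raise-injective (2 * suc j) (subst (λ i → raise (2 * suc i) σ ≡ raise (2 * suc j) σ′) i≡j suffix≡)
  where
  i≡j : i ≡ j
  i≡j = 2*-injective (trans (sym (↭range-length {2 * i} pτ)) (↭range-length {2 * j} pτ′))

glue312≢1∷ : ∀ j τ σ {r} → glue312 j τ σ ≢ 1 ∷ r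
glue312≢1∷ j [] σ ()
glue312≢1∷ j (_ ∷ _) σ ()

glue312′-injective : ∀ {i j τ σ τ′ σ′} → τ ↭ range (2 * i) → τ′ ↭ range (2 * j) →
                     glue312′ i τ σ ≡ glue312′ j τ′ σ′ → i ≡ j × τ ≡ τ′ × σ ≡ σ′
glue312′-injective {i} {j} {τ} {[]} {τ′} {[]} pτ pτ′ eq with raise-injective 2 (snoc-injective _ _ (proj₂ (∷-injective eq)))
... | refl = 2*-injective (trans (sym (↭range-length {2 * i} pτ)) (↭range-length {2 * j} pτ′)) , refl , refl
glue312′-injective {σ = []} {τ′ = τ′} {σ′ = σ′@(_ ∷ _)} _ _ eq = ⊥-elim (glue312≢1∷ _ τ′ σ′ (sym eq))
glue312′-injective {τ = τ} {σ = σ@(_ ∷ _)} {σ′ = []} _ _ eq = ⊥-elim (glue312≢1∷ _ τ σ eq)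
glue312′-injective {σ = _ ∷ _} {σ′ = _ ∷ _} pτ pτ′ eq = glue312-injective pτ pτ′ eq

enum-312-even : ∀ m → Enumeration (Dumont₁Avoiding Is312 (2 * m)) (ballot m 0) × Enumeration (EvenEnded312 m) (ballot m 0)
enum-312-even = ballot-induction (λ m → Enumeration (Dumont₁Avoiding Is312 (2 * m)) (ballot m 0) × Enumeration (EvenEnded312 m) (ballot m 0))
  (enum-Dumont-empty ([] , nothing) , enum-singleton [] (↭-refl , [] , nothing , λ { (_ , _ , _ , () , _) }) (λ (p , _) → ↭-empty-inv p))
  (λ m ih → step₁ m ih , step₂ m ih)
  where
  step₁ : ∀ m → (∀ j → j ≤ m → Enumeration (Dumont₁Avoiding Is312 (2 * j)) (ballot j 0) × Enumeration (EvenEnded312 j) (ballot j 0)) →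
          Enumeration (Dumont₁Avoiding Is312 (2 * suc m)) (ballot (suc m) 0)
  step₁ m ih = enum-by-gluing (Dumont₁Avoiding Is312 (2 * suc m)) EvenEnded312 (λ j → Dumont₁Avoiding Is312 (2 * j)) glue312 m
    (λ j j≤m → proj₂ (ih j j≤m)) (λ j j≤m → proj₁ (ih j j≤m))
    (λ _ _ (pτ , _) _ (pτ′ , _) _ → glue312-injective pτ pτ′)
    (λ j τ σ j≤m eτ dσ → glue312-sound m j τ σ j≤m eτ dσ) (glue312-complete m)
  step₂ : ∀ m → (∀ j → j ≤ m → Enumeration (Dumont₁Avoiding Is312 (2 * j)) (ballot j 0) × Enumeration (EvenEnded312 j) (ballot j 0)) →
          Enumeration (EvenEnded312 (suc m)) (ballot (suc m) 0)
  step₂ m ih = enum-by-gluing (EvenEnded312 (suc m)) EvenEnded312 EvenEnded312 glue312′ m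
    (λ j j≤m → proj₂ (ih j j≤m)) (λ j j≤m → proj₂ (ih j j≤m))
    (λ _ _ (pτ , _) _ (pτ′ , _) _ → glue312′-injective pτ pτ′)
    (λ j τ σ j≤m eτ eσ → glue312′-sound m j τ σ j≤m eτ eσ) (glue312′-complete m)

interleave : List ℕ → List ℕ → List ℕ
interleave []       cs = cs
interleave (a ∷ as) cs = a ∷ interleave cs as

odds evens : List ℕ → List ℕ
odds []       = []
odds (x ∷ xs) = x ∷ evens xs
evens []       = []
evens (x ∷ xs) = odds xs

interleave-odds-evens : ∀ xs → interleave (odds xs) (evens xs) ≡ xs
interleave-odds-evens [] = refl
interleave-odds-evens (x ∷ []) = refl
interleave-odds-evens (x ∷ y ∷ xs) = cong (λ zs → x ∷ y ∷ zs) (interleave-odds-evens xs)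

odds-evens-interleave : ∀ as cs → length as ≡ length cs → odds (interleave as cs) ≡ as × evens (interleave as cs) ≡ cs
odds-evens-interleave [] [] _ = refl , refl
odds-evens-interleave (a ∷ as) (c ∷ cs) eq with odds-evens-interleave as cs (suc-injective eq)
... | odds≡ , evens≡ = cong (a ∷_) odds≡ , cong (c ∷_) evens≡

length-odds-evens : ∀ m xs → length xs ≡ 2 * m → length (odds xs) ≡ m × length (evens xs) ≡ m
length-odds-evens zero [] _ = refl , refl
length-odds-evens (suc m) [] ()
length-odds-evens (suc m) (x ∷ []) eq = ⊥-elim (0≢1+n (suc-injective (trans eq (*-suc 2 m))))
length-odds-evens (suc m) (x ∷ y ∷ xs) eq with length-odds-evens m xs (suc-injective (suc-injective (trans eq (*-suc 2 m))))
... | |odds| , |evens| = cong suc |odds| , cong suc |evens|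

interleave-Interleaving : ∀ as cs → Interleaving as cs (interleave as cs)
interleave-Interleaving [] [] = []
interleave-Interleaving [] (c ∷ cs) = consʳ (interleave-Interleaving [] cs)
interleave-Interleaving (a ∷ as) cs = consˡ (swap (interleave-Interleaving cs as))

-- Odd positions 2k + 1, 2k + 3, … carry entries at least their position; even positions 2k + 2, … entries below it.
OddBounds EvenBounds : ℕ → List ℕ → Set
OddBounds k []       = ⊤
OddBounds k (a ∷ as) = suc (2 * k) ≤ a × OddBounds (suc k) as
EvenBounds k []       = ⊤
EvenBounds k (c ∷ cs) = c < suc (suc (2 * k)) × EvenBounds (suc k) cs

Dumont₂-interleave⁻ : ∀ k as cs → length as ≡ length cs → Dumont₂From (2 * k) (interleave as cs) → OddBounds k as × EvenBounds k cs
Dumont₂-interleave⁻ k [] [] _ _ = tt , tt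
Dumont₂-interleave⁻ k (a ∷ as) (c ∷ cs) eq (da , dc , d)
  with Dumont₂-interleave⁻ (suc k) as cs (suc-injective eq) (subst (λ p → Dumont₂From p (interleave as cs)) (sym (*-suc 2 k)) d)
... | odd , even = (subst (λ b → Step₂ b (suc (2 * k)) a) (parity-1+2* k) da , odd) ,
                   (subst (λ b → Step₂ b (suc (suc (2 * k))) c) (parity-2* k) dc , even)

Dumont₂-interleave⁺ : ∀ k as cs → length as ≡ length cs → OddBounds k as × EvenBounds k cs → Dumont₂From (2 * k) (interleave as cs)
Dumont₂-interleave⁺ k [] [] _ _ = tt
Dumont₂-interleave⁺ k (a ∷ as) (c ∷ cs) eq ((da , odd) , (dc , even)) =
  subst (λ b → Step₂ b (suc (2 * k)) a) (sym (parity-1+2* k)) da ,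
  subst (λ b → Step₂ b (suc (suc (2 * k))) c) (sym (parity-2* k)) dc ,
  subst (λ p → Dumont₂From p (interleave as cs)) (*-suc 2 k) (Dumont₂-interleave⁺ (suc k) as cs (suc-injective eq) (odd , even))

Increasing : List ℕ → Set
Increasing = Linked _<_

Increasing-head : ∀ {x xs} → Increasing (x ∷ xs) → ∀ {q} → q ∈ xs → x < q
Increasing-head {x} {y ∷ xs} (x<y ∷ l) q∈ = All.lookup (Linkedₚ.Linked⇒All <-trans x<y l) q∈

Increasing-pair : ∀ {p q xs} → Increasing xs → p ∷ q ∷ [] ⊆ xs → p < q
Increasing-pair l (_ ∷ʳ s) = Increasing-pair (Linked.tail l) s
Increasing-pair l (refl ∷ s) = Increasing-head l (⊆-lookup s (here refl))

⊆-Interleaving : ∀ {zs xs as cs : List ℕ} → zs ⊆ xs → Interleaving as cs xs →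
                 ∃ λ as′ → ∃ λ cs′ → Interleaving as′ cs′ zs × as′ ⊆ as × cs′ ⊆ cs
⊆-Interleaving [] [] = [] , [] , [] , [] , []
⊆-Interleaving (_ ∷ʳ s) (consˡ i) with ⊆-Interleaving s i
... | as′ , cs′ , i′ , s₁ , s₂ = as′ , cs′ , i′ , _ ∷ʳ s₁ , s₂
⊆-Interleaving (_ ∷ʳ s) (consʳ i) with ⊆-Interleaving s i
... | as′ , cs′ , i′ , s₁ , s₂ = as′ , cs′ , i′ , s₁ , _ ∷ʳ s₂
⊆-Interleaving (refl ∷ s) (consˡ i) with ⊆-Interleaving s i
... | as′ , cs′ , i′ , s₁ , s₂ = _ ∷ as′ , cs′ , consˡ i′ , refl ∷ s₁ , s₂
⊆-Interleaving (refl ∷ s) (consʳ i) with ⊆-Interleaving s i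
... | as′ , cs′ , i′ , s₁ , s₂ = as′ , _ ∷ cs′ , consʳ i′ , s₁ , refl ∷ s₂

-- Two of the three entries of a 321 come from the same increasing list.
interleave-avoids-321 : ∀ as cs → Increasing as → Increasing cs → ¬ Contains Is321 (interleave as cs)
interleave-avoids-321 as cs ias ics (a , b , c , s , b<a , c<b) with ⊆-Interleaving s (interleave-Interleaving as cs)
... | _ , _ , i , s₁ , s₂ = from-one-list i s₁ s₂
  where
  c<a : c < a
  c<a = <-trans c<b b<a
  from-one-list : ∀ {as′ cs′} → Interleaving as′ cs′ (a ∷ b ∷ c ∷ []) → as′ ⊆ as → cs′ ⊆ cs → ⊥
  from-one-list (consˡ (consˡ _)) s₁ _ = <-asym b<a (Increasing-pair ias (⊆-trans (refl ∷ refl ∷ minimum _) s₁))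
  from-one-list (consˡ (consʳ (consˡ _))) s₁ _ = <-asym c<a (Increasing-pair ias (⊆-trans (refl ∷ refl ∷ minimum _) s₁))
  from-one-list (consˡ (consʳ (consʳ _))) _ s₂ = <-asym c<b (Increasing-pair ics (⊆-trans (refl ∷ refl ∷ minimum _) s₂))
  from-one-list (consʳ (consˡ (consˡ _))) s₁ _ = <-asym c<b (Increasing-pair ias (⊆-trans (refl ∷ refl ∷ minimum _) s₁))
  from-one-list (consʳ (consˡ (consʳ _))) _ s₂ = <-asym c<a (Increasing-pair ics (⊆-trans (refl ∷ refl ∷ minimum _) s₂))
  from-one-list (consʳ (consʳ _)) _ s₂ = <-asym b<a (Increasing-pair ics (⊆-trans (refl ∷ refl ∷ minimum _) s₂))

∃-missing : ∀ (L M : List ℕ) → Unique L → length M < length L → ∃ λ v → v ∈ L × v ∉ M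
∃-missing L M u |M|<|L| = not-all-in L (λ L⊆M → <⇒≱ |M|<|L| (Unique-length-≤ u L⊆M))
  where
  not-all-in : ∀ L → ¬ (∀ {v} → v ∈ L → v ∈ M) → ∃ λ v → v ∈ L × v ∉ M
  not-all-in [] ¬⊆ = ⊥-elim (¬⊆ (λ ()))
  not-all-in (l ∷ L) ¬⊆ with l ∈? M
  ... | no l∉M = l , here refl , l∉M
  ... | yes l∈M with not-all-in L (λ L⊆M → ¬⊆ (λ { (here refl) → l∈M ; (there v∈) → L⊆M v∈ }))
  ...   | v , v∈ , v∉ = v , there v∈ , v∉

-- Entries two positions apart increase: if z < x with z two places after x, a pigeonhole count
-- finds an entry completing a 321, one way or the other according to the parity of x's position.
module TwoApart (n : ℕ) (pre : List ℕ) (x y z : ℕ) (post : List ℕ)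
                (p : pre ++ x ∷ y ∷ z ∷ post ↭ range n) (d : Dumont₂ (pre ++ x ∷ y ∷ z ∷ post))
                (av : ¬ Contains Is321 (pre ++ x ∷ y ∷ z ∷ post)) (z<x : z < x) where

  P : ℕ
  P = length pre
  in-xs : ∀ {v} → 1 ≤ v → v ≤ n → v ∈ pre ++ x ∷ y ∷ z ∷ post
  in-xs = ↭range-∈ p
  x≤max : x ≤ n
  x≤max = proj₂ (↭range-bounds p (∈-++⁺ʳ pre (here refl)))
  z≤max : z ≤ n
  z≤max = proj₂ (↭range-bounds p (∈-++⁺ʳ pre (there (there (here refl)))))
  n≡ : n ≡ P + suc (suc (suc (length post)))
  n≡ = trans (sym (↭range-length p)) (length-++ pre)

  even-position : parity P ≡ 0ℙ → ⊥
  even-position even with ∃-missing (range z) (pre ++ y ∷ z ∷ []) (range-unique z) |M|<z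
    where
    3+P≤z : suc (suc (suc P)) ≤ z
    3+P≤z = subst (λ b → Step₂ b (suc (suc (suc P))) z) (trans (parity-suc P) (cong _⁻¹ even))
              (subst (λ l → Dumont₂Entry (suc l) z) (trans (length-++ pre) (+-comm P 2))
                (Dumont₂From-at 0 (pre ++ x ∷ y ∷ []) z post (subst Dumont₂ (sym (++-assoc pre (x ∷ y ∷ []) (z ∷ post))) d)))
    |M|<z : length (pre ++ y ∷ z ∷ []) < length (range z)
    |M|<z = subst₂ _<_ (sym (trans (length-++ pre) (+-comm P 2))) (sym (length-range z)) 3+P≤z
  ... | v , v∈ , v∉ with ∈-range⁻ z v∈
  ... | 1≤v , v≤z with ∈-++⁻ pre (in-xs 1≤v (≤-trans v≤z z≤max))
  ...   | inj₁ v∈pre = v∉ (∈-++⁺ˡ v∈pre)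
  ...   | inj₂ (here refl) = <-irrefl refl (<-≤-trans z<x v≤z)
  ...   | inj₂ (there (here refl)) = v∉ (∈-++⁺ʳ pre (here refl))
  ...   | inj₂ (there (there (here refl))) = v∉ (∈-++⁺ʳ pre (there (here refl)))
  ...   | inj₂ (there (there (there v∈post))) =
    av (x , z , v , Sublist.++⁺ˡ pre (refl ∷ y ∷ʳ refl ∷ from∈ v∈post) , z<x , ≤∧≢⇒< v≤z v≢z)
    where
    v≢z : v ≢ z
    v≢z refl = v∉ (∈-++⁺ʳ pre (there (here refl)))

  odd-position : parity P ≡ 1ℙ → ⊥
  odd-position odd with ∃-missing (raise x (range (n ∸ x))) (y ∷ post) (raise-range-unique x (n ∸ x)) |M|<n-x
    where
    x≤P : x ≤ P
    x≤P = ≤-pred (subst (λ b → Step₂ b (suc P) x) (trans (parity-suc P) (cong _⁻¹ odd)) (Dumont₂From-at 0 pre x (y ∷ z ∷ post) d))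
    |M|<n-x : length (y ∷ post) < length (raise x (range (n ∸ x)))
    |M|<n-x = subst (suc (length (y ∷ post)) ≤_) (sym (trans (length-map (x +_) (range (n ∸ x))) (length-range (n ∸ x))))
      (≤-trans (n≤1+n _) (≤-trans (≤-reflexive (sym (trans (cong (_∸ P) n≡) (m+n∸m≡n P _)))) (∸-monoʳ-≤ n x≤P)))
  ... | w , w∈ , w∉ with ∈-raise-range⁻ x (n ∸ x) w∈
  ... | x<w , w≤ with ∈-++⁻ pre (in-xs (≤-trans (s≤s z≤n) x<w) (≤-trans w≤ (≤-reflexive (m+[n∸m]≡n x≤max))))
  ...   | inj₁ w∈pre = av (w , x , z , Sublist.++⁺ (from∈ w∈pre) (refl ∷ y ∷ʳ refl ∷ minimum post) , x<w , z<x)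
  ...   | inj₂ (here refl) = <-irrefl refl x<w
  ...   | inj₂ (there (here refl)) = w∉ (here refl)
  ...   | inj₂ (there (there (here refl))) = <-asym z<x x<w
  ...   | inj₂ (there (there (there w∈post))) = w∉ (there w∈post)

TwoApartIncreasing : List ℕ → Set
TwoApartIncreasing xs = ∀ pre x y z post → xs ≡ pre ++ x ∷ y ∷ z ∷ post → x < z

TwoApartIncreasing-∷ : ∀ {w xs} → TwoApartIncreasing (w ∷ xs) → TwoApartIncreasing xs
TwoApartIncreasing-∷ {w} t pre x y z post eq = t (w ∷ pre) x y z post (cong (w ∷_) eq)

odds-increasing : ∀ xs → TwoApartIncreasing xs → Increasing (odds xs)
odds-increasing [] _ = []
odds-increasing (a ∷ []) _ = [-]
odds-increasing (a ∷ b ∷ []) _ = [-]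
odds-increasing (a ∷ b ∷ c ∷ post) t = t [] a b c post refl ∷ odds-increasing (c ∷ post) (TwoApartIncreasing-∷ (TwoApartIncreasing-∷ t))

evens-increasing : ∀ xs → TwoApartIncreasing xs → Increasing (evens xs)
evens-increasing [] _ = []
evens-increasing (x ∷ xs) t = odds-increasing xs (TwoApartIncreasing-∷ t)

Dumont₂-321-two-apart : ∀ n xs → Dumont₂Avoiding Is321 n xs → TwoApartIncreasing xs
Dumont₂-321-two-apart n xs (p , d , av) pre x y z post refl = ≤∧≢⇒< (≮⇒≥ z≮x) x≢z
  where
  x≢z : x ≢ z
  x≢z with Unique-++⁻ʳ {pre} (↭range-unique {n} p)
  ... | (_ ∷ x≢z ∷ _) ∷ _ = x≢z
  z≮x : ¬ z < x
  z≮x z<x with parity (length pre) in par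
  ... | 0ℙ = TwoApart.even-position n pre x y z post p d av z<x par
  ... | 1ℙ = TwoApart.odd-position n pre x y z post p d av z<x par

last-connected : ∀ {R : ℕ → ℕ → Set} xs {y} → (∀ {x} → x ∈ xs → R x y) → Connected R (last xs) (just y)
last-connected xs below with last xs in eq
... | nothing = nothing-just
... | just x = just (below (last-∈ xs eq))

Increasing-snoc⁺ : ∀ xs {N} → Increasing xs → (∀ {y} → y ∈ xs → y < N) → Increasing (xs ++ [ N ])
Increasing-snoc⁺ xs l below = Linkedₚ.++⁺ l (last-connected xs below) [-]

Increasing-snoc⁻ : ∀ xs {N} → Increasing (xs ++ [ N ]) → Increasing xs
Increasing-snoc⁻ xs l = proj₁ (Linked-++⁻ xs l)

Increasing-max-last : ∀ xs N → Increasing xs → N ∈ xs → (∀ {y} → y ∈ xs → y ≤ N) → ∃ λ xs′ → xs ≡ xs′ ++ [ N ]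
Increasing-max-last xs N l N∈ ≤N with initLast xs
... | [] with N∈
...   | ()
Increasing-max-last .(xs′ ++ [ x ]) N l N∈ ≤N | xs′ ∷ʳ′ x with ∈-++⁻ xs′ N∈
... | inj₂ (here refl) = xs′ , refl
... | inj₁ N∈xs′ = ⊥-elim (<⇒≱ (Increasing-pair l (Sublist.++⁺ (from∈ N∈xs′) (refl ∷ [])))  (≤N (∈-++⁺ʳ xs′ (here refl))))

OddBounds-snoc⁺ : ∀ k xs x → OddBounds k xs → suc (2 * (k + length xs)) ≤ x → OddBounds k (xs ++ [ x ])
OddBounds-snoc⁺ k [] x _ le = subst (λ z → suc (2 * z) ≤ x) (+-identityʳ k) le , tt
OddBounds-snoc⁺ k (y ∷ xs) x (a , o) le = a , OddBounds-snoc⁺ (suc k) xs x o (subst (λ z → suc (2 * z) ≤ x) (+-suc k (length xs)) le)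

OddBounds-snoc⁻ : ∀ k xs x → OddBounds k (xs ++ [ x ]) → OddBounds k xs
OddBounds-snoc⁻ k [] x _ = tt
OddBounds-snoc⁻ k (y ∷ xs) x (a , o) = a , OddBounds-snoc⁻ (suc k) xs x o

EvenBounds-snoc⁺ : ∀ k xs x → EvenBounds k xs → x < suc (suc (2 * (k + length xs))) → EvenBounds k (xs ++ [ x ])
EvenBounds-snoc⁺ k [] x _ lt = subst (λ z → x < suc (suc (2 * z))) (+-identityʳ k) lt , tt
EvenBounds-snoc⁺ k (y ∷ xs) x (c , e) lt = c , EvenBounds-snoc⁺ (suc k) xs x e (subst (λ z → x < suc (suc (2 * z))) (+-suc k (length xs)) lt)

EvenBounds-snoc⁻ : ∀ k xs x → EvenBounds k (xs ++ [ x ]) → EvenBounds k xs × x < suc (suc (2 * (k + length xs)))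
EvenBounds-snoc⁻ k [] x (lt , _) = tt , subst (λ z → x < suc (suc (2 * z))) (sym (+-identityʳ k)) lt
EvenBounds-snoc⁻ k (y ∷ xs) x (c , e) with EvenBounds-snoc⁻ (suc k) xs x e
... | e′ , lt = (c , e′) , subst (λ z → x < suc (suc (2 * z))) (sym (+-suc k (length xs))) lt

length-snoc : ∀ (xs : List ℕ) x → length (xs ++ [ x ]) ≡ suc (length xs)
length-snoc xs x = trans (length-++ xs) (+-comm (length xs) 1)

-- The odd-position and even-position subsequences of a 321-avoiding Dumont permutation of the
-- second kind: u entries above their positions and u + h entries below them, together a
-- permutation of 2u + h.  Such pairs are counted by ballot u h, by removing the largest entry.
BallotPair : ℕ → ℕ → List ℕ × List ℕ → Set
BallotPair u h (as , cs) = Increasing as × Increasing cs × as ++ cs ↭ range (2 * u + h) ×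
                           length as ≡ u × length cs ≡ u + h × OddBounds 0 as × EvenBounds 0 cs

range-increasing : ∀ h → Increasing (range h)
range-increasing zero = []
range-increasing (suc h) = Increasing-snoc⁺ (range h) (range-increasing h) (λ x∈ → s≤s (proj₂ (∈-range⁻ h x∈)))

range-EvenBounds : ∀ h → EvenBounds 0 (range h)
range-EvenBounds zero = tt
range-EvenBounds (suc h) = EvenBounds-snoc⁺ 0 (range h) (suc h) (range-EvenBounds h)
  (s≤s (s≤s (subst (λ l → h ≤ 2 * l) (sym (length-range h)) (m≤m+n h (h + 0)))))

increasing-↭range : ∀ h cs → Increasing cs → cs ↭ range h → cs ≡ range h
increasing-↭range zero cs _ p = ↭-empty-inv p
increasing-↭range (suc h) cs l p with Increasing-max-last cs (suc h) l (↭range-∈ p (s≤s z≤n) ≤-refl) (λ x∈ → proj₂ (↭range-bounds p x∈))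
... | cs′ , refl = cong (_++ [ suc h ]) (increasing-↭range h cs′ (Increasing-snoc⁻ cs′ l) (↭range-snoc-max⁻ h cs′ p))

BallotPair-maxˡ : ∀ u h as cs → BallotPair u (suc h) (as , cs) → BallotPair (suc u) h (as ++ [ 2 * suc u + h ] , cs)
BallotPair-maxˡ u h as cs (ias , ics , p , |as| , |cs| , oas , ecs) =
  Increasing-snoc⁺ as ias (λ x∈ → ≤-trans (s≤s (proj₂ (↭range-bounds p (∈-++⁺ˡ x∈)))) (≤-reflexive (sym N≡))) , ics ,
  subst (λ N → (as ++ [ N ]) ++ cs ↭ range N) (sym N≡)
    (subst (_↭ range (suc (2 * u + suc h))) (sym (++-assoc as [ _ ] cs)) (↭range-insert-max (2 * u + suc h) p)) ,
  trans (length-snoc as _) (cong suc |as|) , trans |cs| (+-suc u h) ,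
  OddBounds-snoc⁺ 0 as _ oas (subst (λ l → suc (2 * l) ≤ 2 * suc u + h) (sym |as|) (odd-ok u h)) , ecs
  where
  N≡ : 2 * suc u + h ≡ suc (2 * u + suc h)
  N≡ = shape u h
    where
    shape : ∀ u h → 2 * suc u + h ≡ suc (2 * u + suc h)
    shape = solve-∀
  odd-ok : ∀ u h → suc (2 * u) ≤ 2 * suc u + h
  odd-ok u h = ≤-trans (n≤1+n _) (≤-trans (≤-reflexive (sym (*-suc 2 u))) (m≤m+n (2 * suc u) h))

BallotPair-maxʳ : ∀ u h as cs → BallotPair (suc u) h (as , cs) → BallotPair (suc u) (suc h) (as , cs ++ [ 2 * suc u + suc h ])
BallotPair-maxʳ u h as cs (ias , ics , p , |as| , |cs| , oas , ecs) =
  ias , Increasing-snoc⁺ cs ics (λ x∈ → ≤-trans (s≤s (proj₂ (↭range-bounds p (∈-++⁺ʳ as x∈)))) (≤-reflexive (sym N≡))) ,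
  subst (λ N → as ++ (cs ++ [ N ]) ↭ range N) (sym N≡)
    (subst (_↭ range (suc (2 * suc u + h))) (++-assoc as cs [ _ ]) (++⁺ʳ [ suc (2 * suc u + h) ] p)) ,
  |as| , trans (length-snoc cs _) (trans (cong suc |cs|) (sym (+-suc (suc u) h))) , oas ,
  EvenBounds-snoc⁺ 0 cs _ ecs (subst (λ l → 2 * suc u + suc h < suc (suc (2 * l))) (sym |cs|) (s≤s (subst (_≤ suc (2 * (suc u + h))) (sym N≡) (s≤s (even-ok u h)))))
  where
  N≡ : 2 * suc u + suc h ≡ suc (2 * suc u + h)
  N≡ = +-suc (2 * suc u) h
  even-ok : ∀ u h → 2 * suc u + h ≤ 2 * (suc u + h)
  even-ok u h = ≤-trans (+-monoʳ-≤ (2 * suc u) (m≤m+n h (h + 0))) (≤-reflexive (sym (*-distribˡ-+ 2 (suc u) h)))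

-- The largest entry 2(u + 1) + h ends one of the two increasing lists; it can only end the
-- second one if h > 0, since there it sits at an even position 2(u + 1).
BallotPair-max : ∀ u h as cs → BallotPair (suc u) h (as , cs) →
                 (∃ λ as′ → as ≡ as′ ++ [ 2 * suc u + h ] × BallotPair u (suc h) (as′ , cs))
               ⊎ (∃ λ h′ → h ≡ suc h′ × ∃ λ cs′ → cs ≡ cs′ ++ [ 2 * suc u + h ] × BallotPair (suc u) h′ (as , cs′))
BallotPair-max u h as cs (ias , ics , p , |as| , |cs| , oas , ecs) with ∈-++⁻ as (↭range-∈ p (s≤s z≤n) ≤-refl)
... | inj₁ N∈as with Increasing-max-last as _ ias N∈as (λ x∈ → proj₂ (↭range-bounds p (∈-++⁺ˡ x∈)))
...   | as′ , refl = inj₁ (as′ , refl , Increasing-snoc⁻ as′ ias , ics ,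
          ↭range-drop-max (2 * u + suc h) as′ cs (subst (λ N → as′ ++ N ∷ cs ↭ range N) N≡ (subst (_↭ _) (++-assoc as′ [ _ ] cs) p)) ,
          suc-injective (trans (sym (length-snoc as′ _)) |as|) , trans |cs| (sym (+-suc u h)) , OddBounds-snoc⁻ 0 as′ _ oas , ecs)
  where
  N≡ : 2 * suc u + h ≡ suc (2 * u + suc h)
  N≡ = shape u h
    where
    shape : ∀ u h → 2 * suc u + h ≡ suc (2 * u + suc h)
    shape = solve-∀
BallotPair-max u h as cs (ias , ics , p , |as| , |cs| , oas , ecs) | inj₂ N∈cs
  with Increasing-max-last cs _ ics N∈cs (λ x∈ → proj₂ (↭range-bounds p (∈-++⁺ʳ as x∈)))
... | cs′ , refl with h | EvenBounds-snoc⁻ 0 cs′ _ ecs | suc-injective (trans (sym (length-snoc cs′ _)) |cs|)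
...   | zero | _ , N<2|cs′|+2 | |cs′| = ⊥-elim (<-irrefl N≡ (subst (λ l → _ < suc (suc (2 * l))) |cs′| N<2|cs′|+2))
  where
  N≡ : 2 * suc u + 0 ≡ suc (suc (2 * (u + 0)))
  N≡ = shape u
    where
    shape : ∀ u → 2 * suc u + 0 ≡ suc (suc (2 * (u + 0)))
    shape = solve-∀
...   | suc h′ | ecs′ , _ | |cs′| = inj₂ (h′ , refl , cs′ , refl , ias , Increasing-snoc⁻ cs′ ics ,
          ↭range-snoc-max⁻ (2 * suc u + h′) (as ++ cs′) (subst (λ N → (as ++ cs′) ++ [ N ] ↭ range N) (+-suc (2 * suc u) h′) (subst (_↭ _) (sym (++-assoc as cs′ [ _ ])) p)) ,
          |as| , trans |cs′| (+-suc u h′) , oas , ecs′)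

enum-BallotPair : ∀ u h → Enumeration (BallotPair u h) (ballot u h)
enum-BallotPair zero h =
  enum-singleton ([] , range h) ([] , range-increasing h , ↭-refl , refl , length-range h , tt , range-EvenBounds h) only
  where
  only : ∀ {p} → BallotPair 0 h p → p ≡ ([] , range h)
  only {[] , cs} (_ , ics , p , _) = cong ([] ,_) (increasing-↭range h cs ics p)
enum-BallotPair (suc u) zero = enum-⇔ to from (enum-image extend (λ _ _ → extend-injective) (enum-BallotPair u 1))
  where
  N : ℕ
  N = 2 * suc u + 0
  extend : List ℕ × List ℕ → List ℕ × List ℕ
  extend (as , cs) = as ++ [ N ] , cs
  extend-injective : ∀ {x y} → extend x ≡ extend y → x ≡ y
  extend-injective {as , cs} {as′ , cs′} eq with ,-injectiveʳ eq
  ... | refl = cong (_, cs) (snoc-injective as as′ (,-injectiveˡ eq))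
  to : ∀ {p} → (∃ λ q → BallotPair u 1 q × p ≡ extend q) → BallotPair (suc u) 0 p
  to ((as , cs) , bp , refl) = BallotPair-maxˡ u 0 as cs bp
  from : ∀ {p} → BallotPair (suc u) 0 p → ∃ λ q → BallotPair u 1 q × p ≡ extend q
  from {as , cs} bp with BallotPair-max u 0 as cs bp
  ... | inj₁ (as′ , refl , bp′) = (as′ , cs) , bp′ , refl
  ... | inj₂ (_ , () , _)
enum-BallotPair (suc u) (suc h) =
  enum-⇔ to from (enum-⊎ (enum-image extendˡ (λ _ _ → extendˡ-injective) (enum-BallotPair u (2 + h)))
                         (enum-image extendʳ (λ _ _ → extendʳ-injective) (enum-BallotPair (suc u) h)) disjoint)
  where
  N : ℕ
  N = 2 * suc u + suc h
  extendˡ extendʳ : List ℕ × List ℕ → List ℕ × List ℕ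
  extendˡ (as , cs) = as ++ [ N ] , cs
  extendʳ (as , cs) = as , cs ++ [ N ]
  extendˡ-injective : ∀ {x y} → extendˡ x ≡ extendˡ y → x ≡ y
  extendˡ-injective {as , cs} {as′ , cs′} eq with ,-injectiveʳ eq
  ... | refl = cong (_, cs) (snoc-injective as as′ (,-injectiveˡ eq))
  extendʳ-injective : ∀ {x y} → extendʳ x ≡ extendʳ y → x ≡ y
  extendʳ-injective {as , cs} {as′ , cs′} eq with ,-injectiveˡ eq
  ... | refl = cong (as ,_) (snoc-injective cs cs′ (,-injectiveʳ eq))
  to : ∀ {p} → (∃ λ q → BallotPair u (2 + h) q × p ≡ extendˡ q) ⊎ (∃ λ q → BallotPair (suc u) h q × p ≡ extendʳ q) →
       BallotPair (suc u) (suc h) p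
  to (inj₁ ((as , cs) , bp , refl)) = BallotPair-maxˡ u (suc h) as cs bp
  to (inj₂ ((as , cs) , bp , refl)) = BallotPair-maxʳ u h as cs bp
  from : ∀ {p} → BallotPair (suc u) (suc h) p →
         (∃ λ q → BallotPair u (2 + h) q × p ≡ extendˡ q) ⊎ (∃ λ q → BallotPair (suc u) h q × p ≡ extendʳ q)
  from {as , cs} bp with BallotPair-max u (suc h) as cs bp
  ... | inj₁ (as′ , refl , bp′) = inj₁ ((as′ , cs) , bp′ , refl)
  ... | inj₂ (_ , refl , cs′ , refl , bp′) = inj₂ ((as , cs′) , bp′ , refl)
  disjoint : ∀ {p} → (∃ λ q → BallotPair u (2 + h) q × p ≡ extendˡ q) → ¬ (∃ λ q → BallotPair (suc u) h q × p ≡ extendʳ q)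
  disjoint ((as , cs) , bp , refl) ((as′ , cs′) , _ , eq) with to (inj₁ ((as , cs) , bp , refl))
  ... | (_ , _ , p , _) = Unique-++-≢ (↭range-unique {2 * suc u + suc h} p) (∈-++⁺ʳ as (here refl))
                            (subst (N ∈_) (sym (,-injectiveʳ eq)) (∈-++⁺ʳ cs′ (here refl))) refl

enum-321-even : ∀ m → Enumeration (Dumont₂Avoiding Is321 (2 * m)) (ballot m 0)
enum-321-even m = enum-⇔ to from (enum-image (λ (as , cs) → interleave as cs) interleave-injective (enum-BallotPair m 0))
  where
  balanced : ∀ {as cs} → BallotPair m 0 (as , cs) → length as ≡ length cs
  balanced (_ , _ , _ , |as| , |cs| , _) = trans |as| (trans (sym (+-identityʳ m)) (sym |cs|))
  interleave-injective : ∀ {p q} → BallotPair m 0 p → BallotPair m 0 q → interleave (proj₁ p) (proj₂ p) ≡ interleave (proj₁ q) (proj₂ q) → p ≡ q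
  interleave-injective {as , cs} {as′ , cs′} bp bq eq with odds-evens-interleave as cs (balanced bp) | odds-evens-interleave as′ cs′ (balanced bq)
  ... | odds≡ , evens≡ | odds≡′ , evens≡′ =
    cong₂ _,_ (trans (sym odds≡) (trans (cong odds eq) odds≡′)) (trans (sym evens≡) (trans (cong evens eq) evens≡′))
  to : ∀ {xs} → (∃ λ p → BallotPair m 0 p × xs ≡ interleave (proj₁ p) (proj₂ p)) → Dumont₂Avoiding Is321 (2 * m) xs
  to ((as , cs) , bp@(ias , ics , p , _ , _ , oas , ecs) , refl) =
    ↭-trans (toPermutation (interleave-Interleaving as cs)) (subst (λ n → as ++ cs ↭ range n) (+-identityʳ (2 * m)) p) ,
    Dumont₂-interleave⁺ 0 as cs (balanced bp) (oas , ecs) , interleave-avoids-321 as cs ias ics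
  from : ∀ {xs} → Dumont₂Avoiding Is321 (2 * m) xs → ∃ λ p → BallotPair m 0 p × xs ≡ interleave (proj₁ p) (proj₂ p)
  from {xs} dxs@(p , d , av) = (odds xs , evens xs) ,
    (odds-increasing xs two-apart , evens-increasing xs two-apart ,
     subst (λ n → odds xs ++ evens xs ↭ range n) (sym (+-identityʳ (2 * m)))
       (↭-trans (↭-sym (toPermutation (interleave-Interleaving (odds xs) (evens xs)))) (subst (_↭ range (2 * m)) (sym (interleave-odds-evens xs)) p)) ,
     proj₁ lengths , trans (proj₂ lengths) (sym (+-identityʳ m)) , bounds) ,
    sym (interleave-odds-evens xs)
    where
    two-apart : TwoApartIncreasing xs
    two-apart = Dumont₂-321-two-apart (2 * m) xs dxs
    lengths : length (odds xs) ≡ m × length (evens xs) ≡ m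
    lengths = length-odds-evens m xs (↭range-length p)
    bounds : OddBounds 0 (odds xs) × EvenBounds 0 (evens xs)
    bounds = Dumont₂-interleave⁻ 0 (odds xs) (evens xs) (trans (proj₁ lengths) (sym (proj₂ lengths)))
               (subst Dumont₂ (sym (interleave-odds-evens xs)) d)

even-or-odd : ∀ n → ∃ λ m → n ≡ 2 * m ⊎ n ≡ suc (2 * m)
even-or-odd zero = 0 , inj₁ refl
even-or-odd (suc n) with even-or-odd n
... | m , inj₁ refl = m , inj₂ refl
... | m , inj₂ refl = suc m , inj₁ (sym (*-suc 2 m))

2+n/2 : ∀ n → suc (suc n) / 2 ≡ suc (n / 2)
2+n/2 n = m/n≡1+[m∸n]/n {suc (suc n)} (s≤s (s≤s z≤n))

2*m/2 : ∀ m → (2 * m) / 2 ≡ m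
2*m/2 zero = refl
2*m/2 (suc m) = trans (cong (_/ 2) (*-suc 2 m)) (trans (2+n/2 (2 * m)) (cong suc (2*m/2 m)))

[1+2*m]/2 : ∀ m → suc (2 * m) / 2 ≡ m
[1+2*m]/2 zero = refl
[1+2*m]/2 (suc m) = trans (cong (λ n → suc n / 2) (*-suc 2 m)) (trans (2+n/2 (suc (2 * m))) (cong suc ([1+2*m]/2 m)))

count≡catalan : ∀ {P : ℕ → List ℕ → Set} {count : ℕ → ℕ} → (∀ n → Enumeration (P n) (count n)) →
                (∀ m → Enumeration (P (2 * m)) (ballot m 0)) → (∀ m → Enumeration (P (suc (2 * m))) (ballot m 0)) →
                ∀ n → count n ≡ catalan (n / 2)
count≡catalan enum-count enum-even enum-odd n with even-or-odd n
... | m , inj₁ refl = trans (enum-size-unique (enum-count (2 * m)) (enum-even m))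
                            (trans (sym (catalan≡ballot m)) (cong catalan (sym (2*m/2 m))))
... | m , inj₂ refl = trans (enum-size-unique (enum-count (suc (2 * m))) (enum-odd m))
                            (trans (sym (catalan≡ballot m)) (cong catalan (sym ([1+2*m]/2 m))))

theorem4p3 : (n : ℕ) →
    (numD2av321 n ≡ catalan (n / 2)) × (numD1av231 n ≡ catalan (n / 2)) × (numD1av312 n ≡ catalan (n / 2))
theorem4p3 n =
  count≡catalan enum-numD2av321 enum-321-even
    (λ m → enum-Dumont₂-odd 321-endsBelow (2 * m) (parity-1+2* m) (enum-321-even m)) n ,
  count≡catalan enum-numD1av231 enum-231-even
    (λ m → enum-Dumont₁-odd 231-endsBelow (2 * m) (parity-1+2* m) (enum-231-even m)) n ,
  count≡catalan enum-numD1av312 (λ m → proj₁ (enum-312-even m))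
    (λ m → enum-Dumont₁-odd 312-endsBelow (2 * m) (parity-1+2* m) (proj₁ (enum-312-even m))) n
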